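{- Let $\mathcal{Q}_n$ be the set of partitions of $[n]$ whose indecomposable components are all totally nested. Then $\mathcal{Q}_n$ is equinumerous with the set $\mathcal{P}_{\rm ncn}(n)$ of partitions of $[n]$ that are both noncrossing and nonnesting, and $|\mathcal{Q}_n|=F_{2n-1}$. Moreover, the elements of $\mathcal{Q}_n$ are in bijection with compositions $(k_1,\dots,k_m)$ of $n$ in which each part $k_i$ is decorated by a totally nested partition of $[k_i]$.
   Context: $F_0=0$, $F_1=1$, $F_n=F_{n-1}+F_{n-2}$ are the Fibonacci numbers. For a partition of $[n]$, an arc $(i,j)$, $i<j$, joins consecutive elements of the same block; arcs $(i_1,j_1),(i_2,j_2)$ cross if $i_1<i_2<j_1<j_2$ and nest if $i_1<i_2<j_2<j_1$; noncrossing/nonnesting means no such pair. A partition of $[n]$ is indecomposable if no subset of its blocks is a partition of $[k]$ with $k<n$; every partition of $[n]$ decomposes uniquely into indecomposable components, i.e. it is obtained by concatenating indecomposable partitions of consecutive intervals $[a,b]$ (each component is relabeled to a partition of $[b-a+1]$). A block $B=\{i_1<\dots<i_r\}$ is nested by a block $B'=\{j_1<\dots<j_s\}$ if $j_\ell<i_1<\dots<i_r<j_{\ell+1}$ for some $\ell$. A partition is totally nested if its blocks can be listed $B_1,\dots,B_k$ with $k=1$ or each $B_i$ ($1<i\le k$) nested by $B_{i-1}$. -}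

module Defs where

open import Data.Nat using (ℕ; zero; suc; _+_; _<_; _≤_)
open import Data.Fin as Fin using (Fin; toℕ)
open import Data.Vec using (Vec; lookup; toList)
open import Data.List using (List; []; _∷_; length; map)
open import Data.Nat.ListAction using (sum)
open import Data.List.Membership.Propositional using (_∈_)
open import Data.List.Relation.Unary.Unique.Propositional using (Unique)
open import Data.List.Relation.Unary.All using (All)
open import Data.List.Relation.Unary.Linked using (Linked)
open import Data.Product using (Σ; ∃; _×_; proj₁)
open import Relation.Binary.PropositionalEquality using (_≡_; _≢_)
open import Relation.Nullary using (¬_)

fib : ℕ → ℕ
fib zero = zero
fib (suc zero) = suc zero
fib (suc (suc n)) = fib (suc n) + fib n

-- Set partitions of [n], encoded canonically as restricted growth
-- strings: element i of [n] (position i-1 of the vector) carries the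
-- label of its block, blocks being numbered 0,1,2,... in order of their
-- minimal elements.  This encoding is a bijection with set partitions of [n].

data RGSFrom : ℕ → List ℕ → Set where
  []  : ∀ {m} → RGSFrom m []
  new : ∀ {m xs} → RGSFrom (suc m) xs → RGSFrom m (m ∷ xs)
  old : ∀ {m x xs} → x < m → RGSFrom m xs → RGSFrom m (x ∷ xs)

IsPartition : ∀ {n} → Vec ℕ n → Set
IsPartition v = RGSFrom 0 (toList v)

module _ {n : ℕ} (v : Vec ℕ n) where

  SameBlock : Fin n → Fin n → Set
  SameBlock i j = lookup v i ≡ lookup v j

  Arc : Fin n → Fin n → Set
  Arc i j = i Fin.< j × SameBlock i j
          × (∀ k → i Fin.< k → k Fin.< j → ¬ SameBlock i k)

  Crossing : Set
  Crossing = ∃ λ i₁ → ∃ λ j₁ → ∃ λ i₂ → ∃ λ j₂ →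
    Arc i₁ j₁ × Arc i₂ j₂ × i₁ Fin.< i₂ × i₂ Fin.< j₁ × j₁ Fin.< j₂

  Nesting : Set
  Nesting = ∃ λ i₁ → ∃ λ j₁ → ∃ λ i₂ → ∃ λ j₂ →
    Arc i₁ j₁ × Arc i₂ j₂ × i₁ Fin.< i₂ × i₂ Fin.< j₂ × j₂ Fin.< j₁

  Noncrossing : Set
  Noncrossing = ¬ Crossing

  Nonnesting : Set
  Nonnesting = ¬ Nesting

  -- k is a cut point: the elements 1..k form a union of blocks, i.e. the
  -- blocks contained in [k] form a partition of [k].
  IsCut : ℕ → Set
  IsCut k = ∀ i j → SameBlock i j → toℕ i < k → toℕ j < k

  -- the interval of positions [a , b) (elements a+1..b) is indecomposable
  -- as a piece of the partition: no cut point strictly inside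
  IndecomposableOn : ℕ → ℕ → Set
  IndecomposableOn a b = ∀ k → a < k → k < b → ¬ IsCut k

  IsComponent : ℕ → ℕ → Set
  IsComponent a b = a < b × b ≤ n × IsCut a × IsCut b × IndecomposableOn a b

  NestedBy : ℕ → ℕ → Set
  NestedBy c c' = ∃ λ p → ∃ λ q →
      p Fin.< q × lookup v p ≡ c' × lookup v q ≡ c'
    × (∀ r → p Fin.< r → r Fin.< q → lookup v r ≢ c')
    × (∀ r → lookup v r ≡ c → p Fin.< r × r Fin.< q)

  -- the blocks meeting positions [a , b) can be listed B₁,…,B_k (each
  -- exactly once) with B_{i} nested by B_{i-1}
  TotallyNestedOn : ℕ → ℕ → Set
  TotallyNestedOn a b = ∃ λ (cs : List ℕ) →
      Unique cs
    × (∀ c → (c ∈ cs → ∃ λ i → a ≤ toℕ i × toℕ i < b × lookup v i ≡ c)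
           × ((∃ λ i → a ≤ toℕ i × toℕ i < b × lookup v i ≡ c) → c ∈ cs))
    × Linked (λ c c' → NestedBy c' c) cs

  ComponentsTotallyNested : Set
  ComponentsTotallyNested = ∀ a b → IsComponent a b → TotallyNestedOn a b

TotallyNested : ∀ {n} → Vec ℕ n → Set
TotallyNested {n} v = TotallyNestedOn v 0 n

InQ : ∀ {n} → Vec ℕ n → Set
InQ v = IsPartition v × ComponentsTotallyNested v

InPncn : ∀ {n} → Vec ℕ n → Set
InPncn v = IsPartition v × Noncrossing v × Nonnesting v

HasCard : {A : Set} → (A → Set) → ℕ → Set
HasCard {A} P N = ∃ λ (L : List A) → Unique L
  × (∀ x → (x ∈ L → P x) × (P x → x ∈ L)) × length L ≡ N

DecoratedPart : Set
DecoratedPart = Σ ℕ (Vec ℕ)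

IsDecoratedComposition : ℕ → List DecoratedPart → Set
IsDecoratedComposition n d =
    All (λ kw → 0 < proj₁ kw × IsPartition (Data.Product.proj₂ kw)
                             × TotallyNested (Data.Product.proj₂ kw)) d
  × sum (map proj₁ d) ≡ n

Bijection : {A B : Set} → (A → Set) → (B → Set) → Set
Bijection {A} {B} P R = ∃ λ (f : A → B) →
    (∀ x → P x → R (f x))
  × (∀ x y → P x → P y → f x ≡ f y → x ≡ y)
  × (∀ z → R z → ∃ λ x → P x × f x ≡ z)

{-# OPTIONS --safe #-}
-- Membership in 𝒬 and in 𝒫_ncn are both equivalent to local conditions on
-- arcs (for 𝒬: noncrossing, the inner neighbours of every long arc share a
-- block, at most one long arc per block), and these conditions hold for a
-- partition exactly when they hold for each of its indecomposable components.
-- So either set is in bijection with the compositions of n decorated by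
-- indecomposable members, and for 𝒬 those are precisely the totally nested
-- partitions.  In both families an indecomposable member of size k + 1 ≥ 2 is
-- obtained in exactly one way from a member of some size j ≤ k by appending a
-- closing element (after a run of zeros, resp. of singletons), so there are
-- 2^(k−2) of size k ≥ 2; the resulting convolution with the number of
-- compositions satisfies the Fibonacci recurrence and equals F (2n − 1).
module Submission where

module ListArcs where

  open import Data.Nat
  open import Data.Nat.Properties
  open import Data.List using (List; []; _∷_; [_]; length; map; _++_; replicate; take; drop)
  open import Data.List.Properties using (length-++; length-take; ∷-injective)
  open import Data.Product using (Σ; _×_; _,_; map₁)
  open import Data.Sum using (_⊎_; inj₁; inj₂)
  open import Data.Empty using (⊥-elim)
  open import Relation.Nullary using (¬_; yes; no)
  open import Relation.Nullary.Decidable using (_×-dec_)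
  open import Relation.Binary.PropositionalEquality hiding ([_])
  open import Relation.Unary using (Decidable; Pred)
  open import Level using (0ℓ)
  open import Relation.Binary using (tri<; tri≈; tri>)

  -- Out of range, at returns the junk value 0.
  at : List ℕ → ℕ → ℕ
  at [] _ = 0
  at (x ∷ xs) zero = x
  at (x ∷ xs) (suc i) = at xs i

  at-ext : ∀ (xs ys : List ℕ) → length xs ≡ length ys → (∀ i → i < length xs → at xs i ≡ at ys i) → xs ≡ ys
  at-ext [] [] _ _ = refl
  at-ext (x ∷ xs) (y ∷ ys) l h = cong₂ _∷_ (h 0 (s≤s z≤n)) (at-ext xs ys (cong pred l) (λ i p → h (suc i) (s≤s p)))

  at-++ˡ : ∀ xs ys i → i < length xs → at (xs ++ ys) i ≡ at xs i
  at-++ˡ (x ∷ xs) ys zero _ = refl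
  at-++ˡ (x ∷ xs) ys (suc i) (s≤s p) = at-++ˡ xs ys i p

  at-++ʳ : ∀ xs ys i → at (xs ++ ys) (length xs + i) ≡ at ys i
  at-++ʳ [] ys i = refl
  at-++ʳ (x ∷ xs) ys i = at-++ʳ xs ys i

  at-map : ∀ f xs i → i < length xs → at (map f xs) i ≡ f (at xs i)
  at-map f (x ∷ xs) zero _ = refl
  at-map f (x ∷ xs) (suc i) (s≤s p) = at-map f xs i p

  at-last : ∀ (v : List ℕ) x → at (v ++ [ x ]) (length v) ≡ x
  at-last v x = trans (cong (at (v ++ [ x ])) (sym (+-identityʳ (length v)))) (at-++ʳ v [ x ] 0)

  at-replicate : ∀ a c i → i < a → at (replicate a c) i ≡ c
  at-replicate (suc a) c zero _ = refl
  at-replicate (suc a) c (suc i) (s≤s p) = at-replicate a c i p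

  at-take : ∀ m (xs : List ℕ) i → i < m → at (take m xs) i ≡ at xs i
  at-take (suc m) [] i _ = refl
  at-take (suc m) (x ∷ xs) zero _ = refl
  at-take (suc m) (x ∷ xs) (suc i) (s≤s p) = at-take m xs i p

  at-drop : ∀ m (xs : List ℕ) i → at (drop m xs) i ≡ at xs (m + i)
  at-drop zero xs i = refl
  at-drop (suc m) [] i = refl
  at-drop (suc m) (x ∷ xs) i = at-drop m xs i

  length-snoc : ∀ {A : Set} (v : List A) x → length (v ++ [ x ]) ≡ suc (length v)
  length-snoc v x = trans (length-++ v) (+-comm (length v) 1)

  length-take≤ : ∀ {A : Set} m (xs : List A) → m ≤ length xs → length (take m xs) ≡ m
  length-take≤ m xs le = trans (length-take m xs) (m≤n⇒m⊓n≡m le)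

  ++-injective : ∀ {A : Set} (xs ys xs' ys' : List A) → length xs ≡ length xs' → xs ++ ys ≡ xs' ++ ys' → xs ≡ xs' × ys ≡ ys'
  ++-injective [] ys [] ys' _ e = refl , e
  ++-injective (x ∷ xs) ys (x' ∷ xs') ys' l e with ∷-injective e
  ... | refl , e' = map₁ (cong (x ∷_)) (++-injective xs ys xs' ys' (cong pred l) e')

  module BoundedSearch (P : Pred ℕ 0ℓ) (P? : Decidable P) where

    first< : ∀ b → (Σ ℕ λ q → P q × q < b × (∀ k → k < q → ¬ P k)) ⊎ (∀ k → k < b → ¬ P k)
    first< zero = inj₂ (λ k ())
    first< (suc b) with first< b
    ... | inj₁ (q , pq , q<b , mn) = inj₁ (q , pq , m<n⇒m<1+n q<b , mn)
    ... | inj₂ none with P? b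
    ...   | yes pb = inj₁ (b , pb , ≤-refl , none)
    ...   | no ¬pb = inj₂ λ k k<sb → below (m<1+n⇒m<n∨m≡n k<sb)
      where
      below : ∀ {k} → k < b ⊎ k ≡ b → ¬ P k
      below (inj₁ k<b) = none _ k<b
      below (inj₂ refl) = ¬pb

    least : ∀ j → P j → Σ ℕ λ q → P q × q ≤ j × (∀ k → k < q → ¬ P k)
    least j pj with first< (suc j)
    ... | inj₁ (q , pq , s≤s q≤j , mn) = q , pq , q≤j , mn
    ... | inj₂ none = ⊥-elim (none j ≤-refl pj)

    last< : ∀ b → (Σ ℕ λ q → P q × q < b × (∀ k → q < k → k < b → ¬ P k)) ⊎ (∀ k → k < b → ¬ P k)
    last< zero = inj₂ (λ k ())
    last< (suc b) with P? b
    ... | yes pb = inj₁ (b , pb , ≤-refl , λ k b<k k<sb → ⊥-elim (<-irrefl refl (≤-trans k<sb b<k)))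
    ... | no ¬pb with last< b
    ...   | inj₁ (q , pq , q<b , mx) = inj₁ (q , pq , m<n⇒m<1+n q<b , λ k q<k k<sb → above q<k (m<1+n⇒m<n∨m≡n k<sb))
      where
      above : ∀ {k} → q < k → k < b ⊎ k ≡ b → ¬ P k
      above q<k (inj₁ k<b) = mx _ q<k k<b
      above q<k (inj₂ refl) = ¬pb
    ...   | inj₂ none = inj₂ λ k k<sb → below (m<1+n⇒m<n∨m≡n k<sb)
      where
      below : ∀ {k} → k < b ⊎ k ≡ b → ¬ P k
      below (inj₁ k<b) = none _ k<b
      below (inj₂ refl) = ¬pb

    greatest : ∀ b j → j < b → P j → Σ ℕ λ q → P q × j ≤ q × q < b × (∀ k → q < k → k < b → ¬ P k)
    greatest b j j<b pj with last< b
    ... | inj₂ none = ⊥-elim (none j j<b pj)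
    ... | inj₁ (q , pq , q<b , mx) with j ≤? q
    ...   | yes j≤q = q , pq , j≤q , q<b , mx
    ...   | no j≰q = ⊥-elim (mx j (≰⇒> j≰q) j<b pj)

  record Arc (xs : List ℕ) (i j : ℕ) : Set where
    constructor arc
    field
      lt : i < j
      bd : j < length xs
      eq : at xs i ≡ at xs j
      btw : ∀ k → i < k → k < j → at xs i ≢ at xs k

  module _ {xs : List ℕ} where

    arc-target-unique : ∀ {i j j'} → Arc xs i j → Arc xs i j' → j ≡ j'
    arc-target-unique {i} {j} {j'} (arc i<j _ e b) (arc i<j' _ e' b') with <-cmp j j'
    ... | tri≈ _ eq _ = eq
    ... | tri< j<j' _ _ = ⊥-elim (b' j i<j j<j' e)
    ... | tri> _ _ j'<j = ⊥-elim (b j' i<j' j'<j e')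

    arc-disjoint : ∀ {i j i' j'} → Arc xs i j → Arc xs i' j' → at xs i ≡ at xs i' → i < i' → j ≤ i'
    arc-disjoint {i} {j} {i'} {j'} (arc i<j _ e b) _ ee i<i' with j ≤? i'
    ... | yes p = p
    ... | no p = ⊥-elim (b i' i<i' (≰⇒> p) ee)

    module _ (c : ℕ) where
      private
        P : Pred ℕ 0ℓ
        P m = at xs m ≡ c
        P? : Decidable P
        P? m = at xs m ≟ c
        Q : ℕ → Pred ℕ 0ℓ
        Q p m = p < m × at xs m ≡ c
        Q? : ∀ p → Decidable (Q p)
        Q? p m = (p <? m) ×-dec (at xs m ≟ c)

      arc-spanning : ∀ {i j k} → at xs i ≡ c → at xs j ≡ c → j < length xs → i < k → k ≤ j →
        Σ ℕ λ p → Σ ℕ λ q → Arc xs p q × at xs p ≡ c × i ≤ p × p < k × k ≤ q × q ≤ j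
      arc-spanning {i} {j} {k} ei ej j<n i<k k≤j
        with BoundedSearch.greatest P P? k i i<k ei
      ... | p , pp , i≤p , p<k , mx
        with BoundedSearch.least (Q p) (Q? p) j (<-≤-trans p<k k≤j , ej)
      ... | q , (p<q , pq) , q≤j , mn
        with k ≤? q
      ... | no k≰q = ⊥-elim (mx q p<q (≰⇒> k≰q) pq)
      ... | yes k≤q = p , q , arc p<q (≤-<-trans q≤j j<n) (trans pp (sym pq)) between , pp , i≤p , p<k , k≤q , q≤j
        where
        between : ∀ r → p < r → r < q → at xs p ≢ at xs r
        between r p<r r<q e = mn r r<q (p<r , trans (sym e) pp)

    arc-over-gap : ∀ {i j k} → at xs i ≡ at xs j → j < length xs → i < k → k < j → at xs k ≢ at xs i →
        Σ ℕ λ p → Σ ℕ λ q → Arc xs p q × at xs p ≡ at xs i × i ≤ p × p < k × k < q × q ≤ j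
    arc-over-gap {i} {j} {k} e j<n i<k k<j ne with arc-spanning (at xs i) refl (sym e) j<n i<k (<⇒≤ k<j)
    ... | p , q , a , ep , i≤p , p<k , k≤q , q≤j with m≤n⇒m<n∨m≡n k≤q
    ... | inj₁ k<q = p , q , a , ep , i≤p , p<k , k<q , q≤j
    ... | inj₂ refl = ⊥-elim (ne (trans (sym (Arc.eq a)) ep))

    arc-from : ∀ {i j} → at xs i ≡ at xs j → i < j → j < length xs →
        Σ ℕ λ q → Arc xs i q × q ≤ j
    arc-from {i} {j} e i<j j<n with arc-spanning (at xs i) refl (sym e) j<n (≤-refl {suc i}) i<j
    ... | p , q , a , ep , i≤p , p<si , _ , q≤j with ≤-antisym i≤p (≤-pred p<si)
    ... | refl = q , a , q≤j

    arc-to : ∀ {i j} → at xs i ≡ at xs j → i < j → j < length xs →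
        Σ ℕ λ p → Arc xs p j × i ≤ p
    arc-to {i} {j} e i<j j<n with arc-spanning (at xs i) refl (sym e) j<n i<j ≤-refl
    ... | p , q , a , ep , i≤p , p<j , j≤q , q≤j with ≤-antisym j≤q q≤j
    ... | refl = p , a , i≤p

module ArcConditions where

  open import Data.Nat
  open import Data.Nat.Properties
  open import Data.List using (List; []; _∷_; length; replicate)
  open import Data.List.Properties using (length-replicate)
  open import Data.Product using (Σ; _×_; _,_; proj₁)
  open import Data.Empty using (⊥; ⊥-elim)
  open import Relation.Nullary using (¬_; Dec; yes; no)
  open import Relation.Nullary.Decidable using (map′; _×-dec_; _→-dec_)
  open import Relation.Binary.PropositionalEquality
  open ListArcs

  Crossfree : List ℕ → Set
  Crossfree xs = ∀ i₁ j₁ i₂ j₂ → Arc xs i₁ j₁ → Arc xs i₂ j₂ → i₁ < i₂ → i₂ < j₁ → j₁ < j₂ → ⊥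

  Nestfree : List ℕ → Set
  Nestfree xs = ∀ i₁ j₁ i₂ j₂ → Arc xs i₁ j₁ → Arc xs i₂ j₂ → i₁ < i₂ → i₂ < j₂ → j₂ < j₁ → ⊥

  InnerEndsJoined : List ℕ → Set
  InnerEndsJoined xs = ∀ i j → Arc xs i (suc j) → i < j → at xs (suc i) ≡ at xs j

  LongArcUnique : List ℕ → Set
  LongArcUnique xs = ∀ i j i' j' → Arc xs i j → Arc xs i' j' → at xs i ≡ at xs i' → suc i < j → suc i' < j' → i ≡ i'

  -- The arc characterisation of 𝒬 (componentsTN⇒QArcs, QArcs⇒componentsTN).
  QArcs : List ℕ → Set
  QArcs xs = Crossfree xs × InnerEndsJoined xs × LongArcUnique xs

  PncnArcs : List ℕ → Set
  PncnArcs xs = Crossfree xs × Nestfree xs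

  Cut : List ℕ → ℕ → Set
  Cut xs k = ∀ i j → i < length xs → j < length xs → at xs i ≡ at xs j → i < k → j < k

  Indecomposable : List ℕ → Set
  Indecomposable xs = ∀ k → 0 < k → k < length xs → ¬ Cut xs k

  cut-no-arc-over : ∀ {xs k i j} → Cut xs k → Arc xs i j → i < k → k ≤ j → ⊥
  cut-no-arc-over {i = i} {j} cut (arc i<j j<n e _) i<k k≤j =
    <-irrefl refl (<-≤-trans (cut i j (<-trans i<j j<n) j<n e i<k) k≤j)

  cut? : ∀ xs k → Dec (Cut xs k)
  cut? xs k = map′ (λ h i j i<n j<n e i<k → h i<n j<n e i<k) (λ c {i} i<n {j} j<n e i<k → c i j i<n j<n e i<k)
    (allUpTo? (λ i → allUpTo? (λ j → (at xs i ≟ at xs j) →-dec (i <? k) →-dec (j <? k)) (length xs)) (length xs))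

  nonCut⇒arc : ∀ {xs k} → ¬ Cut xs k → Σ ℕ λ i → Σ ℕ λ j → Arc xs i j × i < k × k ≤ j
  nonCut⇒arc {xs} {k} nc with anyUpTo? (λ i → anyUpTo? (λ j → (at xs i ≟ at xs j) ×-dec (i <? k) ×-dec (k ≤? j)) (length xs)) (length xs)
  ... | no none = ⊥-elim (nc λ i j i<n j<n e i<k → ≰⇒> λ k≤j → none (i , i<n , j , j<n , e , i<k , k≤j))
  ... | yes (i , i<n , j , j<n , e , i<k , k≤j) with arc-spanning (at xs i) refl (sym e) j<n i<k k≤j
  ...   | p , q , a , _ , _ , p<k , k≤q , _ = p , q , a , p<k , k≤q

  ShortArcs : List ℕ → Set
  ShortArcs xs = ∀ i j → Arc xs i j → j ≡ suc i

  short⇒QArcs : ∀ {xs} → ShortArcs xs → QArcs xs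
  short⇒QArcs {xs} s = (λ i₁ j₁ i₂ j₂ a₁ a₂ p q r → <-irrefl refl (<-≤-trans q (subst (_≤ i₂) (sym (s _ _ a₁)) p))) ,
    (λ i j a i<j → ⊥-elim (<-irrefl refl (<-≤-trans i<j (≤-pred (≤-reflexive (s _ _ a)))))) ,
    (λ i j i' j' a a' e li li' → ⊥-elim (<-irrefl refl (subst (suc i <_) (s _ _ a) li)))

  short⇒PncnArcs : ∀ {xs} → ShortArcs xs → PncnArcs xs
  short⇒PncnArcs {xs} s = proj₁ (short⇒QArcs s) ,
    λ i₁ j₁ i₂ j₂ a₁ a₂ p q r → <-irrefl refl (<-trans p (<-≤-trans q (≤-pred (subst (j₂ <_) (s _ _ a₁) r))))

  replicate-short : ∀ a c → ShortArcs (replicate a c)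
  replicate-short a c i j (arc l b e w) with suc i <? j
  ... | no ns = ≤-antisym (≮⇒≥ ns) l
  ... | yes si<j = ⊥-elim (w (suc i) ≤-refl si<j (trans (at-replicate a c i (<-trans l b')) (sym (at-replicate a c (suc i) (<-trans si<j b')))))
    where b' = subst (j <_) (length-replicate a) b

  singleton-short : ∀ {x} → ShortArcs (x ∷ [])
  singleton-short i zero (arc () _ _ _)
  singleton-short i (suc j) (arc _ (s≤s ()) _ _)

  []-short : ShortArcs []
  []-short i j (arc _ () _ _)

  arcs-over⇒indecomposable : ∀ {xs} → (∀ c → 0 < c → c < length xs → Σ ℕ λ i → Σ ℕ λ j → Arc xs i j × i < c × c ≤ j) → Indecomposable xs
  arcs-over⇒indecomposable {xs} h c 0<c c<n ct with h c 0<c c<n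
  ... | i , j , a , i<c , c≤j = cut-no-arc-over ct a i<c c≤j

module ListEncoding where

  open import Data.Nat
  open import Data.Nat.Properties
  open import Data.Fin as Fin using (Fin; toℕ; fromℕ<)
  open import Data.Fin.Properties using (toℕ<n; toℕ-fromℕ<)
  open import Data.Vec using (Vec; lookup; toList; []; _∷_)
  open import Data.Vec.Properties using (length-toList; toList-injective; cast-is-id)
  open import Data.List as List using (List; length)
  open import Data.List.Membership.Propositional using (_∈_)
  open import Data.List.Relation.Unary.Unique.Propositional using (Unique)
  open import Data.List.Relation.Unary.Linked as Linked using (Linked)
  open import Data.Product using (Σ; ∃; _×_; _,_; proj₁; proj₂)
  open import Relation.Nullary using (¬_)
  open import Relation.Binary.PropositionalEquality
  open ListArcs
  open ArcConditions
  import Defs as D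

  -- The development works with the list toList v and natural-number positions
  -- rather than with v and Fin positions; every notion of Defs has a list
  -- counterpart (suffix L where the names would clash), and FromVec translates
  -- in both directions.
  lookup≡at : ∀ {m} (w : Vec ℕ m) (i : Fin m) → lookup w i ≡ at (toList w) (toℕ i)
  lookup≡at (x ∷ w) Fin.zero = refl
  lookup≡at (x ∷ w) (Fin.suc i) = lookup≡at w i

  -- Pads with 0 when the list is too short; only applied to lists of length n.
  toVec : (n : ℕ) → List ℕ → Vec ℕ n
  toVec zero _ = []
  toVec (suc n) List.[] = 0 ∷ toVec n List.[]
  toVec (suc n) (x List.∷ xs) = x ∷ toVec n xs

  toList-toVec : ∀ n xs → length xs ≡ n → toList (toVec n xs) ≡ xs
  toList-toVec zero List.[] _ = refl
  toList-toVec (suc n) (x List.∷ xs) e = cong (x List.∷_) (toList-toVec n xs (cong pred e))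

  toList-injective′ : ∀ {n} (v w : Vec ℕ n) → toList v ≡ toList w → v ≡ w
  toList-injective′ v w e = trans (sym (cast-is-id refl v)) (toList-injective refl v w e)

  record NestedByL (xs : List ℕ) (c c' : ℕ) : Set where
    constructor nbl
    field
      p q : ℕ
      p<q : p < q
      q<n : q < length xs
      ep : at xs p ≡ c'
      eq : at xs q ≡ c'
      btw : ∀ r → p < r → r < q → at xs r ≢ c'
      inn : ∀ r → r < length xs → at xs r ≡ c → p < r × r < q

  OccursIn : List ℕ → ℕ → ℕ → ℕ → Set
  OccursIn xs a b c = Σ ℕ λ i → i < length xs × a ≤ i × i < b × at xs i ≡ c

  TotallyNestedL : List ℕ → ℕ → ℕ → Set
  TotallyNestedL xs a b = Σ (List ℕ) λ cs → Unique cs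
    × (∀ c → (c ∈ cs → OccursIn xs a b c) × (OccursIn xs a b c → c ∈ cs))
    × Linked (λ c c' → NestedByL xs c' c) cs

  ComponentL : List ℕ → ℕ → ℕ → Set
  ComponentL xs a b = a < b × b ≤ length xs × Cut xs a × Cut xs b × (∀ k → a < k → k < b → ¬ Cut xs k)

  ComponentsTotallyNestedL : List ℕ → Set
  ComponentsTotallyNestedL xs = ∀ a b → ComponentL xs a b → TotallyNestedL xs a b

  indecomposable⇒component : ∀ {xs} → Indecomposable xs → 0 < length xs → ComponentL xs 0 (length xs)
  indecomposable⇒component {xs} ind 0<n = 0<n , ≤-refl , (λ i j _ _ _ ()) , (λ i j _ j<n _ _ → j<n) , λ k 0<k k<n → ind k 0<k k<n

  module FromVec {n : ℕ} (v : Vec ℕ n) where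
    xs : List ℕ
    xs = toList v

    lenEq : length xs ≡ n
    lenEq = length-toList v

    bnd : ∀ (i : Fin n) → toℕ i < length xs
    bnd i = subst (toℕ i <_) (sym lenEq) (toℕ<n i)

    fin : ∀ {i} → i < length xs → Fin n
    fin p = fromℕ< (subst (_ <_) lenEq p)

    tf : ∀ {i} (p : i < length xs) → toℕ (fin p) ≡ i
    tf p = toℕ-fromℕ< _

    atf : ∀ {i} (p : i < length xs) → lookup v (fin p) ≡ at xs i
    atf p = trans (lookup≡at v (fin p)) (cong (at xs) (tf p))

    cast< : ∀ {a b c d} → a ≡ b → c ≡ d → b < d → a < c
    cast< refl refl p = p
    cast≤ : ∀ {a b c d} → a ≡ b → c ≡ d → b ≤ d → a ≤ c
    cast≤ refl refl p = p

    arcTo : ∀ {i j} → D.Arc v i j → Arc xs (toℕ i) (toℕ j)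
    arcTo {i} {j} (i<j , e , b) = arc i<j (bnd j) (trans (sym (lookup≡at v i)) (trans e (lookup≡at v j))) bt
      where
      bt : ∀ k → toℕ i < k → k < toℕ j → at xs (toℕ i) ≢ at xs k
      bt k i<k k<j ek = b (fin kn) (cast< refl (tf kn) i<k) (cast< (tf kn) refl k<j)
         (trans (lookup≡at v i) (trans ek (sym (atf kn))))
        where kn = <-trans k<j (bnd j)

    arcFrom : ∀ {i j} (a : Arc xs i j) →
      D.Arc v (fin (<-trans (Arc.lt a) (Arc.bd a))) (fin (Arc.bd a))
    arcFrom {i} {j} (arc i<j j<n e b) =
      cast< (tf jn') (tf j<n) i<j ,
      trans (atf jn') (trans e (sym (atf j<n))) ,
      λ k i<k k<j ek → b (toℕ k) (cast< (sym (tf jn')) refl i<k) (cast< refl (sym (tf j<n)) k<j)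
         (trans (sym (atf jn')) (trans ek (lookup≡at v k)))
      where jn' = <-trans i<j j<n

    ncnTo : D.Noncrossing v → Crossfree xs
    ncnTo nc i₁ j₁ i₂ j₂ a₁@(arc p1 q1 _ _) a₂@(arc p2 q2 _ _) p q r = nc (_ , _ , _ , _ , arcFrom a₁ , arcFrom a₂ ,
      cast< (tf (<-trans p1 q1)) (tf (<-trans p2 q2)) p , cast< (tf (<-trans p2 q2)) (tf q1) q ,
      cast< (tf q1) (tf q2) r)

    ncnFrom : Crossfree xs → D.Noncrossing v
    ncnFrom n1 (i₁ , j₁ , i₂ , j₂ , a₁ , a₂ , p , q , r) = n1 _ _ _ _ (arcTo a₁) (arcTo a₂) p q r

    nnTo : D.Nonnesting v → Nestfree xs
    nnTo nc i₁ j₁ i₂ j₂ a₁@(arc p1 q1 _ _) a₂@(arc p2 q2 _ _) p q r = nc (_ , _ , _ , _ , arcFrom a₁ , arcFrom a₂ ,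
      cast< (tf (<-trans p1 q1)) (tf (<-trans p2 q2)) p , cast< (tf (<-trans p2 q2)) (tf q2) q ,
      cast< (tf q2) (tf q1) r)

    nnFrom : Nestfree xs → D.Nonnesting v
    nnFrom n1 (i₁ , j₁ , i₂ , j₂ , a₁ , a₂ , p , q , r) = n1 _ _ _ _ (arcTo a₁) (arcTo a₂) p q r

    cutTo : ∀ {k} → D.IsCut v k → Cut xs k
    cutTo c i j i<n j<n e i<k = cast< (sym (tf j<n)) refl
      (c (fin i<n) (fin j<n) (trans (atf i<n) (trans e (sym (atf j<n)))) (cast< (tf i<n) refl i<k))

    cutFrom : ∀ {k} → Cut xs k → D.IsCut v k
    cutFrom c i j e i<k = c (toℕ i) (toℕ j) (bnd i) (bnd j) (trans (sym (lookup≡at v i)) (trans e (lookup≡at v j))) i<k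

    compTo : ∀ {a b} → D.IsComponent v a b → ComponentL xs a b
    compTo (a<b , b≤n , ca , cb , ind) = a<b , subst (_ ≤_) (sym lenEq) b≤n , cutTo ca , cutTo cb ,
      λ k a<k k<b ck → ind k a<k k<b (cutFrom ck)

    compFrom : ∀ {a b} → ComponentL xs a b → D.IsComponent v a b
    compFrom (a<b , b≤n , ca , cb , ind) = a<b , subst (_ ≤_) lenEq b≤n , cutFrom ca , cutFrom cb ,
      λ k a<k k<b ck → ind k a<k k<b (cutTo ck)

    nbTo : ∀ {c c'} → D.NestedBy v c c' → NestedByL xs c c'
    nbTo {c} {c'} (p , q , p<q , ep , eq , btw , inn) = nbl (toℕ p) (toℕ q) p<q (bnd q)
      (trans (sym (lookup≡at v p)) ep) (trans (sym (lookup≡at v q)) eq) bt ii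
      where
      bt : ∀ r → toℕ p < r → r < toℕ q → at xs r ≢ c'
      bt r p<r r<q er = btw (fin rn) (cast< refl (tf rn) p<r) (cast< (tf rn) refl r<q) (trans (atf rn) er)
        where rn = <-trans r<q (bnd q)
      ii : ∀ r → r < length xs → at xs r ≡ c → toℕ p < r × r < toℕ q
      ii r r<n er with inn (fin r<n) (trans (atf r<n) er)
      ... | x , y = cast< refl (sym (tf r<n)) x , cast< (sym (tf r<n)) refl y

    nbFrom : ∀ {c c'} → NestedByL xs c c' → D.NestedBy v c c'
    nbFrom {c} {c'} (nbl p q p<q q<n ep eq btw inn) = fin pn , fin q<n ,
      cast< (tf pn) (tf q<n) p<q , trans (atf pn) ep , trans (atf q<n) eq , bt , ii
      where
      pn : p < length xs
      pn = <-trans p<q q<n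
      bt : ∀ r → fin pn Fin.< r → r Fin.< fin q<n → lookup v r ≢ c'
      bt r p<r r<q er = btw (toℕ r) (cast< (sym (tf pn)) refl p<r) (cast< refl (sym (tf q<n)) r<q)
         (trans (sym (lookup≡at v r)) er)
      ii : ∀ r → lookup v r ≡ c → fin pn Fin.< r × r Fin.< fin q<n
      ii r er with inn (toℕ r) (bnd r) (trans (sym (lookup≡at v r)) er)
      ... | x , y = cast< (tf pn) refl x , cast< refl (tf q<n) y

    irTo : ∀ {a b c} → (∃ λ i → a ≤ toℕ i × toℕ i < b × lookup v i ≡ c) → OccursIn xs a b c
    irTo (i , a≤i , i<b , e) = toℕ i , bnd i , a≤i , i<b , trans (sym (lookup≡at v i)) e

    irFrom : ∀ {a b c} → OccursIn xs a b c → (∃ λ i → a ≤ toℕ i × toℕ i < b × lookup v i ≡ c)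
    irFrom (i , i<n , a≤i , i<b , e) = fin i<n , cast≤ refl (tf i<n) a≤i ,
      cast< (tf i<n) refl i<b , trans (atf i<n) e

    tnTo : ∀ {a b} → D.TotallyNestedOn v a b → TotallyNestedL xs a b
    tnTo (cs , u , sp , lk) = cs , u , (λ c → (λ m → irTo (proj₁ (sp c) m)) , λ r → proj₂ (sp c) (irFrom r)) ,
      Linked.map nbTo lk

    tnFrom : ∀ {a b} → TotallyNestedL xs a b → D.TotallyNestedOn v a b
    tnFrom (cs , u , sp , lk) = cs , u , (λ c → (λ m → irFrom (proj₁ (sp c) m)) , λ r → proj₂ (sp c) (irTo r)) ,
      Linked.map nbFrom lk

    ctnTo : D.ComponentsTotallyNested v → ComponentsTotallyNestedL xs
    ctnTo h a b c = tnTo (h a b (compFrom c))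

    ctnFrom : ComponentsTotallyNestedL xs → D.ComponentsTotallyNested v
    ctnFrom h a b c = tnFrom (h a b (compTo c))

module TotallyNestedArcs where

  open import Data.Nat
  open import Data.Nat.Properties
  open import Data.List using (List; _∷_; length)
  open import Data.List.Membership.Propositional using (_∈_)
  open import Data.List.Relation.Unary.Any using (here; there)
  import Data.List.Relation.Unary.All as All
  open import Data.List.Relation.Unary.AllPairs using (AllPairs; _∷_)
  open import Data.List.Relation.Unary.Linked.Properties using (Linked⇒AllPairs)
  open import Data.Product using (Σ; _×_; _,_; proj₁; proj₂)
  open import Data.Sum using (_⊎_; inj₁; inj₂)
  open import Data.Empty using (⊥; ⊥-elim)
  open import Relation.Nullary using (¬_; yes; no)
  open import Relation.Nullary.Decidable using (_×-dec_)
  open import Relation.Binary.PropositionalEquality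
  open import Relation.Binary using (tri<; tri≈; tri>)
  open ListArcs
  open ArcConditions
  open ListEncoding

  componentOf : ∀ xs i → i < length xs → Σ ℕ λ a → Σ ℕ λ b → ComponentL xs a b × a ≤ i × i < b
  componentOf xs i i<n
    with BoundedSearch.greatest (Cut xs) (cut? xs) (suc i) 0 (s≤s z≤n) (λ _ _ _ _ _ ())
       | BoundedSearch.least (λ k → i < k × Cut xs k) (λ k → (i <? k) ×-dec cut? xs k) (length xs)
           (i<n , λ _ j _ j<n _ _ → j<n)
  ... | a , ca , _ , a<si , mx | b , (i<b , cb) , b≤n , mn =
    a , b , (≤-<-trans (≤-pred a<si) i<b , b≤n , ca , cb , ind) , ≤-pred a<si , i<b
    where
    ind : ∀ k → a < k → k < b → ¬ Cut xs k
    ind k a<k k<b ck with k ≤? i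
    ... | yes k≤i = mx k a<k (s≤s k≤i) ck
    ... | no k≰i = mn k k<b (≰⇒> k≰i , ck)

  arcs-of-a-block : ∀ {xs i j p q} → Arc xs i j → Arc xs p q → at xs i ≡ at xs p →
    (i ≡ p × j ≡ q) ⊎ (j ≤ p ⊎ q ≤ i)
  arcs-of-a-block {xs} {i} {j} {p} {q} a b e with <-cmp i p
  ... | tri≈ _ refl _ = inj₁ (refl , arc-target-unique a b)
  ... | tri< i<p _ _ = inj₂ (inj₁ (arc-disjoint a b e i<p))
  ... | tri> _ _ p<i = inj₂ (inj₂ (arc-disjoint b a (sym e) p<i))

  nestedBy-arc : ∀ {xs c c'} (nb : NestedByL xs c c') → Arc xs (NestedByL.p nb) (NestedByL.q nb)
  nestedBy-arc {xs} {c} {c'} (nbl p q p<q q<n ep eq btw inn) =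
    arc p<q q<n (trans ep (sym eq)) λ r p<r r<q e → btw r p<r r<q (trans (sym e) ep)

  nestedBy-gap : ∀ {xs c c' i j k} (nb : NestedByL xs c c') → Arc xs i j → at xs i ≡ c' →
    i < k → k < j → at xs k ≡ c → NestedByL.p nb ≡ i × NestedByL.q nb ≡ j
  nestedBy-gap {xs} {c} {c'} {i} {j} {k} nb@(nbl p q p<q q<n ep eq btw inn) a ei i<k k<j ek
    with inn k (<-trans k<j (Arc.bd a)) ek
  ... | p<k , k<q with arcs-of-a-block a (nestedBy-arc nb) (trans ei (sym ep))
  ... | inj₁ (e1 , e2) = sym e1 , sym e2
  ... | inj₂ (inj₁ j≤p) = ⊥-elim (<-irrefl refl (<-trans p<k (<-≤-trans k<j j≤p)))
  ... | inj₂ (inj₂ q≤i) = ⊥-elim (<-irrefl refl (<-trans k<q (≤-<-trans q≤i i<k)))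

  nestedBy-not-between : ∀ {xs c x i j k} → NestedByL xs c x → at xs i ≡ c → at xs j ≡ c → i < k → k < j → j < length xs →
    at xs k ≡ x → ⊥
  nestedBy-not-between {xs} {c} {x} {i} {j} {k} (nbl p q p<q q<n ep eq btw inn) ei ej i<k k<j j<n ek
    with inn i (<-trans (<-trans i<k k<j) j<n) ei | inn j j<n ej
  ... | p<i , _ | _ , j<q = btw k (<-trans p<i i<k) (<-trans k<j j<q) ek

  nestedBy-trans : ∀ {xs a b c} → NestedByL xs b a → NestedByL xs c b → NestedByL xs c a
  nestedBy-trans {xs} {a} {b} {c} (nbl p q p<q q<n ep eq btw inn) (nbl p' q' p'<q' q'<n ep' eq' btw' inn')
    with inn p' (<-trans p'<q' q'<n) ep' | inn q' q'<n eq'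
  ... | p<p' , _ | _ , q'<q = nbl p q p<q q<n ep eq btw
    λ r r<n er → let (x , y) = inn' r r<n er in <-trans p<p' x , <-trans y q'<q

  allPairs-either : ∀ {A : Set} {R : A → A → Set} {cs x y} → AllPairs R cs → x ∈ cs → y ∈ cs → x ≢ y → R x y ⊎ R y x
  allPairs-either (h ∷ t) (here refl) (here refl) ne = ⊥-elim (ne refl)
  allPairs-either (h ∷ t) (here refl) (there m) ne = inj₁ (All.lookup h m)
  allPairs-either (h ∷ t) (there m) (here refl) ne = inj₂ (All.lookup h m)
  allPairs-either (h ∷ t) (there m) (there m') ne = allPairs-either t m m' ne

  Comparable : List ℕ → ℕ → ℕ → Set
  Comparable xs a b = ∀ c c' → OccursIn xs a b c → OccursIn xs a b c' → c ≢ c' → NestedByL xs c c' ⊎ NestedByL xs c' c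

  tn⇒comparable : ∀ {xs a b} → TotallyNestedL xs a b → Comparable xs a b
  tn⇒comparable {xs} (cs , u , sp , lk) c c' r r' ne with allPairs-either (Linked⇒AllPairs nestedBy-trans lk)
    (proj₂ (sp c) r) (proj₂ (sp c') r') ne
  ... | inj₁ x = inj₂ x
  ... | inj₂ y = inj₁ y

  module Necessity {xs : List ℕ} (h : ComponentsTotallyNestedL xs) where

    -- If i and e lie in one block, all of [i , e] lies in one component, whose
    -- blocks are pairwise comparable under nesting.
    record SpanContext (i e : ℕ) : Set where
      field
        a b : ℕ
        a≤i : a ≤ i
        e<b : e < b
        cmp : Comparable xs a b

    spanContext : ∀ {i e} → at xs i ≡ at xs e → i < e → e < length xs → SpanContext i e
    spanContext {i} {e} eq i<e e<n with componentOf xs i (<-trans i<e e<n)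
    ... | a , b , comp@(_ , _ , _ , cb , _) , a≤i , i<b =
      record { a = a ; b = b ; a≤i = a≤i ; e<b = cb i e (<-trans i<e e<n) e<n eq i<b ; cmp = tn⇒comparable (h a b comp) }

    comparableIn : ∀ {i e} → SpanContext i e → ∀ k k' → i ≤ k → k < e → i ≤ k' → k' < e → e < length xs → at xs k ≢ at xs k' →
      NestedByL xs (at xs k) (at xs k') ⊎ NestedByL xs (at xs k') (at xs k)
    comparableIn c k k' i≤k k≤e i≤k' k'≤e e<n ne =
      SpanContext.cmp c (at xs k) (at xs k')
        (k , <-trans k≤e e<n , ≤-trans (SpanContext.a≤i c) i≤k , <-trans k≤e (SpanContext.e<b c) , refl)
        (k' , <-trans k'≤e e<n , ≤-trans (SpanContext.a≤i c) i≤k' , <-trans k'≤e (SpanContext.e<b c) , refl) ne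

    crossfree : Crossfree xs
    crossfree i₁ j₁ i₂ j₂ a₁@(arc l₁ b₁ e₁ w₁) a₂@(arc l₂ b₂ e₂ w₂) p q r
      with comparableIn (spanContext e₁ l₁ b₁) i₁ i₂ ≤-refl l₁ (<⇒≤ p) q b₁ (λ e → <-irrefl refl (<-≤-trans q (arc-disjoint a₁ a₂ e p)))
    ... | inj₁ nb = nestedBy-not-between nb refl (sym e₁) p q b₁ refl
    ... | inj₂ nb with nestedBy-gap nb a₁ refl p q refl
    ...   | refl , refl = <-irrefl refl (<-trans r (proj₂ (NestedByL.inn nb j₂ b₂ (sym e₂))))

    innerEndsJoined : InnerEndsJoined xs
    innerEndsJoined i j a@(arc l b e w) i<j with at xs (suc i) ≟ at xs j
    ... | yes eq = eq
    ... | no ne = ⊥-elim (go (comparableIn C (suc i) j (n≤1+n i) (s≤s i<j) (<⇒≤ i<j) ≤-refl b ne))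
      where
      C : SpanContext i (suc j)
      C = spanContext e l b
      xc : at xs (suc i) ≢ at xs i
      xc q = w (suc i) ≤-refl (s≤s i<j) (sym q)
      yc : at xs j ≢ at xs i
      yc q = w j i<j ≤-refl (sym q)
      go : NestedByL xs (at xs (suc i)) (at xs j) ⊎ NestedByL xs (at xs j) (at xs (suc i)) → ⊥
      go (inj₂ nyx) with comparableIn C (suc i) i (n≤1+n i) (s≤s i<j) ≤-refl l b xc
      ... | inj₂ ncx = nestedBy-not-between ncx refl (sym e) (≤-refl) (s≤s i<j) b refl
      ... | inj₁ nxc with nestedBy-gap nxc a refl ≤-refl (s≤s i<j) refl
      ...   | p'≡ , q'≡ = <-irrefl refl (<-≤-trans j<Q (≤-pred (subst (NestedByL.q nyx <_) q'≡ Qlt)))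
        where
        j<Q : j < NestedByL.q nyx
        j<Q = proj₂ (NestedByL.inn nyx j (<-trans ≤-refl b) refl)
        Qlt : NestedByL.q nyx < NestedByL.q nxc
        Qlt = proj₂ (NestedByL.inn nxc (NestedByL.q nyx) (NestedByL.q<n nyx) (NestedByL.eq nyx))
      go (inj₁ nxy) with comparableIn C j i (<⇒≤ i<j) ≤-refl ≤-refl l b yc
      ... | inj₂ ncy = nestedBy-not-between ncy refl (sym e) i<j ≤-refl b refl
      ... | inj₁ nyc with nestedBy-gap nyc a refl i<j ≤-refl refl
      ...   | p'≡ , q'≡ = <-irrefl refl (<-≤-trans (subst (_< NestedByL.p nxy) p'≡ iP) (≤-pred P<si))
        where
        P<si : NestedByL.p nxy < suc i
        P<si = proj₁ (NestedByL.inn nxy (suc i) (<-≤-trans (s≤s i<j) (<⇒≤ b)) refl)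
        iP : NestedByL.p nyc < NestedByL.p nxy
        iP = proj₁ (NestedByL.inn nyc (NestedByL.p nxy) (<-trans (NestedByL.p<q nxy) (NestedByL.q<n nxy)) (NestedByL.ep nxy))

    -- The blocks of i+1 and i'+1 are nested by the block of i inside the gaps
    -- (i , j) and (i' , j'), so neither of them can nest the other.
    twoLongArcs-absurd : ∀ i j i' j' → Arc xs i j → Arc xs i' j' → at xs i ≡ at xs i' → suc i < j → suc i' < j' → i < i' → ⊥
    twoLongArcs-absurd i j i' j' a@(arc l b e w) a'@(arc l' b' e' w') ee li li' ii' = go
      where
      j≤i' : j ≤ i'
      j≤i' = arc-disjoint a a' ee ii'
      i<j' : i < j'
      i<j' = <-trans ii' l'
      C : SpanContext i j'
      C = spanContext (trans ee e') i<j' b'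
      x y : ℕ
      x = at xs (suc i)
      y = at xs (suc i')
      xc : x ≢ at xs i
      xc q = w (suc i) ≤-refl li (sym q)
      yc : y ≢ at xs i
      yc q = w' (suc i') ≤-refl li' (trans (sym ee) (sym q))
      noCX : NestedByL xs (at xs i) x → ⊥
      noCX ncx = nestedBy-not-between ncx refl (sym e) ≤-refl li b refl
      noCY : NestedByL xs (at xs i) y → ⊥
      noCY ncy = nestedBy-not-between ncy (sym ee) (sym (trans ee e')) ≤-refl li' b' refl
      go : ⊥
      go with x ≟ y
      ... | yes xy with comparableIn C (suc i) i (n≤1+n i) (<-≤-trans li (≤-trans j≤i' (<⇒≤ l'))) ≤-refl i<j' b' xc
      ...   | inj₂ ncx = noCX ncx
      ...   | inj₁ nxc with nestedBy-gap nxc a refl ≤-refl li refl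
      ...     | _ , q≡ = <-irrefl refl (<-≤-trans (subst (suc i' <_) q≡ lt) (≤-trans j≤i' (n≤1+n i')))
        where
        lt : suc i' < NestedByL.q nxc
        lt = proj₂ (NestedByL.inn nxc (suc i') (<-trans li' b') (sym xy))
      go | no ne with comparableIn C (suc i) (suc i') (n≤1+n i) (<-≤-trans li (≤-trans j≤i' (<⇒≤ l'))) (≤-trans (n≤1+n i) (s≤s (<⇒≤ ii'))) li' b' ne
      ... | inj₂ nyx with comparableIn C (suc i) i (n≤1+n i) (<-≤-trans li (≤-trans j≤i' (<⇒≤ l'))) ≤-refl i<j' b' xc
      ...   | inj₂ ncx = noCX ncx
      ...   | inj₁ nxc with nestedBy-gap nxc a refl ≤-refl li refl
      ...     | _ , q≡ = <-irrefl refl (<-≤-trans (<-trans si'<Q (subst (NestedByL.q nyx <_) q≡ Q<q)) (≤-trans j≤i' (n≤1+n i')))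
        where
        si'<Q : suc i' < NestedByL.q nyx
        si'<Q = proj₂ (NestedByL.inn nyx (suc i') (<-trans li' b') refl)
        Q<q : NestedByL.q nyx < NestedByL.q nxc
        Q<q = proj₂ (NestedByL.inn nxc (NestedByL.q nyx) (NestedByL.q<n nyx) (NestedByL.eq nyx))
      go | no ne | inj₁ nxy with comparableIn C (suc i') i (≤-trans (n≤1+n i) (s≤s (<⇒≤ ii'))) li' ≤-refl i<j' b' yc
      ...   | inj₂ ncy = noCY ncy
      ...   | inj₁ nyc with nestedBy-gap nyc a' (sym ee) ≤-refl li' refl
      ...     | p≡ , _ = <-irrefl refl (<-≤-trans (subst (_< NestedByL.p nxy) p≡ i'<P) (≤-trans (≤-pred P<si) (<⇒≤ ii')))
        where
        P<si : NestedByL.p nxy < suc i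
        P<si = proj₁ (NestedByL.inn nxy (suc i) (<-≤-trans li (<⇒≤ b)) refl)
        i'<P : NestedByL.p nyc < NestedByL.p nxy
        i'<P = proj₁ (NestedByL.inn nyc (NestedByL.p nxy) (<-trans (NestedByL.p<q nxy) (NestedByL.q<n nxy)) (NestedByL.ep nxy))

    longArcUnique : LongArcUnique xs
    longArcUnique i j i' j' a a' ee li li' with <-cmp i i'
    ... | tri≈ _ eq _ = eq
    ... | tri< ii' _ _ = ⊥-elim (twoLongArcs-absurd i j i' j' a a' ee li li' ii')
    ... | tri> _ _ i'i = ⊥-elim (twoLongArcs-absurd i' j' i j a' a (sym ee) li' li i'i)

  componentsTN⇒QArcs : ∀ {xs} → ComponentsTotallyNestedL xs → QArcs xs
  componentsTN⇒QArcs h = Necessity.crossfree h , Necessity.innerEndsJoined h , Necessity.longArcUnique h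

module ArcsTotallyNested where

  open import Data.Nat
  open import Data.Nat.Properties
  open import Data.List using (List; []; _∷_; length)
  open import Data.List.Membership.Propositional using (_∈_)
  open import Data.List.Relation.Unary.Any using (here; there)
  open import Data.List.Relation.Unary.All using ([]; _∷_; tabulate)
  open import Data.List.Relation.Unary.AllPairs using ([]; _∷_)
  open import Data.List.Relation.Unary.Unique.Propositional using (Unique)
  open import Data.List.Relation.Unary.Linked using (Linked; []; [-]; _∷_)
  open import Data.Product using (Σ; _×_; _,_; proj₁; proj₂)
  open import Data.Sum using (inj₁; inj₂)
  open import Data.Empty using (⊥; ⊥-elim)
  open import Relation.Nullary using (yes; no; ¬?)
  open import Relation.Nullary.Decidable using (_×-dec_)
  open import Relation.Binary.PropositionalEquality
  open ListArcs
  open ArcConditions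
  open ListEncoding

  module Sufficiency {xs : List ℕ} (nl : QArcs xs) where
    n1 : Crossfree xs
    n1 = proj₁ nl
    n2 : InnerEndsJoined xs
    n2 = proj₁ (proj₂ nl)
    n3 : LongArcUnique xs
    n3 = proj₂ (proj₂ nl)

    Nests : ℕ → ℕ → Set
    Nests c c' = NestedByL xs c' c

    -- If the last occurrence L of the first block lay before the end, the arc
    -- passing over L + 1 (no cut) would extend that block or cross one of its arcs.
    component-closes : ∀ {a b'} → ComponentL xs a (suc b') → at xs a ≡ at xs b'
    component-closes {a} {b'} (a<b , b≤n , ca , cb , ind)
      with BoundedSearch.greatest (λ m → at xs m ≡ at xs a) (λ m → at xs m ≟ at xs a) (suc b') a a<b refl
    ... | L , eL , a≤L , L<b , mx with m≤n⇒m<n∨m≡n (≤-pred L<b)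
    ... | inj₂ refl = sym eL
    ... | inj₁ L<b' with nonCut⇒arc (ind (suc L) (s≤s a≤L) (s≤s L<b'))
    ... | i , j , ar@(arc i<j j<n eij between) , i<sL , sL≤j = ⊥-elim arc-over-L-absurd
      where
      j<b : j < suc b'
      j<b = cb i j (<-trans i<j j<n) j<n eij (<-trans i<sL (s≤s L<b'))
      a≤i : a ≤ i
      a≤i with a ≤? i
      ... | yes p = p
      ... | no p = ⊥-elim (<-irrefl refl (<-≤-trans (ca i j (<-trans i<j j<n) j<n eij (≰⇒> p)) (≤-trans a≤L (≤-trans (n≤1+n L) sL≤j))))
      arc-over-L-absurd : ⊥
      arc-over-L-absurd with m≤n⇒m<n∨m≡n (≤-pred i<sL)
      ... | inj₂ refl = mx j sL≤j j<b (trans (sym eij) eL)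
      ... | inj₁ i<L with at xs i ≟ at xs a
      ...   | yes ia = between L i<L sL≤j (trans ia (sym eL))
      ...   | no nia with m≤n⇒m<n∨m≡n a≤i
      ...     | inj₂ refl = nia refl
      ...     | inj₁ a<i with arc-over-gap {xs = xs} (sym eL) (≤-<-trans (≤-pred L<b) (<-≤-trans (n<1+n b') b≤n)) a<i i<L nia
      ...       | p , q , apq , _ , _ , p<i , i<q , q≤L = n1 p q i j apq ar p<i i<q (≤-<-trans q≤L sL≤j)

    innerBlock-nestedBy : ∀ {p q} → Arc xs p (suc q) → p < q → NestedByL xs (at xs (suc p)) (at xs p)
    innerBlock-nestedBy {p} {q} apq@(arc p<sq sq<n epq bpq) p<q =
      nbl p (suc q) p<sq sq<n refl (sym epq) (λ r p<r r<sq e → bpq r p<r r<sq (sym e)) inside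
      where
      c d : ℕ
      c = at xs p
      d = at xs (suc p)
      dc : ∀ {k} → p < k → k < suc q → at xs k ≢ c
      dc p<k k<sq e = bpq _ p<k k<sq (sym e)
      inside : ∀ r → r < length xs → at xs r ≡ d → p < r × r < suc q
      inside r r<n er = lo , hi
        where
        lo : p < r
        lo with p <? r
        ... | yes z = z
        ... | no z with m≤n⇒m<n∨m≡n (≮⇒≥ z)
        ...   | inj₂ refl = ⊥-elim (dc ≤-refl (s≤s p<q) (sym er))
        ...   | inj₁ r<p with arc-over-gap {xs = xs} {i = r} {j = suc p} {k = p} er (<-trans (s≤s p<q) sq<n) r<p ≤-refl
                               (λ z → dc ≤-refl (s≤s p<q) (trans (sym er) (sym z)))
        ...     | p2 , q2 , a2 , _ , _ , p2<p , p<q2 , q2≤sp =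
                  ⊥-elim (n1 p2 q2 p (suc q) a2 apq p2<p p<q2 (≤-<-trans q2≤sp (s≤s p<q)))
        hi : r < suc q
        hi with r <? suc q
        ... | yes z = z
        ... | no z with m≤n⇒m<n∨m≡n (≮⇒≥ z)
        ...   | inj₂ refl = ⊥-elim (dc ≤-refl (s≤s p<q) (trans (sym er) (sym epq)))
        ...   | inj₁ sq<r with arc-over-gap {xs = xs} {i = q} {j = r} {k = suc q} (trans (sym (n2 p q apq p<q)) (sym er)) r<n ≤-refl sq<r
                               (λ z → dc ≤-refl (s≤s p<q) (trans (n2 p q apq p<q) (trans (sym z) (sym epq))))
        ...     | p2 , q2 , a2 , _ , q≤p2 , p2<sq , sq<q2 , _ =
                  ⊥-elim (n1 p (suc q) p2 q2 apq a2 (<-≤-trans p<q q≤p2) p2<sq sq<q2)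

    NestingChain : ℕ → ℕ → Set
    NestingChain x y = Σ (List ℕ) λ cs → Linked Nests (at xs x ∷ cs) × Unique (at xs x ∷ cs)
      × (∀ d → d ∈ at xs x ∷ cs → Σ ℕ λ k → x ≤ k × k ≤ y × at xs k ≡ d)
      × (∀ k → x ≤ k → k ≤ y → at xs k ∈ at xs x ∷ cs)

    -- The blocks met between two occurrences x < y of one block form a chain under
    -- nesting: the long arc of that block over the first foreign position has
    -- joined inner ends, whose block nests inside it and starts the rest of the
    -- chain.  The fuel f only bounds the recursion (y - x decreases).
    nestingChain : ∀ f x y → y < x + f → x ≤ y → y < length xs → at xs x ≡ at xs y → NestingChain x y
    nestingChain zero x y y<x x≤y _ _ = ⊥-elim (<-irrefl refl (<-≤-trans (subst (y <_) (+-identityʳ x) y<x) x≤y))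
    nestingChain (suc f) x y y<xf x≤y y<n exy
      with anyUpTo? (λ k → (x <? k) ×-dec ¬? (at xs k ≟ at xs x)) y
    ... | no ¬h = [] , [-] , ([] ∷ []) , (λ { d (here refl) → x , ≤-refl , x≤y , refl ; d (there ()) }) , cov
      where
      cov : ∀ k → x ≤ k → k ≤ y → at xs k ∈ at xs x ∷ []
      cov k x≤k k≤y with at xs k ≟ at xs x
      ... | yes e = here e
      ... | no ne with m≤n⇒m<n∨m≡n x≤k | m≤n⇒m<n∨m≡n k≤y
      ...   | inj₂ refl | _ = ⊥-elim (ne refl)
      ...   | inj₁ _ | inj₂ refl = ⊥-elim (ne (sym exy))
      ...   | inj₁ x<k | inj₁ k<y = ⊥-elim (¬h (k , k<y , x<k , ne))
    ... | yes (k , k<y , x<k , ne) with arc-over-gap {xs = xs} exy y<n x<k k<y ne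
    ... | p , zero , apq , _ , _ , _ , () , _
    ... | p , suc q' , apq@(arc p<q q<n epq bpq) , ep , x≤p , p<k , k<q , q≤y =
      extend (nestingChain f (suc p) q' bound p<q' (<-trans (n<1+n q') q<n) e2)
      where
      c d : ℕ
      c = at xs x
      p<q' : p < q'
      p<q' = <-≤-trans p<k (≤-pred k<q)
      d = at xs (suc p)
      e2 : d ≡ at xs q'
      e2 = n2 p q' apq p<q'
      bound : q' < suc p + f
      bound = <-≤-trans q≤y (≤-trans (≤-pred (subst (y <_) (+-suc x f) y<xf)) (≤-trans (+-monoˡ-≤ f x≤p) (n≤1+n (p + f))))
      dc : ∀ {k'} → p < k' → k' < suc q' → at xs k' ≢ c
      dc p<k' k'<q e = bpq _ p<k' k'<q (trans ep (sym e))
      extend : NestingChain (suc p) q' → NestingChain x y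
      extend (cs' , lk' , u' , occ' , cov') = d ∷ cs' , nbR ∷ lk' , tabulate notc ∷ u' , occ , cov
        where
        nbR : Nests c d
        nbR = subst (λ z → NestedByL xs d z) ep (innerBlock-nestedBy apq p<q')
        notc : ∀ {e} → e ∈ d ∷ cs' → c ≢ e
        notc m ce with occ' _ m
        ... | k , spk , k≤q' , ek = dc spk (s≤s k≤q') (trans ek (sym ce))
        occ : ∀ e → e ∈ c ∷ d ∷ cs' → Σ ℕ λ k → x ≤ k × k ≤ y × at xs k ≡ e
        occ e (here refl) = x , ≤-refl , x≤y , refl
        occ e (there m) with occ' e m
        ... | k , spk , k≤q' , ek = k , ≤-trans x≤p (≤-trans (n≤1+n p) spk) , ≤-trans k≤q' (<⇒≤ q≤y) , ek
        cov : ∀ k → x ≤ k → k ≤ y → at xs k ∈ c ∷ d ∷ cs'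
        cov k x≤k k≤y with at xs k ≟ c
        ... | yes e = here e
        ... | no ne with m≤n⇒m<n∨m≡n x≤k | m≤n⇒m<n∨m≡n k≤y
        ...   | inj₂ refl | _ = ⊥-elim (ne refl)
        ...   | inj₁ _ | inj₂ refl = ⊥-elim (ne (sym exy))
        ...   | inj₁ x<k | inj₁ k<y with arc-over-gap {xs = xs} exy y<n x<k k<y ne
        ...     | p2 , q2 , a2 , ep2 , _ , p2<k , k<q2 , _ with n3 p2 q2 p (suc q') a2 apq (trans ep2 (sym ep)) (≤-<-trans p2<k k<q2) (s≤s p<q')
        ...       | refl with arc-target-unique a2 apq
        ...         | refl = there (cov' k p2<k (≤-pred k<q2))

    componentsTN : ComponentsTotallyNestedL xs
    componentsTN a zero (() , _)
    componentsTN a (suc b') comp@(a<b , b≤n , _) with nestingChain (suc b') a b' (≤-trans (s≤s (m≤n+m b' a)) (≤-reflexive (sym (+-suc a b')))) (≤-pred a<b) (<-≤-trans ≤-refl b≤n) (component-closes comp)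
    ... | cs , lk , u , occ , cov = at xs a ∷ cs , u , (λ c → f c , g c) , lk
      where
      f : ∀ c → c ∈ at xs a ∷ cs → OccursIn xs a (suc b') c
      f c m with occ c m
      ... | k , a≤k , k≤b' , ek = k , <-≤-trans (s≤s k≤b') b≤n , a≤k , s≤s k≤b' , ek
      g : ∀ c → OccursIn xs a (suc b') c → c ∈ at xs a ∷ cs
      g c (i , i<n , a≤i , i<b , refl) = cov i a≤i (≤-pred i<b)

  QArcs⇒componentsTN : ∀ {xs} → QArcs xs → ComponentsTotallyNestedL xs
  QArcs⇒componentsTN nl = Sufficiency.componentsTN nl

  indecomposable-closes : ∀ {x xs'} → QArcs (x ∷ xs') → Indecomposable (x ∷ xs') → x ≡ at (x ∷ xs') (length xs')
  indecomposable-closes {x} {xs'} nl ind = Sufficiency.component-closes nl (indecomposable⇒component ind (s≤s z≤n))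

module Concatenation where

  open import Data.Nat
  open import Data.Nat.Properties
  open import Data.List using (List; length; map; _++_)
  open import Data.List.Properties using (length-map; length-++)
  open import Data.Product using (_×_; _,_)
  open import Data.Empty using (⊥-elim)
  open import Relation.Nullary using (yes; no)
  open import Relation.Binary.PropositionalEquality
  open ListArcs
  open ArcConditions

  Disjoint : List ℕ → List ℕ → Set
  Disjoint xs ys = ∀ i j → i < length xs → j < length ys → at xs i ≢ at ys j

  arc-++ˡ : ∀ {xs ys i j} → Arc xs i j → Arc (xs ++ ys) i j
  arc-++ˡ {xs} {ys} {i} {j} (arc l b e w) =
    arc l (<-≤-trans b (subst (length xs ≤_) (sym (length-++ xs)) (m≤m+n _ _)))
      (trans (at-++ˡ xs ys i (<-trans l b)) (trans e (sym (at-++ˡ xs ys j b))))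
      λ k i<k k<j ek → w k i<k k<j (trans (sym (at-++ˡ xs ys i (<-trans l b))) (trans ek (at-++ˡ xs ys k (<-trans k<j b))))

  arc-++ʳ : ∀ {xs ys i j} → Arc ys i j → Arc (xs ++ ys) (length xs + i) (length xs + j)
  arc-++ʳ {xs} {ys} {i} {j} (arc l b e w) =
    arc (+-monoʳ-< (length xs) l) (subst (length xs + j <_) (sym (length-++ xs)) (+-monoʳ-< (length xs) b))
      (trans (at-++ʳ xs ys i) (trans e (sym (at-++ʳ xs ys j))))
      λ k i<k k<j ek → w' k i<k k<j (trans (sym (at-++ʳ xs ys i)) ek)
    where
    w' : ∀ k → length xs + i < k → k < length xs + j → at ys i ≢ at (xs ++ ys) k
    w' k i<k k<j ek with m+[n∸m]≡n {length xs} {k} (≤-trans (m≤m+n _ _) (<⇒≤ i<k))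
    ... | kk = w (k ∸ length xs) (+-cancelˡ-< (length xs) _ _ (subst (_ <_) (sym kk) i<k))
                  (+-cancelˡ-< (length xs) _ _ (subst (_< _) (sym kk) k<j))
                  (trans ek (trans (cong (at (xs ++ ys)) (sym kk)) (at-++ʳ xs ys _)))

  arc-++⁻ˡ : ∀ {xs ys i j} → Arc (xs ++ ys) i j → j < length xs → Arc xs i j
  arc-++⁻ˡ {xs} {ys} {i} {j} (arc l b e w) j<m =
    arc l j<m (trans (sym (at-++ˡ xs ys i (<-trans l j<m))) (trans e (at-++ˡ xs ys j j<m)))
      λ k i<k k<j ek → w k i<k k<j (trans (at-++ˡ xs ys i (<-trans l j<m)) (trans ek (sym (at-++ˡ xs ys k (<-trans k<j j<m)))))

  data ArcSplit (xs ys : List ℕ) (i j : ℕ) : Set where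
    inl : j < length xs → Arc xs i j → ArcSplit xs ys i j
    inr : ∀ i' j' → i ≡ length xs + i' → j ≡ length xs + j' → Arc ys i' j' → ArcSplit xs ys i j

  arc-split : ∀ {xs ys i j} → Disjoint xs ys → Arc (xs ++ ys) i j → ArcSplit xs ys i j
  arc-split {xs} {ys} {i} {j} dj a@(arc l b e w) with j <? length xs
  ... | yes j<m = inl j<m (arc-++⁻ˡ a j<m)
  ... | no j≮m with i <? length xs
  ...   | yes i<m = ⊥-elim (dj i (j ∸ length xs) i<m j'<
            (trans (sym (at-++ˡ xs ys i i<m)) (trans e (trans (cong (at (xs ++ ys)) (sym jj)) (at-++ʳ xs ys _)))))
    where
    jj : length xs + (j ∸ length xs) ≡ j
    jj = m+[n∸m]≡n (≮⇒≥ j≮m)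
    j'< : j ∸ length xs < length ys
    j'< = +-cancelˡ-< (length xs) _ _ (subst (_< _) (sym jj) (subst (j <_) (length-++ xs) b))
  ...   | no i≮m = inr (i ∸ length xs) (j ∸ length xs) (sym ii) (sym jj)
            (arc (+-cancelˡ-< (length xs) _ _ (subst₂ _<_ (sym ii) (sym jj) l))
                 (+-cancelˡ-< (length xs) _ _ (subst (_< _) (sym jj) (subst (j <_) (length-++ xs) b)))
                 (trans (sym (at-++ʳ xs ys _)) (trans (cong (at (xs ++ ys)) ii) (trans e (trans (cong (at (xs ++ ys)) (sym jj)) (at-++ʳ xs ys _)))))
                 λ k i<k k<j ek → w (length xs + k) (subst (_< _) ii (+-monoʳ-< (length xs) i<k)) (subst (_ <_) jj (+-monoʳ-< (length xs) k<j))
                    (trans (cong (at (xs ++ ys)) (sym ii)) (trans (at-++ʳ xs ys _) (trans ek (sym (at-++ʳ xs ys k))))))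
    where
    jj : length xs + (j ∸ length xs) ≡ j
    jj = m+[n∸m]≡n (≮⇒≥ j≮m)
    ii : length xs + (i ∸ length xs) ≡ i
    ii = m+[n∸m]≡n (≮⇒≥ i≮m)

  module _ {xs ys : List ℕ} where
    private
      m : ℕ
      m = length xs
      zs : List ℕ
      zs = xs ++ ys
      atl : ∀ {i} → i < m → at zs i ≡ at xs i
      atl {i} p = at-++ˡ xs ys i p
      atr : ∀ i → at zs (m + i) ≡ at ys i
      atr i = at-++ʳ xs ys i
      sh< : ∀ {a b} → a < b → m + a < m + b
      sh< = +-monoʳ-< m
      un< : ∀ {a b} → m + a < m + b → a < b
      un< = +-cancelˡ-< m _ _

    Crossfree-++⁻ˡ : Crossfree zs → Crossfree xs
    Crossfree-++⁻ˡ h i₁ j₁ i₂ j₂ a₁ a₂ = h i₁ j₁ i₂ j₂ (arc-++ˡ a₁) (arc-++ˡ a₂)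
    Crossfree-++⁻ʳ : Crossfree zs → Crossfree ys
    Crossfree-++⁻ʳ h i₁ j₁ i₂ j₂ a₁ a₂ p q r = h _ _ _ _ (arc-++ʳ {xs} a₁) (arc-++ʳ {xs} a₂) (sh< p) (sh< q) (sh< r)
    Nestfree-++⁻ˡ : Nestfree zs → Nestfree xs
    Nestfree-++⁻ˡ h i₁ j₁ i₂ j₂ a₁ a₂ = h i₁ j₁ i₂ j₂ (arc-++ˡ a₁) (arc-++ˡ a₂)
    Nestfree-++⁻ʳ : Nestfree zs → Nestfree ys
    Nestfree-++⁻ʳ h i₁ j₁ i₂ j₂ a₁ a₂ p q r = h _ _ _ _ (arc-++ʳ {xs} a₁) (arc-++ʳ {xs} a₂) (sh< p) (sh< q) (sh< r)
    InnerEndsJoined-++⁻ˡ : InnerEndsJoined zs → InnerEndsJoined xs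
    InnerEndsJoined-++⁻ˡ h i j a i<j = trans (sym (atl (<-trans (s≤s i<j) (Arc.bd a)))) (trans (h i j (arc-++ˡ a) i<j) (atl (<-trans ≤-refl (Arc.bd a))))
    InnerEndsJoined-++⁻ʳ : InnerEndsJoined zs → InnerEndsJoined ys
    InnerEndsJoined-++⁻ʳ h i j a i<j = trans (sym (trans (cong (at zs) (sym (+-suc m i))) (atr (suc i))))
       (trans (h (m + i) (m + j) (subst (Arc zs (m + i)) (+-suc m j) (arc-++ʳ {xs} a)) (sh< i<j)) (atr j))
    LongArcUnique-++⁻ˡ : LongArcUnique zs → LongArcUnique xs
    LongArcUnique-++⁻ˡ h i j i' j' a a' e li li' = h i j i' j' (arc-++ˡ a) (arc-++ˡ a')
      (trans (atl (<-trans (Arc.lt a) (Arc.bd a))) (trans e (sym (atl (<-trans (Arc.lt a') (Arc.bd a')))))) li li'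
    LongArcUnique-++⁻ʳ : LongArcUnique zs → LongArcUnique ys
    LongArcUnique-++⁻ʳ h i j i' j' a a' e li li' = +-cancelˡ-≡ m _ _ (h _ _ _ _ (arc-++ʳ {xs} a) (arc-++ʳ {xs} a')
      (trans (atr i) (trans e (sym (atr i')))) (subst (_< m + j) (+-suc m i) (sh< li)) (subst (_< m + j') (+-suc m i') (sh< li')))

    module _ (dj : Disjoint xs ys) where
      Crossfree-++⁺ : Crossfree xs → Crossfree ys → Crossfree zs
      Crossfree-++⁺ h₁ h₂ i₁ j₁ i₂ j₂ a₁ a₂ p q r with arc-split dj a₁ | arc-split dj a₂
      ... | inl b₁ x₁ | inl b₂ x₂ = h₁ _ _ _ _ x₁ x₂ p q r
      ... | inl b₁ x₁ | inr i' j' refl refl x₂ = <-irrefl refl (<-trans (≤-<-trans (m≤m+n m i') q) b₁)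
      ... | inr i' j' refl refl x₁ | inl b₂ x₂ = <-irrefl refl (≤-<-trans (m≤m+n m i') (<-trans p (<-trans (Arc.lt x₂) b₂)))
      ... | inr i' j' refl refl x₁ | inr i'' j'' refl refl x₂ = h₂ _ _ _ _ x₁ x₂ (un< p) (un< q) (un< r)

      Nestfree-++⁺ : Nestfree xs → Nestfree ys → Nestfree zs
      Nestfree-++⁺ h₁ h₂ i₁ j₁ i₂ j₂ a₁ a₂ p q r with arc-split dj a₁ | arc-split dj a₂
      ... | inl b₁ x₁ | inl b₂ x₂ = h₁ _ _ _ _ x₁ x₂ p q r
      ... | inl b₁ x₁ | inr i' j' refl refl x₂ = <-irrefl refl (≤-<-trans (m≤m+n m i') (<-trans q (<-trans r b₁)))
      ... | inr i' j' refl refl x₁ | inl b₂ x₂ = <-irrefl refl (≤-<-trans (m≤m+n m i') (<-trans p (<-trans q b₂)))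
      ... | inr i' j' refl refl x₁ | inr i'' j'' refl refl x₂ = h₂ _ _ _ _ x₁ x₂ (un< p) (un< q) (un< r)

      InnerEndsJoined-++⁺ : InnerEndsJoined xs → InnerEndsJoined ys → InnerEndsJoined zs
      InnerEndsJoined-++⁺ h₁ h₂ i j a i<j with arc-split dj a
      ... | inl b x = trans (atl (<-trans (s≤s i<j) b)) (trans (h₁ i j x i<j) (sym (atl (<-trans ≤-refl b))))
      ... | inr i' zero refl e (arc () _ _ _)
      ... | inr i' (suc j'') refl e x with trans e (+-suc m j'')
      ...   | refl = trans (trans (cong (at zs) (sym (+-suc m i'))) (atr (suc i')))
                    (trans (h₂ i' j'' x (un< i<j)) (sym (atr j'')))

      LongArcUnique-++⁺ : LongArcUnique xs → LongArcUnique ys → LongArcUnique zs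
      LongArcUnique-++⁺ h₁ h₂ i j i' j' a a' e li li' with arc-split dj a | arc-split dj a'
      ... | inl b x | inl b' x' = h₁ i j i' j' x x' (trans (sym (atl (<-trans (Arc.lt x) b))) (trans e (atl (<-trans (Arc.lt x') b')))) li li'
      ... | inl b x | inr k l refl refl x' = ⊥-elim (dj i k (<-trans (Arc.lt x) b) (<-trans (Arc.lt x') (Arc.bd x'))
             (trans (sym (atl (<-trans (Arc.lt x) b))) (trans e (atr k))))
      ... | inr k l refl refl x | inl b' x' = ⊥-elim (dj i' k (<-trans (Arc.lt x') b') (<-trans (Arc.lt x) (Arc.bd x))
             (trans (sym (atl (<-trans (Arc.lt x') b'))) (trans (sym e) (atr k))))
      ... | inr k l refl refl x | inr k' l' refl refl x' = cong (m +_) (h₂ k l k' l' x x'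
             (trans (sym (atr k)) (trans e (atr k'))) (un< (subst (_< m + l) (sym (+-suc m k)) li))
             (un< (subst (_< m + l') (sym (+-suc m k')) li')))

  QArcs-++⁻ : ∀ {xs ys} → QArcs (xs ++ ys) → QArcs xs × QArcs ys
  QArcs-++⁻ {xs} {ys} (a , b , c) = (Crossfree-++⁻ˡ {xs} {ys} a , InnerEndsJoined-++⁻ˡ {xs} {ys} b , LongArcUnique-++⁻ˡ {xs} {ys} c) , (Crossfree-++⁻ʳ {xs} {ys} a , InnerEndsJoined-++⁻ʳ {xs} {ys} b , LongArcUnique-++⁻ʳ {xs} {ys} c)

  QArcs-++⁺ : ∀ {xs ys} → Disjoint xs ys → QArcs xs → QArcs ys → QArcs (xs ++ ys)
  QArcs-++⁺ {xs} {ys} dj (a , b , c) (a' , b' , c') = Crossfree-++⁺ {xs} {ys} dj a a' , InnerEndsJoined-++⁺ {xs} {ys} dj b b' , LongArcUnique-++⁺ {xs} {ys} dj c c'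

  PncnArcs-++⁻ : ∀ {xs ys} → PncnArcs (xs ++ ys) → PncnArcs xs × PncnArcs ys
  PncnArcs-++⁻ {xs} {ys} (a , b) = (Crossfree-++⁻ˡ {xs} {ys} a , Nestfree-++⁻ˡ {xs} {ys} b) , (Crossfree-++⁻ʳ {xs} {ys} a , Nestfree-++⁻ʳ {xs} {ys} b)

  PncnArcs-++⁺ : ∀ {xs ys} → Disjoint xs ys → PncnArcs xs → PncnArcs ys → PncnArcs (xs ++ ys)
  PncnArcs-++⁺ {xs} {ys} dj (a , b) (a' , b') = Crossfree-++⁺ {xs} {ys} dj a a' , Nestfree-++⁺ {xs} {ys} dj b b'

  module Shift (B : ℕ) {xs : List ℕ} where
    private
      ys : List ℕ
      ys = map (B +_) xs
      ln : length ys ≡ length xs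
      ln = length-map (B +_) xs
      am : ∀ {i} → i < length xs → at ys i ≡ B + at xs i
      am {i} p = at-map (B +_) xs i p
      inj : ∀ {a b} → B + a ≡ B + b → a ≡ b
      inj = +-cancelˡ-≡ B _ _
      bd : ∀ {j} → j < length ys → j < length xs
      bd = subst (_ <_) ln

    arc-unshift : ∀ {i j} → Arc ys i j → Arc xs i j
    arc-unshift {i} {j} (arc l b e w) = arc l (bd b) (inj (trans (sym (am (<-trans l (bd b)))) (trans e (am (bd b)))))
      λ k i<k k<j ek → w k i<k k<j (trans (am (<-trans l (bd b))) (trans (cong (B +_) ek) (sym (am (<-trans k<j (bd b))))))

    arc-shift : ∀ {i j} → Arc xs i j → Arc ys i j
    arc-shift {i} {j} (arc l b e w) = arc l (subst (_ <_) (sym ln) b) (trans (am (<-trans l b)) (trans (cong (B +_) e) (sym (am b))))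
      λ k i<k k<j ek → w k i<k k<j (inj (trans (sym (am (<-trans l b))) (trans ek (am (<-trans k<j b)))))

    QArcs-unshift : QArcs ys → QArcs xs
    QArcs-unshift (h1 , h2 , h3) = (λ i₁ j₁ i₂ j₂ a b → h1 i₁ j₁ i₂ j₂ (arc-shift a) (arc-shift b)) ,
      (λ i j a i<j → inj (trans (sym (am (<-trans (s≤s i<j) (Arc.bd a)))) (trans (h2 i j (arc-shift a) i<j) (am (<-trans ≤-refl (Arc.bd a)))))) ,
      λ i j i' j' a a' e → h3 i j i' j' (arc-shift a) (arc-shift a') (trans (am (<-trans (Arc.lt a) (Arc.bd a))) (trans (cong (B +_) e) (sym (am (<-trans (Arc.lt a') (Arc.bd a'))))))

    QArcs-shift : QArcs xs → QArcs ys
    QArcs-shift (h1 , h2 , h3) = (λ i₁ j₁ i₂ j₂ a b → h1 i₁ j₁ i₂ j₂ (arc-unshift a) (arc-unshift b)) ,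
      (λ i j a i<j → let a' = arc-unshift a in trans (am (<-trans (s≤s i<j) (Arc.bd a'))) (trans (cong (B +_) (h2 i j a' i<j)) (sym (am (<-trans ≤-refl (Arc.bd a')))))) ,
      λ i j i' j' a a' e → let b = arc-unshift a ; b' = arc-unshift a' in h3 i j i' j' b b' (inj (trans (sym (am (<-trans (Arc.lt b) (Arc.bd b)))) (trans e (am (<-trans (Arc.lt b') (Arc.bd b'))))))

    PncnArcs-unshift : PncnArcs ys → PncnArcs xs
    PncnArcs-unshift (h1 , h2) = (λ i₁ j₁ i₂ j₂ a b → h1 i₁ j₁ i₂ j₂ (arc-shift a) (arc-shift b)) , (λ i₁ j₁ i₂ j₂ a b → h2 i₁ j₁ i₂ j₂ (arc-shift a) (arc-shift b))

    PncnArcs-shift : PncnArcs xs → PncnArcs ys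
    PncnArcs-shift (h1 , h2) = (λ i₁ j₁ i₂ j₂ a b → h1 i₁ j₁ i₂ j₂ (arc-unshift a) (arc-unshift b)) , (λ i₁ j₁ i₂ j₂ a b → h2 i₁ j₁ i₂ j₂ (arc-unshift a) (arc-unshift b))

    cut-unshift : ∀ {k} → Cut ys k → Cut xs k
    cut-unshift c i j i<n j<n e i<k = c i j (subst (_ <_) (sym ln) i<n) (subst (_ <_) (sym ln) j<n) (trans (am i<n) (trans (cong (B +_) e) (sym (am j<n)))) i<k

    cut-shift : ∀ {k} → Cut xs k → Cut ys k
    cut-shift c i j i<n j<n e i<k = c i j (bd i<n) (bd j<n) (inj (trans (sym (am (bd i<n))) (trans e (am (bd j<n))))) i<k

    indecomposable-unshift : Indecomposable ys → Indecomposable xs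
    indecomposable-unshift h k 0<k k<n ck = h k 0<k (subst (_ <_) (sym ln) k<n) (cut-shift ck)

module RestrictedGrowth where

  open import Data.Nat
  open import Data.Nat.Properties
  open import Data.List using (List; []; _∷_; length; map; _++_)
  open import Data.Product using (Σ; _×_; _,_)
  open import Data.Sum using (inj₁; inj₂)
  open import Data.Empty using (⊥-elim)
  open import Relation.Binary.PropositionalEquality
  open import Defs using (RGSFrom; new; old; [])
  open ListArcs

  -- The least number above m and above every label of xs: for a restricted
  -- growth string from m, the first label not yet used.
  labelBound : ℕ → List ℕ → ℕ
  labelBound m [] = m
  labelBound m (x ∷ xs) = labelBound (m ⊔ suc x) xs

  ⊔-new : ∀ m → m ⊔ suc m ≡ suc m
  ⊔-new m = m≤n⇒m⊔n≡n (n≤1+n m)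

  ⊔-old : ∀ {m x} → x < m → m ⊔ suc x ≡ m
  ⊔-old x<m = m≥n⇒m⊔n≡m x<m

  labelBound-++ : ∀ m xs ys → labelBound m (xs ++ ys) ≡ labelBound (labelBound m xs) ys
  labelBound-++ m [] ys = refl
  labelBound-++ m (x ∷ xs) ys = labelBound-++ _ xs ys

  rgs-head : ∀ {x xs} → RGSFrom 0 (x ∷ xs) → x ≡ 0
  rgs-head (new _) = refl
  rgs-head (old () _)

  rgs-++⁻ : ∀ {m} xs {ys} → RGSFrom m (xs ++ ys) → RGSFrom m xs × RGSFrom (labelBound m xs) ys
  rgs-++⁻ [] r = [] , r
  rgs-++⁻ {m} (x ∷ xs) (new r) with rgs-++⁻ xs r
  ... | a , b = new a , subst (λ z → RGSFrom (labelBound z xs) _) (sym (⊔-new m)) b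
  rgs-++⁻ {m} (x ∷ xs) (old x<m r) with rgs-++⁻ xs r
  ... | a , b = old x<m a , subst (λ z → RGSFrom (labelBound z xs) _) (sym (⊔-old x<m)) b

  rgs-++⁺ : ∀ {m xs ys} → RGSFrom m xs → RGSFrom (labelBound m xs) ys → RGSFrom m (xs ++ ys)
  rgs-++⁺ [] r = r
  rgs-++⁺ {m} {x ∷ xs} (new a) r = new (rgs-++⁺ a (subst (λ z → RGSFrom (labelBound z xs) _) (⊔-new m) r))
  rgs-++⁺ {m} {x ∷ xs} (old x<m a) r = old x<m (rgs-++⁺ a (subst (λ z → RGSFrom (labelBound z xs) _) (⊔-old x<m) r))

  rgs-shift : ∀ B {m xs} → RGSFrom m xs → RGSFrom (B + m) (map (B +_) xs)
  rgs-shift B [] = []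
  rgs-shift B {m} {_ ∷ xs} (new r) = new (subst (λ z → RGSFrom z (map (B +_) xs)) (+-suc B m) (rgs-shift B r))
  rgs-shift B (old x<m r) = old (+-monoʳ-< B x<m) (rgs-shift B r)

  rgs-unshift′ : ∀ B {m k} xs → RGSFrom k (map (B +_) xs) → k ≡ B + m → RGSFrom m xs
  rgs-unshift′ B [] _ _ = []
  rgs-unshift′ B {m} (x ∷ xs) (new r) e with +-cancelˡ-≡ B x m e
  ... | refl = new (rgs-unshift′ B xs r (sym (+-suc B x)))
  rgs-unshift′ B {m} (x ∷ xs) (old x<k r) refl = old (+-cancelˡ-< B _ _ x<k) (rgs-unshift′ B xs r refl)

  rgs-unshift : ∀ B {m} xs → RGSFrom (B + m) (map (B +_) xs) → RGSFrom m xs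
  rgs-unshift B xs r = rgs-unshift′ B xs r refl

  labelBound-shift : ∀ B m xs → labelBound (B + m) (map (B +_) xs) ≡ B + labelBound m xs
  labelBound-shift B m [] = refl
  labelBound-shift B m (x ∷ xs) = trans (cong (λ z → labelBound z (map (B +_) xs)) (trans (cong ((B + m) ⊔_) (sym (+-suc B x))) (sym (+-distribˡ-⊔ B m (suc x)))))
    (labelBound-shift B (m ⊔ suc x) xs)

  labelBound-≥ : ∀ m xs → m ≤ labelBound m xs
  labelBound-≥ m [] = ≤-refl
  labelBound-≥ m (x ∷ xs) = ≤-trans (m≤m⊔n m (suc x)) (labelBound-≥ _ xs)

  at<labelBound : ∀ {m} xs → ∀ i → i < length xs → at xs i < labelBound m xs
  at<labelBound {m} (x ∷ xs) zero _ = <-≤-trans (<-≤-trans (n<1+n x) (m≤n⊔m m (suc x))) (labelBound-≥ _ xs)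
  at<labelBound {m} (x ∷ xs) (suc i) (s≤s p) = at<labelBound xs i p

  rgs-labels-occur : ∀ {m xs} → RGSFrom m xs → ∀ l → m ≤ l → l < labelBound m xs → Σ ℕ λ i → i < length xs × at xs i ≡ l
  rgs-labels-occur [] l m≤l l<m = ⊥-elim (<-irrefl refl (<-≤-trans l<m m≤l))
  rgs-labels-occur {m} {x ∷ xs} (new r) l m≤l l<c with m≤n⇒m<n∨m≡n m≤l
  ... | inj₂ refl = 0 , s≤s z≤n , refl
  ... | inj₁ m<l with rgs-labels-occur r l m<l (subst (λ z → l < labelBound z xs) (⊔-new m) l<c)
  ... | i , i<n , e = suc i , s≤s i<n , e
  rgs-labels-occur {m} {x ∷ xs} (old x<m r) l m≤l l<c with rgs-labels-occur r l m≤l (subst (λ z → l < labelBound z xs) (⊔-old x<m) l<c)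
  ... | i , i<n , e = suc i , s≤s i<n , e

module IndecomposableTotallyNested where

  open import Data.Nat
  open import Data.Nat.Properties
  open import Data.List using (List; []; _∷_; length)
  open import Data.List.Relation.Unary.Unique.Propositional using (Unique)
  open import Data.List.Relation.Unary.Linked using ([])
  open import Data.Product using (_,_; proj₁; proj₂)
  open import Data.Sum using (inj₁; inj₂)
  open import Data.Empty using (⊥-elim)
  open import Relation.Nullary using (yes; no)
  open import Relation.Binary.PropositionalEquality
  open ListArcs
  open ArcConditions
  open ListEncoding
  open TotallyNestedArcs
  open ArcsTotallyNested

  tn⇒indecomposable : ∀ {xs} → TotallyNestedL xs 0 (length xs) → Indecomposable xs
  tn⇒indecomposable {[]} tn k 0<k ()
  tn⇒indecomposable {xs@(x ∷ ys)} tn k 0<k k<n ck with at xs 0 ≟ at xs (length ys)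
  ... | yes e = <-irrefl refl (<-≤-trans (ck 0 (length ys) (s≤s z≤n) ≤-refl e 0<k) (≤-pred k<n))
  ... | no ne with tn⇒comparable tn (at xs 0) (at xs (length ys))
                    (0 , s≤s z≤n , z≤n , s≤s z≤n , refl)
                    (length ys , ≤-refl , z≤n , ≤-refl , refl) ne
  ...   | inj₁ nb = n≮0 (proj₁ (NestedByL.inn nb 0 (s≤s z≤n) refl))
  ...   | inj₂ nb = <-irrefl refl (<-≤-trans (proj₂ (NestedByL.inn nb (length ys) ≤-refl refl))
                         (≤-pred (NestedByL.q<n nb)))

  tn⇒componentsTN : ∀ {xs} → TotallyNestedL xs 0 (length xs) → ComponentsTotallyNestedL xs
  tn⇒componentsTN {xs} tn a b (a<b , b≤n , ca , cb , _) = subst₂ (TotallyNestedL xs) (sym a≡0) (sym b≡n) tn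
    where
    ind : Indecomposable xs
    ind = tn⇒indecomposable tn
    a≡0 : a ≡ 0
    a≡0 = inner-cut-zero a ca (<-≤-trans a<b b≤n)
      where
      inner-cut-zero : ∀ a → Cut xs a → a < length xs → a ≡ 0
      inner-cut-zero zero _ _ = refl
      inner-cut-zero (suc a') c l = ⊥-elim (ind (suc a') (s≤s z≤n) l c)
    b≡n : b ≡ length xs
    b≡n with m≤n⇒m<n∨m≡n b≤n
    ... | inj₂ e = e
    ... | inj₁ b<n = ⊥-elim (ind b (≤-<-trans z≤n a<b) b<n cb)

  tn⇒QArcs : ∀ {xs} → TotallyNestedL xs 0 (length xs) → QArcs xs
  tn⇒QArcs tn = componentsTN⇒QArcs (tn⇒componentsTN tn)

  QArcs⇒tn : ∀ {xs} → QArcs xs → Indecomposable xs → TotallyNestedL xs 0 (length xs)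
  QArcs⇒tn {[]} nl ind = [] , Data.List.Relation.Unary.Unique.Propositional.[] , (λ c → (λ ()) , λ { (i , () , _) }) , []
  QArcs⇒tn {xs@(x ∷ ys)} nl ind = QArcs⇒componentsTN nl 0 (length xs) (indecomposable⇒component ind (s≤s z≤n))

module ComponentDecomposition where

  open import Data.Nat
  open import Data.Nat.Properties
  open import Data.Nat.ListAction using (sum)
  open import Data.List using (List; []; _∷_; length; map; _++_; take; drop)
  open import Data.List.Properties using (length-map; length-++; take++drop≡id; length-drop; map-injective)
  open import Data.List.Relation.Unary.All using (All; []; _∷_)
  open import Data.Vec using (Vec; toList)
  import Data.Vec as V
  open import Data.Vec.Properties using (length-toList)
  open import Data.Product using (Σ; _×_; _,_; proj₁; proj₂)
  open import Data.Empty using (⊥-elim)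
  open import Relation.Nullary using (¬_; yes; no)
  open import Relation.Nullary.Decidable using (_×-dec_)
  open import Relation.Binary.PropositionalEquality
  open import Relation.Binary using (tri<; tri≈; tri>)
  open import Defs using (RGSFrom; []; DecoratedPart)
  open ListEncoding using (toVec; toList-toVec; toList-injective′)
  open ListArcs
  open ArcConditions
  open Concatenation
  open RestrictedGrowth

  LabelsFrom : ℕ → List ℕ → Set
  LabelsFrom B xs = ∀ i → i < length xs → B ≤ at xs i

  labelsFrom-++⁺ : ∀ {B} xs ys → LabelsFrom B xs → LabelsFrom B ys → LabelsFrom B (xs ++ ys)
  labelsFrom-++⁺ {B} xs ys f g i i<n with i <? length xs
  ... | yes i<m = subst (B ≤_) (sym (at-++ˡ xs ys i i<m)) (f i i<m)
  ... | no i≮m = subst (B ≤_) (trans (sym (at-++ʳ xs ys (i ∸ length xs))) (cong (at (xs ++ ys)) ii))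
                   (g (i ∸ length xs) (+-cancelˡ-< (length xs) _ _ (subst (_< _) (sym ii) (subst (i <_) (length-++ xs) i<n))))
    where ii = m+[n∸m]≡n (≮⇒≥ i≮m)

  labelsFrom-mono : ∀ {B B'} xs → B ≤ B' → LabelsFrom B' xs → LabelsFrom B xs
  labelsFrom-mono xs le f i i<n = ≤-trans le (f i i<n)

  cut-++⁻ˡ : ∀ {xs ys c} → Cut (xs ++ ys) c → c ≤ length xs → Cut xs c
  cut-++⁻ˡ {xs} {ys} {c} ct c≤ i j i<n j<n e i<c =
    ct i j (len< i<n) (len< j<n) (trans (at-++ˡ xs ys i i<n) (trans e (sym (at-++ˡ xs ys j j<n)))) i<c
    where
    len< : ∀ {i} → i < length xs → i < length (xs ++ ys)
    len< p = <-≤-trans p (subst (length xs ≤_) (sym (length-++ xs)) (m≤m+n _ _))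

  disjoint⇒cut : ∀ {xs ys} → Disjoint xs ys → Cut (xs ++ ys) (length xs)
  disjoint⇒cut {xs} {ys} dj i j i<n j<n e i<m with j <? length xs
  ... | yes j<m = j<m
  ... | no j≮m = ⊥-elim (dj i (j ∸ length xs) i<m j'< (trans (sym (at-++ˡ xs ys i i<m)) (trans e
                     (trans (cong (at (xs ++ ys)) (sym jj)) (at-++ʳ xs ys _)))))
    where
    jj : length xs + (j ∸ length xs) ≡ j
    jj = m+[n∸m]≡n (≮⇒≥ j≮m)
    j'< : j ∸ length xs < length ys
    j'< = +-cancelˡ-< (length xs) _ _ (subst (_< _) (sym jj) (subst (j <_) (length-++ xs) j<n))

  cut⇒disjoint : ∀ {xs ys} → Cut (xs ++ ys) (length xs) → Disjoint xs ys
  cut⇒disjoint {xs} {ys} ct i j i<m j<n e = <-irrefl refl (≤-<-trans (m≤m+n (length xs) j)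
      (ct i (length xs + j) (<-≤-trans i<m (subst (length xs ≤_) (sym (length-++ xs)) (m≤m+n _ _)))
         (subst (length xs + j <_) (sym (length-++ xs)) (+-monoʳ-< (length xs) j<n))
         (trans (at-++ˡ xs ys i i<m) (trans e (sym (at-++ʳ xs ys j)))) i<m))

  at-shift< : ∀ B xs → RGSFrom 0 xs → ∀ i → i < length (map (B +_) xs) → at (map (B +_) xs) i < B + labelBound 0 xs
  at-shift< B xs r i i<n = subst (_< B + labelBound 0 xs) (sym (at-map (B +_) xs i i<n'))
      (+-monoʳ-< B (at<labelBound xs i i<n'))
    where i<n' = subst (i <_) (length-map (B +_) xs) i<n

  labelsFrom-shift : ∀ B xs → LabelsFrom B (map (B +_) xs)
  labelsFrom-shift B xs i i<n = subst (B ≤_) (sym (at-map (B +_) xs i (subst (i <_) (length-map (B +_) xs) i<n))) (m≤m+n B _)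

  labelsFrom-++⁻ : ∀ {B} xs ys → LabelsFrom B (xs ++ ys) → LabelsFrom B xs × LabelsFrom B ys
  labelsFrom-++⁻ {B} xs ys f = (λ i i<n → subst (B ≤_) (at-++ˡ xs ys i i<n) (f i (<-≤-trans i<n (subst (length xs ≤_) (sym (length-++ xs)) (m≤m+n _ _))))) ,
    λ j j<n → subst (B ≤_) (at-++ʳ xs ys j) (f (length xs + j) (subst (length xs + j <_) (sym (length-++ xs)) (+-monoʳ-< (length xs) j<n)))

  shift∘unshift : ∀ B xs → LabelsFrom B xs → map (B +_) (map (_∸ B) xs) ≡ xs
  shift∘unshift B [] f = refl
  shift∘unshift B (x ∷ xs) f = cong₂ _∷_ (m+[n∸m]≡n (f 0 (s≤s z≤n))) (shift∘unshift B xs (λ i i<n → f (suc i) (s≤s i<n)))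

  cut-extend : ∀ {xs₁ xs₂ c'} → Cut (xs₁ ++ xs₂) (length xs₁) → Cut xs₁ c' → c' ≤ length xs₁ → Cut (xs₁ ++ xs₂) c'
  cut-extend {xs₁} {xs₂} {c'} big small le i j i<n j<n e i<c' =
    small i j i<m j<m (trans (sym (at-++ˡ xs₁ xs₂ i i<m)) (trans e (at-++ˡ xs₁ xs₂ j j<m))) i<c'
    where
    i<m : i < length xs₁
    i<m = <-≤-trans i<c' le
    j<m : j < length xs₁
    j<m = big i j i<n j<n e i<m

  labelsFrom-disjoint : ∀ {B xs ys} → RGSFrom B xs → LabelsFrom B ys → Disjoint xs ys → LabelsFrom (labelBound B xs) ys
  labelsFrom-disjoint {B} {xs} {ys} r fr dj j j<n with labelBound B xs ≤? at ys j
  ... | yes le = le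
  ... | no nle with rgs-labels-occur r (at ys j) (fr j j<n) (≰⇒> nle)
  ...   | i , i<n , ei = ⊥-elim (dj i j i<n j<n ei)

  first-cut : ∀ xs → 0 < length xs → Σ ℕ λ c → 0 < c × c ≤ length xs × Cut xs c × Indecomposable (take c xs)
  first-cut xs 0<n with BoundedSearch.least (λ k → 0 < k × Cut xs k) (λ k → (0 <? k) ×-dec cut? xs k) (length xs)
                          (0<n , λ _ _ _ j<n _ _ → j<n)
  ... | c , (0<c , ctc) , c≤n , mn = c , 0<c , c≤n , ctc , ind
    where
    l₁ : length (take c xs) ≡ c
    l₁ = length-take≤ c xs c≤n
    ct : Cut (take c xs ++ drop c xs) (length (take c xs))
    ct = subst₂ Cut (sym (take++drop≡id c xs)) (sym l₁) ctc
    ind : Indecomposable (take c xs)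
    ind k 0<k k<n ck = mn k (subst (k <_) l₁ k<n)
      (0<k , subst (λ z → Cut z k) (take++drop≡id c xs) (cut-extend {take c xs} {drop c xs} ct ck (<⇒≤ k<n)))

  -- Every partition is the concatenation of its indecomposable components, the
  -- i-th one relabelled by the number of blocks before it; concatParts B ds
  -- performs this concatenation with first free label B.
  module Decomposition (Good : List ℕ → Set)
    (good-[] : Good [])
    (good-++⁻ : ∀ {xs ys} → Good (xs ++ ys) → Good xs × Good ys)
    (good-++⁺ : ∀ {xs ys} → Disjoint xs ys → Good xs → Good ys → Good (xs ++ ys))
    (good-unshift : ∀ B {xs} → Good (map (B +_) xs) → Good xs)
    (good-shift : ∀ B {xs} → Good xs → Good (map (B +_) xs)) where

    GoodPart : DecoratedPart → Set
    GoodPart (k , w) = 0 < k × RGSFrom 0 (toList w) × Good (toList w) × Indecomposable (toList w)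

    concatParts : ℕ → List DecoratedPart → List ℕ
    concatParts B [] = []
    concatParts B ((k , w) ∷ ds) = map (B +_) (toList w) ++ concatParts (B + labelBound 0 (toList w)) ds

    rgs-shift₀ : ∀ B xs → RGSFrom 0 xs → RGSFrom B (map (B +_) xs)
    rgs-shift₀ B xs r = subst (λ z → RGSFrom z (map (B +_) xs)) (+-identityʳ B) (rgs-shift B r)

    labelBound-shift₀ : ∀ B xs → labelBound B (map (B +_) xs) ≡ B + labelBound 0 xs
    labelBound-shift₀ B xs = trans (cong (λ z → labelBound z (map (B +_) xs)) (sym (+-identityʳ B))) (labelBound-shift B 0 xs)

    concat-good : ∀ B ds → All GoodPart ds → RGSFrom B (concatParts B ds) × Good (concatParts B ds) × LabelsFrom B (concatParts B ds)
         × length (concatParts B ds) ≡ sum (map proj₁ ds)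
    concat-good B [] [] = [] , good-[] , (λ i ()) , refl
    concat-good B ((k , w) ∷ ds) ((0<k , r , g , ind) ∷ gs) with concat-good (B + labelBound 0 (toList w)) ds gs
    ... | r' , g' , f' , l' = rgs-++⁺ (rgs-shift₀ B ws r) (subst (λ z → RGSFrom z rest) (sym (labelBound-shift₀ B ws)) r') ,
          good-++⁺ dj (good-shift B g) g' ,
          labelsFrom-++⁺ (map (B +_) ws) rest (labelsFrom-shift B ws) (labelsFrom-mono rest (m≤m+n B _) f') ,
          trans (length-++ (map (B +_) (toList w))) (cong₂ _+_ (trans (length-map _ (toList w)) (length-toList w)) l')
      where
      ws rest : List ℕ
      ws = toList w
      rest = concatParts (B + labelBound 0 (toList w)) ds
      dj : Disjoint (map (B +_) (toList w)) (concatParts (B + labelBound 0 (toList w)) ds)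
      dj i j i<n j<n e = <-irrefl refl (<-≤-trans (subst (_< B + labelBound 0 ws) e (at-shift< B ws r i i<n)) (f' j j<n))

    concat-disjoint : ∀ B k w ds → All GoodPart ds → GoodPart (k , w) →
      Disjoint (map (B +_) (toList w)) (concatParts (B + labelBound 0 (toList w)) ds)
    concat-disjoint B k w ds gs (_ , r , _ , _) i j i<n j<n e with concat-good (B + labelBound 0 (toList w)) ds gs
    ... | _ , _ , f' , _ = <-irrefl refl (<-≤-trans (subst (_< B + labelBound 0 (toList w)) e (at-shift< B (toList w) r i i<n)) (f' j j<n))

    length-shifted : ∀ B {k} (w : Vec ℕ k) → length (map (B +_) (toList w)) ≡ k
    length-shifted B w = trans (length-map _ (toList w)) (length-toList w)

    concat-cut-first : ∀ B k w ds → All GoodPart ds → GoodPart (k , w) → Cut (concatParts B ((k , w) ∷ ds)) k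
    concat-cut-first B k w ds gs gp = subst (Cut (concatParts B ((k , w) ∷ ds))) (length-shifted B w) (disjoint⇒cut {map (B +_) (toList w)} {concatParts (B + labelBound 0 (toList w)) ds} (concat-disjoint B k w ds gs gp))

    concat-no-cut-in-first : ∀ B k w ds → GoodPart (k , w) → ∀ c → 0 < c → c < k → ¬ Cut (concatParts B ((k , w) ∷ ds)) c
    concat-no-cut-in-first B k w ds (_ , _ , _ , ind) c 0<c c<k ct =
      ind c 0<c (subst (c <_) (sym (length-toList w)) c<k)
        (Shift.cut-unshift B {toList w} (cut-++⁻ˡ {map (B +_) (toList w)} {concatParts (B + labelBound 0 (toList w)) ds} ct (subst (c ≤_) (sym (length-shifted B w)) (<⇒≤ c<k))))

    concat-injective : ∀ B ds ds' → All GoodPart ds → All GoodPart ds' → concatParts B ds ≡ concatParts B ds' → ds ≡ ds'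
    concat-injective B [] [] _ _ _ = refl
    concat-injective B [] ((suc k , x V.∷ w) ∷ ds') _ _ ()
    concat-injective B [] ((zero , V.[]) ∷ ds') _ ((() , _) ∷ _) _
    concat-injective B ((zero , V.[]) ∷ ds) _ ((() , _) ∷ _) _ _
    concat-injective B ((suc k , x V.∷ w) ∷ ds) [] _ _ ()
    concat-injective B ((k , w) ∷ ds) ((k' , w') ∷ ds') (gp ∷ gs) (gp' ∷ gs') e with <-cmp k k'
    ... | tri< k<k' _ _ = ⊥-elim (concat-no-cut-in-first B k' w' ds' gp' k (proj₁ gp) k<k' (subst (λ z → Cut z k) e (concat-cut-first B k w ds gs gp)))
    ... | tri> _ _ k'<k = ⊥-elim (concat-no-cut-in-first B k w ds gp k' (proj₁ gp') k'<k (subst (λ z → Cut z k') (sym e) (concat-cut-first B k' w' ds' gs' gp')))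
    ... | tri≈ _ refl _ with ++-injective (map (B +_) (toList w)) _ (map (B +_) (toList w')) _ (trans (length-shifted B w) (sym (length-shifted B w'))) e
    ...   | e1 , e2 with toList-injective′ w w' (map-injective (+-cancelˡ-≡ B _ _) e1)
    ...     | refl = cong ((k , w) ∷_) (concat-injective _ ds ds' gs gs' e2)

    normalise : ∀ B ys → RGSFrom B ys → LabelsFrom B ys → Good ys → Indecomposable ys → 0 < length ys →
      GoodPart (length ys , toVec (length ys) (map (_∸ B) ys)) × map (B +_) (map (_∸ B) ys) ≡ ys
    normalise B ys r fr g ind 0<n =
      (0<n , subst (RGSFrom 0) (sym tl) r₀ , subst Good (sym tl) g₀ , subst Indecomposable (sym tl) ind₀) , eqw
      where
      w : List ℕ
      w = map (_∸ B) ys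
      eqw : map (B +_) w ≡ ys
      eqw = shift∘unshift B ys fr
      tl : toList (toVec (length ys) w) ≡ w
      tl = toList-toVec (length ys) w (length-map _ ys)
      r₀ : RGSFrom 0 w
      r₀ = rgs-unshift B w (subst (λ z → RGSFrom z (map (B +_) w)) (sym (+-identityʳ B)) (subst (RGSFrom B) (sym eqw) r))
      g₀ : Good w
      g₀ = good-unshift B (subst Good (sym eqw) g)
      ind₀ : Indecomposable w
      ind₀ = Shift.indecomposable-unshift B {w} (subst Indecomposable (sym eqw) ind)

    decompose : ∀ f B xs → length xs < f → RGSFrom B xs → LabelsFrom B xs → Good xs →
         Σ (List DecoratedPart) λ ds → All GoodPart ds × concatParts B ds ≡ xs
    decompose zero B xs () r fr g
    decompose (suc f) B [] _ r fr g = [] , [] , refl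
    decompose (suc f) B xs@(x ∷ xs') lt r fr g with first-cut xs (s≤s z≤n)
    ... | c , 0<c , c≤n , ctc , ind₁ = (length xs₁ , v₁) ∷ ds₂ , proj₁ norm ∷ gs₂ , eqFinal
      where
      xs₁ xs₂ w : List ℕ
      xs₁ = take c xs
      xs₂ = drop c xs
      w = map (_∸ B) xs₁
      e0 : xs₁ ++ xs₂ ≡ xs
      e0 = take++drop≡id c xs
      l₁ : length xs₁ ≡ c
      l₁ = length-take≤ c xs c≤n
      dj : Disjoint xs₁ xs₂
      dj = cut⇒disjoint {xs₁} {xs₂} (subst₂ Cut (sym e0) (sym l₁) ctc)
      gg : Good xs₁ × Good xs₂
      gg = good-++⁻ (subst Good (sym e0) g)
      rr : RGSFrom B xs₁ × RGSFrom (labelBound B xs₁) xs₂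
      rr = rgs-++⁻ {B} xs₁ {xs₂} (subst (RGSFrom B) (sym e0) r)
      ff : LabelsFrom B xs₁ × LabelsFrom B xs₂
      ff = labelsFrom-++⁻ {B} xs₁ xs₂ (subst (LabelsFrom B) (sym e0) fr)
      v₁ : Vec ℕ (length xs₁)
      v₁ = toVec (length xs₁) w
      norm : GoodPart (length xs₁ , v₁) × map (B +_) w ≡ xs₁
      norm = normalise B xs₁ (proj₁ rr) (proj₁ ff) (proj₁ gg) ind₁ (subst (0 <_) (sym l₁) 0<c)
      B' : ℕ
      B' = B + labelBound 0 w
      cnteq : labelBound B xs₁ ≡ B'
      cnteq = trans (cong (labelBound B) (sym (proj₂ norm))) (labelBound-shift₀ B w)
      fr₂ : LabelsFrom B' xs₂
      fr₂ = subst (λ z → LabelsFrom z xs₂) cnteq (labelsFrom-disjoint {ys = xs₂} (proj₁ rr) (proj₂ ff) dj)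
      len₂ : length xs₂ < f
      len₂ = <-≤-trans (subst (_< length xs) (sym (length-drop c xs)) (∸-monoʳ-< 0<c c≤n)) (≤-pred lt)
      rec : Σ (List DecoratedPart) λ ds → All GoodPart ds × concatParts B' ds ≡ xs₂
      rec = decompose f B' xs₂ len₂ (subst (λ z → RGSFrom z xs₂) cnteq (proj₂ rr)) fr₂ (proj₂ gg)
      ds₂ : List DecoratedPart
      ds₂ = proj₁ rec
      gs₂ : All GoodPart ds₂
      gs₂ = proj₁ (proj₂ rec)
      eqFinal : concatParts B ((length xs₁ , v₁) ∷ ds₂) ≡ xs
      eqFinal = trans (cong (λ z → map (B +_) z ++ concatParts (B + labelBound 0 z) ds₂) (toList-toVec (length xs₁) w (length-map _ xs₁)))
                (trans (cong₂ _++_ (proj₂ norm) (proj₂ (proj₂ rec))) e0)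

module IndecomposableEnumeration where

  open import Data.Nat
  open import Data.Nat.Properties
  open import Data.List using (List; []; _∷_; length; map; _++_)
  open import Data.List.Properties using (length-map; length-++)
  open import Data.List.Membership.Propositional using (_∈_)
  open import Data.List.Membership.Propositional.Properties using (∈-map⁺; ∈-map⁻; ∈-++⁻; ∈-++⁺ˡ; ∈-++⁺ʳ)
  open import Data.List.Relation.Unary.Any using (here; there)
  open import Data.List.Relation.Unary.All as All using (All; []; _∷_)
  open import Data.List.Relation.Unary.Unique.Propositional using (Unique; []; _∷_)
  open import Data.List.Relation.Unary.Unique.Propositional.Properties using (++⁺)
  open import Data.Product using (Σ; _×_; _,_; proj₁; proj₂)
  open import Data.Sum using (inj₁; inj₂)
  open import Data.Empty using (⊥-elim)
  open import Relation.Nullary using (¬_)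
  open import Relation.Binary.PropositionalEquality

  unique-map : ∀ {A Step : Set} {f : A → Step} {xs} → Unique xs → (∀ {x y} → x ∈ xs → y ∈ xs → f x ≡ f y → x ≡ y) → Unique (map f xs)
  unique-map [] _ = []
  unique-map {f = f} {x ∷ xs} (a ∷ u) f-injective = All.tabulate fresh ∷ unique-map u (λ p q e → f-injective (there p) (there q) e)
    where
    fresh : ∀ {z} → z ∈ map f xs → f x ≢ z
    fresh m e with ∈-map⁻ f m
    ... | y , y∈ , refl = All.lookup a y∈ (f-injective (here refl) (there y∈) e)

  mutual
    indecCount : ℕ → ℕ
    indecCount zero = 0
    indecCount (suc zero) = 1
    indecCount (suc (suc k)) = indecCountSum (suc k)

    indecCountSum : ℕ → ℕ
    indecCountSum zero = 0
    indecCountSum (suc j) = indecCountSum j + indecCount (suc j)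

  -- If the single object of size 1 is 0 ∷ [] and every object of size k + 2 is
  -- grow (k + 1) j w' for exactly one j ∈ [1 , k + 1] and object w' of size j,
  -- then listing objects size by size yields indecCount k objects of size k.
  -- The first argument of enumBySize is fuel.
  module GrowthEnumeration (P : ℕ → List ℕ → Set) (grow : ℕ → ℕ → List ℕ → List ℕ)
    (base-unique : ∀ w → P 1 w → w ≡ 0 ∷ [])
    (base : P 1 (0 ∷ []))
    (shrink : ∀ k w → P (suc (suc k)) w → Σ ℕ λ j → 1 ≤ j × j ≤ suc k × Σ (List ℕ) λ w' → P j w' × w ≡ grow (suc k) j w')
    (grow-closed : ∀ k j w' → 1 ≤ j → j ≤ suc k → P j w' → P (suc (suc k)) (grow (suc k) j w'))
    (grow-injective : ∀ k j j' w' w'' → 1 ≤ j → j ≤ suc k → 1 ≤ j' → j' ≤ suc k → P j w' → P j' w'' →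
           grow (suc k) j w' ≡ grow (suc k) j' w'' → j ≡ j' × w' ≡ w'')
    where

    mutual
      enumBySize : ℕ → ℕ → List (List ℕ)
      enumBySize _ zero = []
      enumBySize _ (suc zero) = (0 ∷ []) ∷ []
      enumBySize zero (suc (suc k)) = []
      enumBySize (suc f) (suc (suc k)) = enumBySizeUpTo f (suc k) (suc k)

      enumBySizeUpTo : ℕ → ℕ → ℕ → List (List ℕ)
      enumBySizeUpTo f k zero = []
      enumBySizeUpTo f k (suc j) = enumBySizeUpTo f k j ++ map (grow k (suc j)) (enumBySize f (suc j))

    record Invariant (f : ℕ) : Set where
      field
        sound : ∀ k w → k ≤ suc f → w ∈ enumBySize f k → P k w
        complete : ∀ k w → k ≤ suc f → 1 ≤ k → P k w → w ∈ enumBySize f k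
        uniq : ∀ k → k ≤ suc f → Unique (enumBySize f k)
        len : ∀ k → k ≤ suc f → length (enumBySize f k) ≡ indecCount k

    module Step (f k' : ℕ) (invariant : Invariant f) (k'≤f : k' ≤ f) where
      k : ℕ
      k = suc k'
      open Invariant invariant
      step-sound : ∀ j w → j ≤ k → w ∈ enumBySizeUpTo f k j → Σ ℕ λ j' → 1 ≤ j' × j' ≤ j × Σ (List ℕ) λ w' → P j' w' × w ≡ grow k j' w'
      step-sound zero w _ ()
      step-sound (suc j) w sj≤k m with ∈-++⁻ (enumBySizeUpTo f k j) m
      ... | inj₁ m' with step-sound j w (≤-trans (n≤1+n j) sj≤k) m'
      ...   | j' , a , b , c = j' , a , ≤-trans b (n≤1+n j) , c
      step-sound (suc j) w sj≤k m | inj₂ m' with ∈-map⁻ (grow k (suc j)) m'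
      ...   | w' , w'∈ , refl = suc j , s≤s z≤n , ≤-refl , w' , sound (suc j) w' (≤-trans sj≤k (s≤s k'≤f)) w'∈ , refl

      step-complete : ∀ j j' w' → j ≤ k → 1 ≤ j' → j' ≤ j → P j' w' → grow k j' w' ∈ enumBySizeUpTo f k j
      step-complete zero j' w' _ 1≤j' j'≤0 _ = ⊥-elim (<-irrefl refl (≤-trans 1≤j' j'≤0))
      step-complete (suc j) j' w' sj≤k 1≤j' j'≤sj p with m≤n⇒m<n∨m≡n j'≤sj
      ... | inj₁ j'<sj = ∈-++⁺ˡ (step-complete j j' w' (≤-trans (n≤1+n j) sj≤k) 1≤j' (≤-pred j'<sj) p)
      ... | inj₂ refl = ∈-++⁺ʳ (enumBySizeUpTo f k j) (∈-map⁺ (grow k (suc j)) (complete (suc j) w' (≤-trans sj≤k (s≤s k'≤f)) 1≤j' p))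

      step-unique : ∀ j → j ≤ k → Unique (enumBySizeUpTo f k j)
      step-unique zero _ = []
      step-unique (suc j) sj≤k = ++⁺ (step-unique j (≤-trans (n≤1+n j) sj≤k))
        (unique-map (uniq (suc j) sjf) (λ {x} {y} p q e → proj₂ (grow-injective k' (suc j) (suc j) x y (s≤s z≤n) sj≤k (s≤s z≤n) sj≤k
            (sound (suc j) x sjf p) (sound (suc j) y sjf q) e)))
        dis
        where
        sjf : suc j ≤ suc f
        sjf = ≤-trans sj≤k (s≤s k'≤f)
        dis : ∀ {v} → ¬ (v ∈ enumBySizeUpTo f k j × v ∈ map (grow k (suc j)) (enumBySize f (suc j)))
        dis (m1 , m2) with step-sound j _ (≤-trans (n≤1+n j) sj≤k) m1 | ∈-map⁻ (grow k (suc j)) m2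
        ... | j' , 1≤j' , j'≤j , w' , pw' , refl | w'' , w''∈ , e2 =
          <-irrefl refl (≤-trans (s≤s (≤-reflexive (sym (proj₁ (grow-injective k' j' (suc j) w' w'' 1≤j' (≤-trans j'≤j (≤-trans (n≤1+n j) sj≤k)) (s≤s z≤n) sj≤k
            pw' (sound (suc j) w'' sjf w''∈) e2))))) (s≤s j'≤j))

      step-length : ∀ j → j ≤ k → length (enumBySizeUpTo f k j) ≡ indecCountSum j
      step-length zero _ = refl
      step-length (suc j) sj≤k = trans (length-++ (enumBySizeUpTo f k j)) (cong₂ _+_ (step-length j (≤-trans (n≤1+n j) sj≤k))
        (trans (length-map _ (enumBySize f (suc j))) (len (suc j) (≤-trans sj≤k (s≤s k'≤f)))))

    invariant : ∀ f → Invariant f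
    invariant zero = record { sound = s0 ; complete = c0 ; uniq = u0 ; len = l0 }
      where
      s0 : ∀ k w → k ≤ 1 → w ∈ enumBySize 0 k → P k w
      s0 zero w _ ()
      s0 (suc zero) w _ (here refl) = base
      s0 (suc zero) w _ (there ())
      s0 (suc (suc k)) w (s≤s ()) _
      c0 : ∀ k w → k ≤ 1 → 1 ≤ k → P k w → w ∈ enumBySize 0 k
      c0 (suc zero) w _ _ p = here (base-unique w p)
      c0 (suc (suc k)) w (s≤s ()) _ _
      u0 : ∀ k → k ≤ 1 → Unique (enumBySize 0 k)
      u0 zero _ = []
      u0 (suc zero) _ = [] ∷ []
      u0 (suc (suc k)) (s≤s ())
      l0 : ∀ k → k ≤ 1 → length (enumBySize 0 k) ≡ indecCount k
      l0 zero _ = refl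
      l0 (suc zero) _ = refl
      l0 (suc (suc k)) (s≤s ())
    invariant (suc f) = record { sound = s1 ; complete = c1 ; uniq = u1 ; len = l1 }
      where
      I : Invariant f
      I = invariant f
      s1 : ∀ k w → k ≤ suc (suc f) → w ∈ enumBySize (suc f) k → P k w
      s1 zero w _ ()
      s1 (suc zero) w _ (here refl) = base
      s1 (suc zero) w _ (there ())
      s1 (suc (suc k')) w (s≤s (s≤s k'≤f)) m with Step.step-sound f k' I k'≤f (suc k') w ≤-refl m
      ... | j , 1≤j , j≤k , w' , p , refl = grow-closed k' j w' 1≤j j≤k p
      c1 : ∀ k w → k ≤ suc (suc f) → 1 ≤ k → P k w → w ∈ enumBySize (suc f) k
      c1 (suc zero) w _ _ p = here (base-unique w p)
      c1 (suc (suc k')) w (s≤s (s≤s k'≤f)) _ p with shrink k' w p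
      ... | j , 1≤j , j≤k , w' , pw , refl = Step.step-complete f k' I k'≤f (suc k') j w' ≤-refl 1≤j j≤k pw
      u1 : ∀ k → k ≤ suc (suc f) → Unique (enumBySize (suc f) k)
      u1 zero _ = []
      u1 (suc zero) _ = [] ∷ []
      u1 (suc (suc k')) (s≤s (s≤s k'≤f)) = Step.step-unique f k' I k'≤f (suc k') ≤-refl
      l1 : ∀ k → k ≤ suc (suc f) → length (enumBySize (suc f) k) ≡ indecCount k
      l1 zero _ = refl
      l1 (suc zero) _ = refl
      l1 (suc (suc k')) (s≤s (s≤s k'≤f)) = Step.step-length f k' I k'≤f (suc k') ≤-refl

    enumeration : ℕ → List (List ℕ)
    enumeration k = enumBySize k k

    enumeration-sound : ∀ k w → w ∈ enumeration k → P k w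
    enumeration-sound k w = Invariant.sound (invariant k) k w (n≤1+n k)

    enumeration-complete : ∀ k w → 1 ≤ k → P k w → w ∈ enumeration k
    enumeration-complete k w = Invariant.complete (invariant k) k w (n≤1+n k)

    enumeration-unique : ∀ k → Unique (enumeration k)
    enumeration-unique k = Invariant.uniq (invariant k) k (n≤1+n k)

    enumeration-length : ∀ k → length (enumeration k) ≡ indecCount k
    enumeration-length k = Invariant.len (invariant k) k (n≤1+n k)

module FibonacciConvolution where

  open import Data.Nat
  open import Data.Nat.Properties
  open import Relation.Binary.PropositionalEquality
  open import Defs using (fib)
  open IndecomposableEnumeration using (indecCount)

  sumUpTo : (ℕ → ℕ) → ℕ → ℕ
  sumUpTo g zero = 0
  sumUpTo g (suc k) = sumUpTo g k + g (suc k)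

  sumUpTo-first : ∀ g k → sumUpTo g (suc k) ≡ g 1 + sumUpTo (λ j → g (suc j)) k
  sumUpTo-first g zero = +-comm 0 (g 1)
  sumUpTo-first g (suc k) = trans (cong (_+ g (suc (suc k))) (sumUpTo-first g k)) (+-assoc (g 1) _ _)

  sumUpTo-cong : ∀ g h k → (∀ j → 1 ≤ j → j ≤ k → g j ≡ h j) → sumUpTo g k ≡ sumUpTo h k
  sumUpTo-cong g h zero e = refl
  sumUpTo-cong g h (suc k) e = cong₂ _+_ (sumUpTo-cong g h k (λ j a b → e j a (≤-trans b (n≤1+n k)))) (e (suc k) (s≤s z≤n) ≤-refl)

  sumUpTo-2* : ∀ g k → sumUpTo (λ j → 2 * g j) k ≡ 2 * sumUpTo g k
  sumUpTo-2* g zero = refl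
  sumUpTo-2* g (suc k) = trans (cong (_+ 2 * g (suc k)) (sumUpTo-2* g k)) (sym (*-distribˡ-+ 2 (sumUpTo g k) (g (suc k))))

  -- fibOdd n = F (2n − 1), with F (−1) = 1 counting the empty composition.
  fibOdd : ℕ → ℕ
  fibOdd zero = 1
  fibOdd (suc n) = fib (suc (2 * n))

  indecCount-double : ∀ j → 1 ≤ j → indecCount (suc (suc j)) ≡ 2 * indecCount (suc j)
  indecCount-double (suc j') _ = cong (indecCount (suc (suc j')) +_) (sym (+-identityʳ _))

  2*-suc : ∀ n → 2 * suc n ≡ suc (suc (2 * n))
  2*-suc n = cong suc (+-suc n (n + 0))

  -- Since indecCount doubles from index 2 on, the convolution S n below satisfies
  -- S (n + 1) = fibOdd n + 2 S n, the recurrence of F (2n); then the full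
  -- convolution is fibOdd n + S n = F (2n + 1).
  shiftedConvolution : ℕ → ℕ
  shiftedConvolution n = sumUpTo (λ j → indecCount (suc j) * fibOdd (n ∸ j)) n

  shiftedConvolution-suc : ∀ n → shiftedConvolution (suc n) ≡ fibOdd n + 2 * shiftedConvolution n
  shiftedConvolution-suc n = trans (sumUpTo-first (λ j → indecCount (suc j) * fibOdd (suc n ∸ j)) n)
    (cong₂ _+_ (+-identityʳ (fibOdd n)) (trans
       (sumUpTo-cong _ (λ j → 2 * (indecCount (suc j) * fibOdd (n ∸ j))) n
          (λ j 1≤j _ → trans (cong (_* fibOdd (n ∸ j)) (indecCount-double j 1≤j)) (*-assoc 2 (indecCount (suc j)) _)))
       (sumUpTo-2* (λ j → indecCount (suc j) * fibOdd (n ∸ j)) n)))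

  shiftedConvolution≡fib : ∀ n → shiftedConvolution n ≡ fib (2 * n)
  shiftedConvolution≡fib zero = refl
  shiftedConvolution≡fib (suc zero) = refl
  shiftedConvolution≡fib (suc (suc n')) = begin
      shiftedConvolution (suc (suc n'))
    ≡⟨ shiftedConvolution-suc (suc n') ⟩
      fibOdd (suc n') + 2 * shiftedConvolution (suc n')
    ≡⟨ cong (λ z → fibOdd (suc n') + 2 * z) (shiftedConvolution≡fib (suc n')) ⟩
      fib (suc (2 * n')) + 2 * fib (2 * suc n')
    ≡⟨ cong (λ z → fib (suc (2 * n')) + 2 * fib z) (2*-suc n') ⟩
      fib (suc (2 * n')) + 2 * fib (suc (suc (2 * n')))
    ≡⟨ rearrange (fib (suc (2 * n'))) (fib (suc (suc (2 * n')))) ⟩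
      fib (suc (suc (suc (suc (2 * n')))))
    ≡⟨ cong fib (sym (trans (2*-suc (suc n')) (cong (λ z → suc (suc z)) (2*-suc n')))) ⟩
      fib (2 * suc (suc n'))
    ∎
    where
    open ≡-Reasoning
    rearrange : ∀ a b → a + 2 * b ≡ (b + a) + b
    rearrange a b = trans (cong (a +_) (cong (b +_) (+-identityʳ b))) (trans (sym (+-assoc a b b)) (cong (_+ b) (+-comm a b)))

  convolution : ℕ → ℕ
  convolution n = sumUpTo (λ j → indecCount j * fibOdd (suc n ∸ j)) (suc n)

  convolution≡fibOdd : ∀ n → convolution n ≡ fibOdd (suc n)
  convolution≡fibOdd n = trans (sumUpTo-first (λ j → indecCount j * fibOdd (suc n ∸ j)) n) (trans (cong₂ _+_ (+-identityʳ (fibOdd n)) refl) (fibOdd+shifted n))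
    where
    fibOdd+shifted : ∀ n → fibOdd n + shiftedConvolution n ≡ fibOdd (suc n)
    fibOdd+shifted zero = refl
    fibOdd+shifted (suc n') = trans (cong (fibOdd (suc n') +_) (shiftedConvolution≡fib (suc n')))
      (trans (cong (λ z → fib (suc (2 * n')) + fib z) (2*-suc n'))
        (trans (+-comm (fib (suc (2 * n'))) _) (cong fib (sym (cong suc (2*-suc n'))))))

module CompositionEnumeration where

  open import Data.Nat
  open import Data.Nat.Properties
  open import Data.Nat.ListAction using (sum)
  open import Data.List using (List; []; _∷_; length; map; _++_; cartesianProductWith)
  open import Data.List.Properties using (length-map; length-++; ∷-injective)
  open import Data.List.Membership.Propositional using (_∈_)
  open import Data.List.Membership.Propositional.Properties
    using (∈-map⁺; ∈-map⁻; ∈-++⁻; ∈-++⁺ˡ; ∈-++⁺ʳ; ∈-cartesianProductWith⁺; ∈-cartesianProductWith⁻)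
  open import Data.List.Relation.Unary.Any using (here; there)
  open import Data.List.Relation.Unary.All as All using (All; []; _∷_)
  open import Data.List.Relation.Unary.Unique.Propositional using (Unique; []; _∷_)
  open import Data.List.Relation.Unary.Unique.Propositional.Properties using (++⁺)
  import Data.List.Relation.Unary.Unique.Propositional.Properties as Unique
  open import Data.Product using (Σ; _×_; _,_; proj₁; proj₂)
  open import Data.Sum using (inj₁; inj₂)
  open import Data.Empty using (⊥-elim)
  open import Relation.Nullary using (¬_)
  open import Relation.Binary.PropositionalEquality
  open import Defs using (DecoratedPart)
  open IndecomposableEnumeration using (indecCount)
  open FibonacciConvolution

  length-cartesianProductWith : ∀ {A Step C : Set} (f : A → Step → C) xs ys →
    length (cartesianProductWith f xs ys) ≡ length xs * length ys
  length-cartesianProductWith f [] ys = refl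
  length-cartesianProductWith f (x ∷ xs) ys =
    trans (length-++ (map (f x) ys)) (cong₂ _+_ (length-map (f x) ys) (length-cartesianProductWith f xs ys))

  -- A composition splits into its first part, of some size k, and a composition
  -- of n − k; with indecCount k parts of size k there are fibOdd n compositions of
  -- n, by the convolution identity.  The first argument of enumComps is fuel.
  module Compositions (Part : DecoratedPart → Set) (parts : ℕ → List DecoratedPart)
    (parts-sound : ∀ k p → p ∈ parts k → Part p × proj₁ p ≡ k)
    (parts-complete : ∀ p → Part p → p ∈ parts (proj₁ p))
    (part-pos : ∀ p → Part p → 1 ≤ proj₁ p)
    (parts-unique : ∀ k → Unique (parts k))
    (parts-length : ∀ k → length (parts k) ≡ indecCount k) where

    IsComposition : ℕ → List DecoratedPart → Set
    IsComposition n ds = All Part ds × sum (map proj₁ ds) ≡ n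

    mutual
      enumComps : ℕ → ℕ → List (List DecoratedPart)
      enumComps _ zero = [] ∷ []
      enumComps zero (suc n) = []
      enumComps (suc f) (suc n) = enumCompsBy f (suc n) (suc n)

      enumCompsBy : ℕ → ℕ → ℕ → List (List DecoratedPart)
      enumCompsBy f N zero = []
      enumCompsBy f N (suc k) = enumCompsBy f N k ++ cartesianProductWith _∷_ (parts (suc k)) (enumComps f (N ∸ suc k))

    record Invariant (f : ℕ) : Set where
      field
        sound : ∀ n ds → n ≤ f → ds ∈ enumComps f n → IsComposition n ds
        complete : ∀ n ds → n ≤ f → IsComposition n ds → ds ∈ enumComps f n
        uniq : ∀ n → n ≤ f → Unique (enumComps f n)
        len : ∀ n → n ≤ f → length (enumComps f n) ≡ fibOdd n

    module Step (f N : ℕ) (invariant : Invariant f) (N≤sf : N ≤ suc f) where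
      open Invariant invariant
      fuel : ∀ j → 1 ≤ j → N ∸ j ≤ f
      fuel j 1≤j = ≤-trans (∸-monoʳ-≤ N 1≤j) (∸-monoˡ-≤ 1 N≤sf)

      step-sound : ∀ k ds → k ≤ N → ds ∈ enumCompsBy f N k → IsComposition N ds
      step-sound zero ds _ ()
      step-sound (suc k) ds sk≤N m with ∈-++⁻ (enumCompsBy f N k) m
      ... | inj₁ m' = step-sound k ds (≤-trans (n≤1+n k) sk≤N) m'
      ... | inj₂ m' with ∈-cartesianProductWith⁻ _∷_ (parts (suc k)) _ m'
      ...   | p , r , p∈ , r∈ , refl with parts-sound (suc k) p p∈ | sound (N ∸ suc k) r (fuel (suc k) (s≤s z≤n)) r∈
      ...     | gp , e | ga , es = gp ∷ ga , trans (cong₂ _+_ e es) (m+[n∸m]≡n sk≤N)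

      step-complete : ∀ k p r → k ≤ N → Part p → 1 ≤ proj₁ p → proj₁ p ≤ k → IsComposition (N ∸ proj₁ p) r → (p ∷ r) ∈ enumCompsBy f N k
      step-complete zero p r _ _ 1≤ ≤0 _ = ⊥-elim (<-irrefl refl (≤-trans 1≤ ≤0))
      step-complete (suc k) p r sk≤N gp 1≤ ≤sk dc with m≤n⇒m<n∨m≡n ≤sk
      ... | inj₁ lt = ∈-++⁺ˡ (step-complete k p r (≤-trans (n≤1+n k) sk≤N) gp 1≤ (≤-pred lt) dc)
      ... | inj₂ refl = ∈-++⁺ʳ (enumCompsBy f N k) (∈-cartesianProductWith⁺ _∷_ (parts-complete p gp)
              (complete (N ∸ suc k) r (fuel (suc k) (s≤s z≤n)) dc))

      step-unique : ∀ k → k ≤ N → Unique (enumCompsBy f N k)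
      step-unique zero _ = []
      step-unique (suc k) sk≤N = ++⁺ (step-unique k (≤-trans (n≤1+n k) sk≤N)) (Unique.cartesianProductWith⁺ _∷_ ∷-injective (parts-unique (suc k)) (uniq _ (fuel (suc k) (s≤s z≤n)))) dis
        where
        step-head : ∀ j ds → j ≤ N → ds ∈ enumCompsBy f N j → Σ DecoratedPart λ p → Σ (List DecoratedPart) λ r → ds ≡ p ∷ r × proj₁ p ≤ j
        step-head zero ds _ ()
        step-head (suc j) ds sj≤N m with ∈-++⁻ (enumCompsBy f N j) m
        ... | inj₁ m' with step-head j ds (≤-trans (n≤1+n j) sj≤N) m'
        ...   | p , r , e , le = p , r , e , ≤-trans le (n≤1+n j)
        step-head (suc j) ds sj≤N m | inj₂ m' with ∈-cartesianProductWith⁻ _∷_ (parts (suc j)) _ m'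
        ...   | p , r , p∈ , _ , e = p , r , e , ≤-reflexive (proj₂ (parts-sound (suc j) p p∈))
        dis : ∀ {v} → ¬ (v ∈ enumCompsBy f N k × v ∈ cartesianProductWith _∷_ (parts (suc k)) (enumComps f (N ∸ suc k)))
        dis (m1 , m2) with step-head k _ (≤-trans (n≤1+n k) sk≤N) m1 | ∈-cartesianProductWith⁻ _∷_ (parts (suc k)) _ m2
        ... | p , r , refl , le | p' , r' , p'∈ , _ , refl =
          <-irrefl refl (≤-trans (s≤s (≤-reflexive (sym (proj₂ (parts-sound (suc k) p' p'∈))))) (s≤s le))

      step-length : ∀ k → k ≤ N → length (enumCompsBy f N k) ≡ sumUpTo (λ j → indecCount j * fibOdd (N ∸ j)) k
      step-length zero _ = refl
      step-length (suc k) sk≤N = trans (length-++ (enumCompsBy f N k)) (cong₂ _+_ (step-length k (≤-trans (n≤1+n k) sk≤N))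
        (trans (length-cartesianProductWith _∷_ (parts (suc k)) _) (cong₂ _*_ (parts-length (suc k)) (len _ (fuel (suc k) (s≤s z≤n))))))

    invariant : ∀ f → Invariant f
    invariant zero = record { sound = s0 ; complete = c0 ; uniq = u0 ; len = l0 }
      where
      s0 : ∀ n ds → n ≤ 0 → ds ∈ enumComps 0 n → IsComposition n ds
      s0 zero ds _ (here refl) = [] , refl
      s0 zero ds _ (there ())
      c0 : ∀ n ds → n ≤ 0 → IsComposition n ds → ds ∈ enumComps 0 n
      c0 zero [] _ _ = here refl
      c0 zero (p ∷ ds) _ (gp ∷ _ , e) = ⊥-elim (<-irrefl refl (≤-trans (≤-trans (part-pos p gp) (m≤m+n (proj₁ p) _)) (≤-reflexive e)))
      u0 : ∀ n → n ≤ 0 → Unique (enumComps 0 n)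
      u0 zero _ = [] ∷ []
      l0 : ∀ n → n ≤ 0 → length (enumComps 0 n) ≡ fibOdd n
      l0 zero _ = refl
    invariant (suc f) = record { sound = s1 ; complete = c1 ; uniq = u1 ; len = l1 }
      where
      I : Invariant f
      I = invariant f
      s1 : ∀ n ds → n ≤ suc f → ds ∈ enumComps (suc f) n → IsComposition n ds
      s1 zero ds _ (here refl) = [] , refl
      s1 zero ds _ (there ())
      s1 (suc n) ds le m = Step.step-sound f (suc n) I le (suc n) ds ≤-refl m
      c1 : ∀ n ds → n ≤ suc f → IsComposition n ds → ds ∈ enumComps (suc f) n
      c1 zero [] _ _ = here refl
      c1 zero (p ∷ ds) _ (gp ∷ _ , e) = ⊥-elim (<-irrefl refl (≤-trans (≤-trans (part-pos p gp) (m≤m+n (proj₁ p) _)) (≤-reflexive e)))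
      c1 (suc n) [] _ (_ , ())
      c1 (suc n) (p ∷ r) le (gp ∷ ga , e) = Step.step-complete f (suc n) I le (suc n) p r ≤-refl gp (part-pos p gp)
        (subst (proj₁ p ≤_) e (m≤m+n (proj₁ p) _)) (ga , trans (sym (m+n∸m≡n (proj₁ p) _)) (cong (_∸ proj₁ p) e))
      u1 : ∀ n → n ≤ suc f → Unique (enumComps (suc f) n)
      u1 zero _ = [] ∷ []
      u1 (suc n) le = Step.step-unique f (suc n) I le (suc n) ≤-refl
      l1 : ∀ n → n ≤ suc f → length (enumComps (suc f) n) ≡ fibOdd n
      l1 zero _ = refl
      l1 (suc n) le = trans (Step.step-length f (suc n) I le (suc n) ≤-refl) (convolution≡fibOdd n)

    compositions : ℕ → List (List DecoratedPart)
    compositions n = enumComps n n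

    compositions-sound : ∀ n ds → ds ∈ compositions n → IsComposition n ds
    compositions-sound n ds = Invariant.sound (invariant n) n ds ≤-refl
    compositions-complete : ∀ n ds → IsComposition n ds → ds ∈ compositions n
    compositions-complete n ds = Invariant.complete (invariant n) n ds ≤-refl
    compositions-unique : ∀ n → Unique (compositions n)
    compositions-unique n = Invariant.uniq (invariant n) n ≤-refl
    compositions-length : ∀ n → length (compositions n) ≡ fibOdd n
    compositions-length n = Invariant.len (invariant n) n ≤-refl

module Cardinality where

  open import Data.Nat
  open import Data.Nat.Properties
  open import Data.Nat.ListAction using (sum)
  open import Data.List using (List; []; length; map; _++_)
  open import Data.List.Properties using (length-map; ≡-dec)
  open import Data.List.Membership.Propositional using (_∈_; find; lose)
  open import Data.List.Membership.Propositional.Properties using (∈-map⁺; ∈-map⁻)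
  open import Data.List.Relation.Unary.Any using (Any; any?)
  open import Data.List.Relation.Unary.All as All using (All; [])
  open import Data.List.Relation.Unary.Unique.Propositional using (Unique; [])
  open import Data.Vec using (Vec; toList)
  open import Data.Vec.Properties using (length-toList)
  open import Data.Product using (Σ; _×_; _,_; proj₁; proj₂)
  open import Data.Empty using (⊥; ⊥-elim)
  open import Relation.Nullary using (Dec; yes; no)
  open import Relation.Binary.PropositionalEquality
  open import Defs using (RGSFrom; DecoratedPart; HasCard)
  open ArcConditions
  open Concatenation
  open ComponentDecomposition
  open ListEncoding using (toVec; toList-toVec; toList-injective′)
  open IndecomposableEnumeration using (indecCount; unique-map)
  open FibonacciConvolution using (fibOdd)

  module ComponentCounting (Good : List ℕ → Set)
    (good-[] : Good [])
    (good-++⁻ : ∀ {xs ys} → Good (xs ++ ys) → Good xs × Good ys)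
    (good-++⁺ : ∀ {xs ys} → Disjoint xs ys → Good xs → Good ys → Good (xs ++ ys))
    (good-unshift : ∀ B {xs} → Good (map (B +_) xs) → Good xs)
    (good-shift : ∀ B {xs} → Good xs → Good (map (B +_) xs))
    (enumeration : ℕ → List (List ℕ))
    (enumeration-sound : ∀ k w → w ∈ enumeration k → length w ≡ k × RGSFrom 0 w × Good w × Indecomposable w)
    (enumeration-complete : ∀ k w → 1 ≤ k → length w ≡ k × RGSFrom 0 w × Good w × Indecomposable w → w ∈ enumeration k)
    (enumeration-unique : ∀ k → Unique (enumeration k))
    (enumeration-length : ∀ k → length (enumeration k) ≡ indecCount k)
    (enumeration-0 : enumeration 0 ≡ [])
    where

    open Decomposition Good good-[] good-++⁻ good-++⁺ good-unshift good-shift public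

    parts : ℕ → List DecoratedPart
    parts k = map (λ w → k , toVec k w) (enumeration k)

    parts-sound : ∀ k p → p ∈ parts k → GoodPart p × proj₁ p ≡ k
    parts-sound k p m with ∈-map⁻ (λ w → k , toVec k w) m
    ... | w , w∈ , refl with enumeration-sound k w w∈
    ...   | l , r , g , ind = (pos k w∈ , subst (RGSFrom 0) (sym tv) r , subst Good (sym tv) g , subst Indecomposable (sym tv) ind) , refl
      where
      tv : toList (toVec k w) ≡ w
      tv = toList-toVec k w l
      pos : ∀ k → w ∈ enumeration k → 0 < k
      pos zero m with subst (w ∈_) enumeration-0 m
      ... | ()
      pos (suc k) _ = s≤s z≤n

    parts-complete : ∀ p → GoodPart p → p ∈ parts (proj₁ p)
    parts-complete (k , v) (0<k , r , g , ind) =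
      subst (λ z → (k , z) ∈ parts k) (toList-injective′ _ v (toList-toVec k (toList v) (length-toList v)))
        (∈-map⁺ (λ w → k , toVec k w) (enumeration-complete k (toList v) 0<k (length-toList v , r , g , ind)))

    part-pos : ∀ p → GoodPart p → 1 ≤ proj₁ p
    part-pos p gp = proj₁ gp

    parts-unique : ∀ k → Unique (parts k)
    parts-unique k = unique-map (enumeration-unique k) λ {x} {y} mx my e →
      trans (sym (toList-toVec k x (proj₁ (enumeration-sound k x mx)))) (trans (cong (λ p → toList (proj₂ p)) e) (toList-toVec k y (proj₁ (enumeration-sound k y my))))

    parts-length : ∀ k → length (parts k) ≡ indecCount k
    parts-length k = trans (length-map _ (enumeration k)) (enumeration-length k)

    open CompositionEnumeration.Compositions GoodPart parts parts-sound parts-complete part-pos parts-unique parts-length public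

    assemble : (n : ℕ) → List DecoratedPart → Vec ℕ n
    assemble n ds = toVec n (concatParts 0 ds)

    assemble-length : ∀ n ds → IsComposition n ds → length (concatParts 0 ds) ≡ n
    assemble-length n ds (ga , e) = trans (proj₂ (proj₂ (proj₂ (concat-good 0 ds ga)))) e

    module Count {n : ℕ} (Pred : Vec ℕ n → Set)
      (to : ∀ v → Pred v → RGSFrom 0 (toList v) × Good (toList v))
      (from : ∀ v → RGSFrom 0 (toList v) → Good (toList v) → Pred v) where

      listing : List (Vec ℕ n)
      listing = map (assemble n) (compositions n)

      toList-assemble : ∀ ds → ds ∈ compositions n → toList (assemble n ds) ≡ concatParts 0 ds
      toList-assemble ds m = toList-toVec n _ (assemble-length n ds (compositions-sound n ds m))

      decomposition : ∀ v → Pred v → Σ (List DecoratedPart) λ ds → ds ∈ compositions n × concatParts 0 ds ≡ toList v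
      decomposition v p with decompose (suc (length (toList v))) 0 (toList v) ≤-refl (proj₁ (to v p)) (λ _ _ → z≤n) (proj₂ (to v p))
      ... | ds , ga , e = ds , compositions-complete n ds (ga , trans (sym (proj₂ (proj₂ (proj₂ (concat-good 0 ds ga))))) (trans (cong length e) (length-toList v))) , e

      card : HasCard {Vec ℕ n} Pred (fibOdd n)
      card = listing , unique-map (compositions-unique n) (λ {x} {y} mx my e → concat-injective 0 x y (proj₁ (compositions-sound n x mx)) (proj₁ (compositions-sound n y my))
                   (trans (sym (toList-assemble x mx)) (trans (cong toList e) (toList-assemble y my)))) ,
             (λ v → listing-sound v , listing-complete v) , trans (length-map _ (compositions n)) (compositions-length n)
        where
        listing-sound : ∀ v → v ∈ listing → Pred v
        listing-sound v m with ∈-map⁻ (assemble n) m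
        ... | ds , m' , refl with concat-good 0 ds (proj₁ (compositions-sound n ds m'))
        ...   | r , g , _ , _ = from _ (subst (RGSFrom 0) (sym (toList-assemble ds m')) r) (subst Good (sym (toList-assemble ds m')) g)
        listing-complete : ∀ v → Pred v → v ∈ listing
        listing-complete v p with decomposition v p
        ... | ds , m , e = subst (_∈ listing) (toList-injective′ _ v (trans (toList-assemble ds m) e)) (∈-map⁺ (assemble n) m)

      module Decorations (Decorating : DecoratedPart → Set) (decorating⇒good : ∀ p → Decorating p → GoodPart p) (good⇒decorating : ∀ p → GoodPart p → Decorating p) where
        open import Defs using (Bijection)

        IsDecorated : List DecoratedPart → Set
        IsDecorated d = All Decorating d × sum (map proj₁ d) ≡ n

        decorated⇒composition : ∀ d → IsDecorated d → IsComposition n d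
        decorated⇒composition d (a , e) = All.map (λ {p} → decorating⇒good p) a , e

        composition⇒decorated : ∀ d → IsComposition n d → IsDecorated d
        composition⇒decorated d (a , e) = All.map (λ {p} → good⇒decorating p) a , e

        search : (v : Vec ℕ n) → Dec (Any (λ ds → concatParts 0 ds ≡ toList v) (compositions n))
        search v = any? (λ ds → ≡-dec _≟_ (concatParts 0 ds) (toList v)) (compositions n)

        -- Found by search so that it is total on Vec ℕ n; on members of Pred it
        -- returns the decomposition.
        decorationOf : Vec ℕ n → List DecoratedPart
        decorationOf v with search v
        ... | yes found = proj₁ (find found)
        ... | no _ = []

        decorationOf-spec : ∀ v → Pred v → decorationOf v ∈ compositions n × concatParts 0 (decorationOf v) ≡ toList v
        decorationOf-spec v p with search v
        ... | yes found = proj₂ (find found)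
        ... | no none with decomposition v p
        ...   | ds , m , e = ⊥-elim (none (lose m e))

        bijection : Bijection {Vec ℕ n} Pred IsDecorated
        bijection = decorationOf , (λ v p → composition⇒decorated (decorationOf v) (compositions-sound n _ (proj₁ (decorationOf-spec v p)))) ,
          (λ x y px py e → toList-injective′ x y (trans (sym (proj₂ (decorationOf-spec x px))) (trans (cong (concatParts 0) e) (proj₂ (decorationOf-spec y py))))) ,
          surjective
          where
          surjective : ∀ z → IsDecorated z → Σ (Vec ℕ n) λ x → Pred x × decorationOf x ≡ z
          surjective z iz with decorated⇒composition z iz
          ... | dcz = x , px , concat-injective 0 (decorationOf x) z (proj₁ (compositions-sound n _ (proj₁ fs))) (proj₁ dcz) (trans (proj₂ fs) tlx)
            where
            x : Vec ℕ n
            x = assemble n z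
            tlx : toList x ≡ concatParts 0 z
            tlx = toList-toVec n _ (assemble-length n z dcz)
            K : RGSFrom 0 (concatParts 0 z) × Good (concatParts 0 z) × LabelsFrom 0 (concatParts 0 z)
                × length (concatParts 0 z) ≡ sum (map proj₁ z)
            K = concat-good 0 z (proj₁ dcz)
            px : Pred x
            px = from x (subst (RGSFrom 0) (sym tlx) (proj₁ K)) (subst Good (sym tlx) (proj₁ (proj₂ K)))
            fs : decorationOf x ∈ compositions n × concatParts 0 (decorationOf x) ≡ toList x
            fs = decorationOf-spec x px

module LastElement where

  open import Data.Nat
  open import Data.Nat.Properties
  open import Data.List using (List; length; _++_; [_])
  open import Data.Product using (_×_; _,_; proj₁; proj₂)
  open import Data.Empty using (⊥; ⊥-elim)
  open import Relation.Nullary using (yes; no)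
  open import Relation.Binary.PropositionalEquality hiding ([_])
  open import Relation.Binary using (tri<; tri≈; tri>)
  open import Function using (_∘_)
  open ListArcs
  open ArcConditions
  open Concatenation

  LastOccurrence : List ℕ → ℕ → ℕ → Set
  LastOccurrence v x l = l < length v × at v l ≡ x × (∀ k → l < k → k < length v → at v k ≢ x)

  snoc-last-arc : ∀ {v x l} → LastOccurrence v x l → Arc (v ++ [ x ]) l (length v)
  snoc-last-arc {v} {x} {l} (l<n , el , nk) =
    arc l<n (subst (length v <_) (sym (length-snoc v x)) ≤-refl) (trans (at-++ˡ v [ x ] l l<n) (trans el (sym (at-last v x))))
      λ k l<k k<n ek → nk k l<k k<n (trans (sym (at-++ˡ v [ x ] k k<n)) (trans (sym ek) (trans (at-++ˡ v [ x ] l l<n) el)))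

  data ArcOfSnoc (v : List ℕ) (x l i j : ℕ) : Set where
    earlier : j < length v → Arc v i j → ArcOfSnoc v x l i j
    closing : i ≡ l → j ≡ length v → ArcOfSnoc v x l i j

  snoc-arc-cases : ∀ {v x l i j} → LastOccurrence v x l → Arc (v ++ [ x ]) i j → ArcOfSnoc v x l i j
  snoc-arc-cases {v} {x} {l} {i} {j} lo@(l<n , el , nk) a@(arc lt b e w) with j <? length v
  ... | yes j<n = earlier j<n (arc-++⁻ˡ a j<n)
  ... | no j≮n with ≤-antisym (≤-pred (subst (j <_) (length-snoc v x) b)) (≮⇒≥ j≮n)
  ...   | refl = closing i≡l refl
    where
    ei : at v i ≡ x
    ei = trans (sym (at-++ˡ v [ x ] i lt)) (trans e (at-last v x))
    i≡l : i ≡ l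
    i≡l with <-cmp i l
    ... | tri≈ _ eq _ = eq
    ... | tri< i<l _ _ = ⊥-elim (w l i<l l<n (trans (at-++ˡ v [ x ] i lt) (trans ei (trans (sym el) (sym (at-++ˡ v [ x ] l l<n))))))
    ... | tri> _ _ l<i = ⊥-elim (nk i l<i lt ei)

  module Snoc {v : List ℕ} {x l : ℕ} (lo : LastOccurrence v x l) where
    private
      n : ℕ
      n = length v
      v' : List ℕ
      v' = v ++ [ x ]
      atl : ∀ {i} → i < n → at v' i ≡ at v i
      atl {i} p = at-++ˡ v [ x ] i p

    QArcs-snoc : QArcs v → (suc l < n → (∀ i j → Arc v i j → i < l → l < j → ⊥) × at v (suc l) ≡ at v (pred n)
                                × (∀ i j → Arc v i j → at v i ≡ x → suc i < j → ⊥)) → QArcs v'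
    QArcs-snoc (n1 , n2 , n3) cond = crossfree′ , innerEndsJoined′ , longArcUnique′
      where
      crossfree′ : Crossfree v'
      crossfree′ i₁ j₁ i₂ j₂ a₁ a₂ p q r with snoc-arc-cases lo a₁ | snoc-arc-cases lo a₂
      ... | earlier b₁ x₁ | earlier b₂ x₂ = n1 _ _ _ _ x₁ x₂ p q r
      ... | earlier b₁ x₁ | closing refl refl with suc l <? n
      ...   | yes long = proj₁ (cond long) i₁ j₁ x₁ p q
      ...   | no short = <-irrefl refl (<-≤-trans q (≤-pred (≤-trans b₁ (≮⇒≥ short))))
      crossfree′ i₁ j₁ i₂ j₂ a₁ a₂ p q r | closing refl refl | earlier b₂ x₂ = <-irrefl refl (<-trans r b₂)
      crossfree′ i₁ j₁ i₂ j₂ a₁ a₂ p q r | closing refl refl | closing refl refl = <-irrefl refl p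
      innerEndsJoined′ : InnerEndsJoined v'
      innerEndsJoined′ i j a i<j with snoc-arc-cases lo a
      ... | earlier b x₁ = trans (atl (<-trans (s≤s i<j) b)) (trans (n2 i j x₁ i<j) (sym (atl (<-trans ≤-refl b))))
      ... | closing refl e with cond (subst (suc l <_) e (s≤s i<j))
      ...   | _ , c2 , _ = trans (atl (subst (suc l <_) e (s≤s i<j))) (trans c2
                (trans (cong (at v ∘ pred) (sym e)) (sym (atl (subst (j <_) e ≤-refl)))))
      longArcUnique′ : LongArcUnique v'
      longArcUnique′ i j i' j' a a' ee li li' with snoc-arc-cases lo a | snoc-arc-cases lo a'
      ... | earlier b x₁ | earlier b' x₂ = n3 i j i' j' x₁ x₂ (trans (sym (atl (<-trans (Arc.lt x₁) b))) (trans ee (atl (<-trans (Arc.lt x₂) b')))) li li'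
      ... | earlier b x₁ | closing refl refl = ⊥-elim (proj₂ (proj₂ (cond li')) i j x₁
              (trans (sym (atl (<-trans (Arc.lt x₁) b))) (trans ee (trans (atl (proj₁ lo)) (proj₁ (proj₂ lo))))) li)
      ... | closing refl refl | earlier b' x₂ = ⊥-elim (proj₂ (proj₂ (cond li)) i' j' x₂
              (trans (sym (atl (<-trans (Arc.lt x₂) b'))) (trans (sym ee) (trans (atl (proj₁ lo)) (proj₁ (proj₂ lo))))) li')
      ... | closing refl refl | closing refl refl = refl

    PncnArcs-snoc : PncnArcs v → (∀ i j → Arc v i j → j ≤ l) → PncnArcs v'
    PncnArcs-snoc (n1 , nn) cond = crossfree′ , nestfree′
      where
      crossfree′ : Crossfree v'
      crossfree′ i₁ j₁ i₂ j₂ a₁ a₂ p q r with snoc-arc-cases lo a₁ | snoc-arc-cases lo a₂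
      ... | earlier b₁ x₁ | earlier b₂ x₂ = n1 _ _ _ _ x₁ x₂ p q r
      ... | earlier b₁ x₁ | closing refl refl = <-irrefl refl (<-≤-trans q (cond _ _ x₁))
      ... | closing refl refl | earlier b₂ x₂ = <-irrefl refl (<-trans r b₂)
      ... | closing refl refl | closing refl refl = <-irrefl refl p
      nestfree′ : Nestfree v'
      nestfree′ i₁ j₁ i₂ j₂ a₁ a₂ p q r with snoc-arc-cases lo a₁ | snoc-arc-cases lo a₂
      ... | earlier b₁ x₁ | earlier b₂ x₂ = nn _ _ _ _ x₁ x₂ p q r
      ... | earlier b₁ x₁ | closing refl refl = <-irrefl refl (<-trans r b₁)
      ... | closing refl refl | earlier b₂ x₂ = <-irrefl refl (<-≤-trans (<-trans p q) (cond _ _ x₂))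
      ... | closing refl refl | closing refl refl = <-irrefl refl p

module QIndecomposables where

  open import Data.Nat
  open import Data.Nat.Properties
  open import Data.List using (List; []; _∷_; length; map; _++_; [_]; replicate; take; drop)
  open import Data.List.Properties using (length-map; length-++; length-replicate; length-drop)
  open import Data.Product using (Σ; _×_; _,_; proj₁; proj₂)
  open import Data.Sum using (_⊎_; inj₁; inj₂)
  open import Data.Empty using (⊥; ⊥-elim)
  open import Relation.Nullary using (yes; no)
  open import Relation.Binary.PropositionalEquality hiding ([_])
  open import Relation.Binary using (tri<; tri≈; tri>)
  open import Defs using (RGSFrom; new; old; [])
  open ListArcs
  open ArcConditions
  open Concatenation
  open RestrictedGrowth
  open LastElement
  open ArcsTotallyNested using (indecomposable-closes)

  rgs-replicate : ∀ a → RGSFrom 0 (replicate (suc a) 0)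
  rgs-replicate a = new (zeros a)
    where
    zeros : ∀ a → RGSFrom 1 (replicate a 0)
    zeros zero = []
    zeros (suc a) = old (s≤s z≤n) (zeros a)

  labelBound-replicate : ∀ a → labelBound 0 (replicate (suc a) 0) ≡ 1
  labelBound-replicate a = go a
    where
    go : ∀ a → labelBound 1 (replicate a 0) ≡ 1
    go zero = refl
    go (suc a) = go a

  equal-neighbours⇒arc-over : ∀ {xs c} → 0 < c → c < length xs → at xs (pred c) ≡ at xs c → Σ ℕ λ i → Σ ℕ λ j → Arc xs i j × i < c × c ≤ j
  equal-neighbours⇒arc-over {xs} {suc c} _ c<n e with arc-from {xs = xs} e ≤-refl c<n
  ... | q , a , q≤ = c , q , a , ≤-refl , Arc.lt a

  -- An indecomposable member of 𝒬 of size k + 1 ≥ 2 starts and ends in block 0.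
  -- If the closing arc is short, dropping the last element leaves a member of
  -- size k.  Otherwise block 0 is an initial run of a + 1 zeros plus the last
  -- element, and the long closing arc encloses, relabelled by one, a member of
  -- size j = k − a − 1 whose first and last elements are the arc's inner ends.
  QIndec : ℕ → List ℕ → Set
  QIndec k w = length w ≡ k × RGSFrom 0 w × QArcs w × Indecomposable w

  qExtend : ℕ → List ℕ → List ℕ
  qExtend zero w = w ++ [ 0 ]
  qExtend (suc a) w = (replicate (suc a) 0 ++ map suc w) ++ [ 0 ]

  qGrow : ℕ → ℕ → List ℕ → List ℕ
  qGrow k j w = qExtend (k ∸ j) w

  QPreimage : ℕ → List ℕ → Set
  QPreimage k' w = Σ ℕ λ j → 1 ≤ j × j ≤ suc k' × Σ (List ℕ) λ w' → QIndec j w' × w ≡ qGrow (suc k') j w'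

  labelBound-pos : ∀ {w} → RGSFrom 0 w → 0 < length w → 0 < labelBound 0 w
  labelBound-pos {x ∷ w} r _ = ≤-<-trans z≤n (at<labelBound {0} (x ∷ w) 0 (s≤s z≤n))

  closing-zero : ∀ {j w} → QIndec j w → 0 < j → LastOccurrence w 0 (pred j)
  closing-zero {suc j'} {x ∷ xs'} (l , r , nl , ind) _ =
    subst (_< length (x ∷ xs')) (cong pred l) ≤-refl ,
    trans (cong (at (x ∷ xs')) (sym (cong pred l))) (trans (sym (indecomposable-closes nl ind)) (rgs-head r)) ,
    λ k p q → ⊥-elim (<-irrefl refl (<-≤-trans p (≤-pred (subst (k <_) l q))))

  ∸-cases : ∀ k j → j ≤ k → (k ∸ j ≡ 0 × j ≡ k) ⊎ Σ ℕ λ a → k ∸ j ≡ suc a × k ≡ suc a + j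
  ∸-cases k j j≤k with k ∸ j in e
  ... | zero = inj₁ (refl , ≤-antisym j≤k (m∸n≡0⇒m≤n e))
  ... | suc a = inj₂ (a , refl , trans (sym (m∸n+n≡m j≤k)) (cong (_+ j) e))

  module ZerosThenShifted (a : ℕ) (w' : List ℕ) where
    R M v : List ℕ
    R = replicate (suc a) 0
    M = map suc w'
    v = R ++ M
    lenR : length R ≡ suc a
    lenR = length-replicate (suc a)
    lenM : length M ≡ length w'
    lenM = length-map suc w'
    lenv : length v ≡ suc a + length w'
    lenv = trans (length-++ R) (cong₂ _+_ lenR lenM)
    atR : ∀ p → p < suc a → at v p ≡ 0
    atR p p< = trans (at-++ˡ R M p (subst (p <_) (sym lenR) p<)) (at-replicate (suc a) 0 p p<)
    atM : ∀ t → t < length w' → at v (suc a + t) ≡ suc (at w' t)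
    atM t t< = trans (cong (λ z → at v (z + t)) (sym lenR)) (trans (at-++ʳ R M t) (at-map suc w' t t<))
    atM' : ∀ p → suc a ≤ p → p < length v → at v p ≢ 0
    atM' p le p< e with m+[n∸m]≡n le
    ... | pp = 1+n≢0 (trans (sym (atM (p ∸ suc a) (+-cancelˡ-< (suc a) _ _ (subst (_< _) (sym pp) (subst (p <_) lenv p<)))))
                  (trans (cong (at v) pp) e))
    dj : Disjoint R M
    dj i t i< t< e = 0≢1+n (trans (sym (at-replicate (suc a) 0 i (subst (i <_) lenR i<))) (trans e (at-map suc w' t (subst (t <_) lenM t<))))
    no-arc-over-last-zero : ∀ i j → Arc v i j → i < a → a < j → ⊥
    no-arc-over-last-zero i j x i<a a<j with arc-split {R} {M} dj x
    ... | inl b _ = <-irrefl refl (<-≤-trans a<j (≤-pred (subst (j <_) lenR b)))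
    ... | inr i' j' refl refl _ = <-irrefl refl (<-≤-trans i<a (≤-trans (n≤1+n a) (subst (_≤ length R + i') lenR (m≤m+n _ _))))
    zeros-short : ∀ i j → Arc v i j → at v i ≡ 0 → suc i < j → ⊥
    zeros-short i j x e0 long with arc-split {R} {M} dj x
    ... | inl b y = <-irrefl refl (subst (suc i <_) (replicate-short (suc a) 0 i j y) long)
    ... | inr i' j' refl refl y = atM' i (subst (_≤ length R + i') lenR (m≤m+n _ _)) (<-trans (Arc.lt x) (Arc.bd x)) e0

  qExtend-zero-closed : ∀ k' w' → QIndec (suc k') w' → QIndec (suc (suc k')) (qExtend 0 w')
  qExtend-zero-closed k' w' pw@(lw , rw , nlw , indw) = len , rgs , nl , ind
    where
    lo : LastOccurrence w' 0 k'
    lo = closing-zero pw (s≤s z≤n)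
    len : length (w' ++ [ 0 ]) ≡ suc (suc k')
    len = trans (length-snoc w' 0) (cong suc lw)
    rgs : RGSFrom 0 (w' ++ [ 0 ])
    rgs = rgs-++⁺ rw (old (labelBound-pos rw (subst (0 <_) (sym lw) (s≤s z≤n))) [])
    nl : QArcs (w' ++ [ 0 ])
    nl = Snoc.QArcs-snoc lo nlw (λ long → ⊥-elim (<-irrefl refl (subst (suc k' <_) lw long)))
    covered : ∀ c → 0 < c → c ≤ suc k' → Σ ℕ λ i → Σ ℕ λ j → Arc (w' ++ [ 0 ]) i j × i < c × c ≤ j
    covered c 0<c c≤k with m≤n⇒m<n∨m≡n c≤k
    ... | inj₁ c<k with nonCut⇒arc (indw c 0<c (subst (c <_) (sym lw) c<k))
    ...   | i , j , a , p , q = i , j , arc-++ˡ {w'} {[ 0 ]} a , p , q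
    covered c 0<c c≤k | inj₂ refl = k' , length w' , snoc-last-arc lo , ≤-refl , ≤-reflexive (sym lw)
    ind : Indecomposable (w' ++ [ 0 ])
    ind = arcs-over⇒indecomposable λ c 0<c c<n → covered c 0<c (≤-pred (subst (c <_) len c<n))

  qExtend-suc-closed : ∀ a j w' → 1 ≤ j → QIndec j w' → QIndec (suc (suc a + j)) (qExtend (suc a) w')
  qExtend-suc-closed a (suc j'') w' 1≤j pw@(lw , rw , nlw , indw) = len , rgs , nl , ind
    where
    open ZerosThenShifted a w'
    lv : length v ≡ suc a + suc j''
    lv = trans lenv (cong (suc a +_) lw)
    nlv : QArcs v
    nlv = QArcs-++⁺ {R} {M} dj (short⇒QArcs (replicate-short (suc a) 0)) (Shift.QArcs-shift 1 {w'} nlw)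
    lo : LastOccurrence v 0 a
    lo = subst (a <_) (sym lenv) (≤-trans (s≤s ≤-refl) (m≤m+n (suc a) _)) , atR a ≤-refl , λ p a<p p< → atM' p a<p p<
    wroot : at w' 0 ≡ at w' j''
    wroot = closes w' lw nlw indw
      where
      closes : ∀ w → length w ≡ suc j'' → QArcs w → Indecomposable w → at w 0 ≡ at w j''
      closes (x ∷ xs') refl nl ind = indecomposable-closes nl ind
    joined : at v (suc a) ≡ at v (pred (length v))
    joined = trans (trans (cong (at v) (sym (+-identityʳ (suc a)))) (atM 0 (subst (0 <_) (sym lw) 1≤j)))
      (trans (cong suc wroot) (trans (sym (atM j'' (subst (j'' <_) (sym lw) ≤-refl)))
        (cong (at v) (sym (cong pred (trans lv (+-suc (suc a) j'')))))))
    len : length (v ++ [ 0 ]) ≡ suc (suc a + suc j'')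
    len = trans (length-snoc v 0) (cong suc lv)
    rgsv : RGSFrom 0 v
    rgsv = rgs-++⁺ {xs = R} (rgs-replicate a) (subst (λ z → RGSFrom z M) (sym (labelBound-replicate a)) (rgs-shift 1 rw))
    rgs : RGSFrom 0 (v ++ [ 0 ])
    rgs = rgs-++⁺ rgsv (old (labelBound-pos rgsv (subst (0 <_) (sym lv) (s≤s z≤n))) [])
    nl : QArcs (v ++ [ 0 ])
    nl = Snoc.QArcs-snoc lo nlv (λ _ → no-arc-over-last-zero , joined , zeros-short)
    covered : ∀ c → 0 < c → c ≤ length v → Σ ℕ λ i → Σ ℕ λ j → Arc (v ++ [ 0 ]) i j × i < c × c ≤ j
    covered (suc c) 0<c c≤v with a <? suc c
    ... | yes a<c = a , length v , snoc-last-arc lo , a<c , c≤v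
    ... | no a≮c = equal-neighbours⇒arc-over 0<c (subst (suc c <_) (sym (length-snoc v 0)) (s≤s c≤v))
          (trans (at-++ˡ v [ 0 ] c (<-≤-trans ≤-refl c≤v)) (trans (atR c (≤-<-trans (n≤1+n c) (s≤s (≮⇒≥ a≮c))))
            (sym (trans (at-++ˡ v [ 0 ] (suc c) (<-≤-trans (s≤s (≮⇒≥ a≮c)) (subst (suc a ≤_) (sym lenv) (m≤m+n _ _)))) (atR (suc c) (s≤s (≮⇒≥ a≮c)))))))
    ind : Indecomposable (v ++ [ 0 ])
    ind = arcs-over⇒indecomposable λ c 0<c c<n → covered c 0<c (≤-pred (subst (c <_) (length-snoc v 0) c<n))

  qGrow-closed : ∀ k' j w' → 1 ≤ j → j ≤ suc k' → QIndec j w' → QIndec (suc (suc k')) (qGrow (suc k') j w')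
  qGrow-closed k' j w' 1≤j j≤k pw with ∸-cases (suc k') j j≤k
  ... | inj₁ (e0 , refl) rewrite e0 = qExtend-zero-closed k' w' pw
  ... | inj₂ (a , e1 , ek) rewrite e1 = subst (λ z → QIndec (suc z) (qExtend (suc a) w')) (sym ek) (qExtend-suc-closed a j w' 1≤j pw)

  module QShrink (k' : ℕ) (x : ℕ) (xs' : List ℕ) (pq : QIndec (suc (suc k')) (x ∷ xs')) (l : ℕ) (alk : Arc (x ∷ xs') l (suc k'))
            (atk : at (x ∷ xs') (suc k') ≡ 0) where
    w : List ℕ
    w = x ∷ xs'
    k : ℕ
    k = suc k'
    lw : length w ≡ suc k
    lw = proj₁ pq
    rw : RGSFrom 0 w
    rw = proj₁ (proj₂ pq)
    nlw : QArcs w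
    nlw = proj₁ (proj₂ (proj₂ pq))
    indw : Indecomposable w
    indw = proj₂ (proj₂ (proj₂ pq))
    k<n : k < length w
    k<n = subst (k <_) (sym lw) ≤-refl

    short : l ≡ k' → QPreimage k' w
    short l≡ = k , s≤s z≤n , ≤-refl , w' , pw' , subst (λ z → w ≡ qExtend z w') (sym (n∸n≡0 k)) eqw
      where
      w' : List ℕ
      w' = take k w
      lw' : length w' ≡ k
      lw' = length-take≤ k w (<⇒≤ k<n)
      eqw : w ≡ w' ++ [ 0 ]
      eqw = at-ext w (w' ++ [ 0 ]) (trans lw (sym (trans (length-snoc w' 0) (cong suc lw')))) pt
        where
        pt : ∀ p → p < length w → at w p ≡ at (w' ++ [ 0 ]) p
        pt p p< with p <? k
        ... | yes p<k = sym (trans (at-++ˡ w' [ 0 ] p (subst (p <_) (sym lw') p<k)) (at-take k w p p<k))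
        ... | no p≮k with ≤-antisym (≤-pred (subst (p <_) lw p<)) (≮⇒≥ p≮k)
        ...   | refl = trans atk (sym (subst (λ z → at (w' ++ [ 0 ]) z ≡ 0) lw' (at-last w' 0)))
      rgs' : RGSFrom 0 w'
      rgs' = proj₁ (rgs-++⁻ w' (subst (RGSFrom 0) eqw rw))
      nl' : QArcs w'
      nl' = proj₁ (QArcs-++⁻ {w'} {[ 0 ]} (subst QArcs eqw nlw))
      ind' : Indecomposable w'
      ind' c 0<c c<n ct = indw c 0<c (<-trans c<n' k<n) ctw
        where
        c<n' : c < k
        c<n' = subst (c <_) lw' c<n
        ctw : Cut w c
        ctw i j i<n j<n e i<c with j <? k
        ... | yes j<k = ct i j (subst (i <_) (sym lw') (<-trans i<c c<n')) (subst (j <_) (sym lw') j<k)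
                           (trans (at-take k w i (<-trans i<c c<n')) (trans e (sym (at-take k w j j<k)))) i<c
        ... | no j≮k with ≤-antisym (≤-pred (subst (j <_) lw j<n)) (≮⇒≥ j≮k)
        ...   | refl = ⊥-elim (<-irrefl refl (<-≤-trans (ct i k' (subst (i <_) (sym lw') (<-trans i<c c<n')) (subst (k' <_) (sym lw') ≤-refl)
                          (trans (at-take k w i (<-trans i<c c<n')) (trans e (trans (sym (Arc.eq alk)) (trans (cong (at w) l≡) (sym (at-take k w k' ≤-refl)))))) i<c)
                          (≤-pred c<n')))
      pw' : QIndec k w'
      pw' = lw' , rgs' , nl' , ind'

    module LongClosingArc (long : suc l < k) where
      n3 : LongArcUnique w
      n3 = proj₂ (proj₂ nlw)
      n2 : InnerEndsJoined w
      n2 = proj₁ (proj₂ nlw)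
      j : ℕ
      j = k ∸ suc l
      kj : suc l + j ≡ k
      kj = m+[n∸m]≡n (<⇒≤ long)
      j≥1 : 1 ≤ j
      j≥1 with j | kj
      ... | zero | e = ⊥-elim (<-irrefl refl (subst (suc l <_) (trans (sym e) (+-identityʳ (suc l))) long))
      ... | suc _ | _ = s≤s z≤n
      x0 : x ≡ 0
      x0 = rgs-head rw
      atl : at w l ≡ 0
      atl = trans (Arc.eq alk) atk
      l<n : l < length w
      l<n = <-trans (Arc.lt alk) k<n
      zeros : ∀ p → p ≤ l → at w p ≡ 0
      zeros zero _ = x0
      zeros (suc p) sp≤l with m≤n⇒m<n∨m≡n sp≤l
      ... | inj₂ refl = atl
      ... | inj₁ sp<l with at w (suc p) ≟ 0
      ...   | yes e = e
      ...   | no ne with arc-over-gap {xs = w} {i = 0} {j = l} {k = suc p} (trans x0 (sym atl)) l<n (s≤s z≤n) sp<l (λ e → ne (trans e x0))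
      ...     | p2 , q2 , a2 , e2 , _ , p2<sp , sp<q2 , _ =
                ⊥-elim (<-irrefl refl (<-trans (subst (_< suc p) (n3 p2 q2 l k a2 alk (trans e2 (trans x0 (sym atl))) (≤-<-trans p2<sp sp<q2) long) p2<sp) sp<l))
      nonzero : ∀ p → l < p → p < k → at w p ≢ 0
      nonzero p l<p p<k e = Arc.btw alk p l<p p<k (trans atl (sym e))
      tk : List ℕ
      tk = take k w
      ltk : length tk ≡ k
      ltk = length-take≤ k w (<⇒≤ k<n)
      dk w' : List ℕ
      dk = drop (suc l) tk
      w' = map pred dk
      lw' : length w' ≡ j
      lw' = trans (length-map pred dk) (trans (length-drop (suc l) tk) (cong (_∸ suc l) ltk))
      ldk : length dk ≡ j
      ldk = trans (length-drop (suc l) tk) (cong (_∸ suc l) ltk)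
      atw : ∀ t → t < j → at w' t ≡ pred (at w (suc l + t))
      atw t t<j = trans (at-map pred dk t (subst (t <_) (sym ldk) t<j))
                    (cong pred (trans (at-drop (suc l) tk t) (at-take k w (suc l + t) (subst (suc l + t <_) kj (+-monoʳ-< (suc l) t<j)))))
      open ZerosThenShifted l w'
      sp : ∀ z → z ≢ 0 → suc (pred z) ≡ z
      sp zero ne = ⊥-elim (ne refl)
      sp (suc z) _ = refl
      atMw : ∀ t → t < j → at M t ≡ at w (suc l + t)
      atMw t t<j = trans (at-map suc w' t (subst (t <_) (sym lw') t<j)) (trans (cong suc (atw t t<j))
                     (sp _ (nonzero (suc l + t) (s≤s (m≤m+n l t)) (subst (suc l + t <_) kj (+-monoʳ-< (suc l) t<j)))))
      full : List ℕ
      full = v ++ [ 0 ]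
      lv : length v ≡ k
      lv = trans lenv (trans (cong (suc l +_) lw') kj)
      eqw : w ≡ full
      eqw = at-ext w full (trans lw (sym (trans (length-snoc v 0) (cong suc lv)))) pt
        where
        pt : ∀ p → p < length w → at w p ≡ at full p
        pt p p< with p <? k
        ... | no p≮k with ≤-antisym (≤-pred (subst (p <_) lw p<)) (≮⇒≥ p≮k)
        ...   | refl = trans atk (sym (subst (λ z → at full z ≡ 0) lv (at-last v 0)))
        pt p p< | yes p<k with p ≤? l
        ...   | yes p≤l = trans (zeros p p≤l) (sym (trans (at-++ˡ v [ 0 ] p (subst (p <_) (sym lv) p<k)) (atR p (s≤s p≤l))))
        ...   | no p≰l with m+[n∸m]≡n {suc l} {p} (≰⇒> p≰l)
        ...     | pp = trans (cong (at w) (sym pp)) (sym (trans (at-++ˡ v [ 0 ] p (subst (p <_) (sym lv) p<k))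
                     (trans (cong (at v) (sym pp)) (trans (atM (p ∸ suc l) (subst (_ <_) (sym lw') t<j)) (trans (cong suc (atw _ t<j))
                       (sp _ (nonzero (suc l + (p ∸ suc l)) (subst (l <_) (sym pp) (≰⇒> p≰l)) (subst (_< k) (sym pp) p<k))))))))
          where
          t<j : p ∸ suc l < j
          t<j = +-cancelˡ-< (suc l) _ _ (subst (_< suc l + j) (sym pp) (subst (p <_) (sym kj) p<k))
      rgs' : RGSFrom 0 w'
      rgs' = rgs-unshift 1 w' (subst (λ z → RGSFrom z M) (labelBound-replicate l)
               (proj₂ (rgs-++⁻ R (proj₁ (rgs-++⁻ v (subst (RGSFrom 0) eqw rw))))))
      nl' : QArcs w'
      nl' = Shift.QArcs-unshift 1 {w'} (proj₂ (QArcs-++⁻ {R} {M} (proj₁ (QArcs-++⁻ {v} {[ 0 ]} (subst QArcs eqw nlw)))))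
      ind' : Indecomposable w'
      ind' = Shift.indecomposable-unshift 1 {w'} indM
        where
        pj : Σ ℕ λ j' → j ≡ suc j'
        pj = ps j≥1
          where
          ps : ∀ {j} → 1 ≤ j → Σ ℕ λ j' → j ≡ suc j'
          ps {suc j} _ = j , refl
        j' : ℕ
        j' = proj₁ pj
        k'eq : suc l + j' ≡ k'
        k'eq = cong pred (trans (sym (+-suc (suc l) j')) (trans (cong (suc l +_) (sym (proj₂ pj))) kj))
        eM : at M 0 ≡ at M j'
        eM = trans (atMw 0 j≥1) (trans (cong (at w) (+-identityʳ (suc l)))
               (trans (n2 l k' alk (≤-pred long))
                 (sym (trans (atMw j' (subst (j' <_) (sym (proj₂ pj)) ≤-refl)) (cong (at w) k'eq)))))
        indM : Indecomposable M
        indM c 0<c c<n ct = <-irrefl refl (<-≤-trans (ct 0 j' (≤-<-trans z≤n c<n) (subst (j' <_) (sym (trans lenM (trans lw' (proj₂ pj)))) ≤-refl) eM 0<c)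
                              (≤-pred (subst (c <_) (trans lenM (trans lw' (proj₂ pj))) c<n)))
      res : QPreimage k' w
      res = j , j≥1 , m∸n≤m k (suc l) , w' , (lw' , rgs' , nl' , ind') ,
            subst (λ z → w ≡ qExtend z w') (sym (m∸[m∸n]≡n (<⇒≤ long))) eqw

  qShrink : ∀ k' w → QIndec (suc (suc k')) w → QPreimage k' w
  qShrink k' [] (() , _)
  qShrink k' (x ∷ xs') pq@(lw , rw , nlw , indw) = byClosingArc (arc-to {xs = x ∷ xs'} {i = 0} (trans x0 (sym atk)) (s≤s z≤n) k<n)
    where
    k<n : suc k' < length (x ∷ xs')
    k<n = subst (suc k' <_) (sym lw) ≤-refl
    x0 : x ≡ 0
    x0 = rgs-head rw
    atk : at (x ∷ xs') (suc k') ≡ 0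
    atk = trans (sym (subst (λ z → x ≡ at (x ∷ xs') z) (cong pred lw) (indecomposable-closes nlw indw))) x0
    byClosingArc : (Σ ℕ λ l → Arc (x ∷ xs') l (suc k') × 0 ≤ l) → QPreimage k' (x ∷ xs')
    byClosingArc (l , alk , _) with suc l <? suc k'
    ... | yes long = QShrink.LongClosingArc.res k' x xs' pq l alk atk long
    ... | no nlong = QShrink.short k' x xs' pq l alk atk (≤-antisym (≤-pred (Arc.lt alk)) (≤-pred (≮⇒≥ nlong)))

  qExtend-zero≢suc : ∀ {k' w' j' w''} a → 1 ≤ j' → QIndec (suc k') w' → QIndec j' w'' → suc k' ≡ suc a + j' →
    qExtend 0 w' ≢ qExtend (suc a) w''
  qExtend-zero≢suc {k'} {w'} {j'} {w''} a 1≤j' pw' pw'' ek e = atM' k' sa≤ k'<v (trans (sym rgt) (trans (cong (λ z → at z k') (sym e)) lft))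
    where
    open ZerosThenShifted a w''
    lv : length v ≡ suc k'
    lv = trans lenv (trans (cong (suc a +_) (proj₁ pw'')) (sym ek))
    sa≤ : suc a ≤ k'
    sa≤ = subst (suc a ≤_) (cong pred (sym ek)) (subst (_≤ a + j') (+-comm a 1) (+-monoʳ-≤ a 1≤j'))
    k'<v : k' < length v
    k'<v = subst (k' <_) (sym lv) ≤-refl
    lo : LastOccurrence w' 0 k'
    lo = closing-zero pw' (s≤s z≤n)
    lft : at (w' ++ [ 0 ]) k' ≡ 0
    lft = trans (at-++ˡ w' [ 0 ] k' (proj₁ lo)) (proj₁ (proj₂ lo))
    rgt : at (v ++ [ 0 ]) k' ≡ at v k'
    rgt = at-++ˡ v [ 0 ] k' k'<v

  qExtend-runs-differ : ∀ {k a a' j j' w' w''} → a < a' → 1 ≤ j → QIndec j w' → QIndec j' w'' → k ≡ suc a + j → k ≡ suc a' + j' →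
    qExtend (suc a) w' ≢ qExtend (suc a') w''
  qExtend-runs-differ {k} {a} {a'} {j} {j'} {w'} {w''} a<a' 1≤j pw' pw'' ek ek' e =
    V.atM' (suc a) ≤-refl sa<v (trans (sym (at-++ˡ V.v [ 0 ] (suc a) sa<v))
      (trans (cong (λ z → at z (suc a)) e) (trans (at-++ˡ V'.v [ 0 ] (suc a) sa<v'') (V'.atR (suc a) (s≤s a<a')))))
    where
    module V = ZerosThenShifted a w'
    module V' = ZerosThenShifted a' w''
    sa<k : suc a < k
    sa<k = subst (suc a <_) (sym ek) (subst (_≤ suc a + j) (+-comm (suc a) 1) (+-monoʳ-≤ (suc a) 1≤j))
    sa<v : suc a < length V.v
    sa<v = subst (suc a <_) (sym (trans V.lenv (trans (cong (suc a +_) (proj₁ pw')) (sym ek)))) sa<k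
    sa<v'' : suc a < length V'.v
    sa<v'' = subst (suc a <_) (sym (trans V'.lenv (trans (cong (suc a' +_) (proj₁ pw'')) (sym ek')))) sa<k

  qExtend-suc-injective : ∀ {k} a a' {j j' w' w''} → 1 ≤ j → 1 ≤ j' → QIndec j w' → QIndec j' w'' →
    k ≡ suc a + j → k ≡ suc a' + j' → qExtend (suc a) w' ≡ qExtend (suc a') w'' → j ≡ j' × w' ≡ w''
  qExtend-suc-injective a a' {j} {j'} {w'} {w''} 1≤j 1≤j' pw' pw'' ek ek' e with <-cmp a a'
  ... | tri< a<a' _ _ = ⊥-elim (qExtend-runs-differ a<a' 1≤j pw' pw'' ek ek' e)
  ... | tri> _ _ a'<a = ⊥-elim (qExtend-runs-differ a'<a 1≤j' pw'' pw' ek' ek (sym e))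
  ... | tri≈ _ refl _ = jj , Data.List.Properties.map-injective suc-injective (proj₂ (++-injective R M R M'' refl (proj₁ (++-injective v [ 0 ] v'' [ 0 ] lvv e))))
    where
    open ZerosThenShifted a w'
    M'' v'' : List ℕ
    M'' = map suc w''
    v'' = R ++ M''
    jj : j ≡ j'
    jj = +-cancelˡ-≡ (suc a) _ _ (trans (sym ek) ek')
    lvv : length v ≡ length v''
    lvv = trans lenv (trans (cong (suc a +_) (trans (proj₁ pw') (trans jj (sym (proj₁ pw''))))) (sym (ZerosThenShifted.lenv a w'')))

  qGrow-injective : ∀ k' j j' w' w'' → 1 ≤ j → j ≤ suc k' → 1 ≤ j' → j' ≤ suc k' → QIndec j w' → QIndec j' w'' →
         qGrow (suc k') j w' ≡ qGrow (suc k') j' w'' → j ≡ j' × w' ≡ w''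
  qGrow-injective k' j j' w' w'' 1≤j j≤k 1≤j' j'≤k pw' pw'' e with ∸-cases (suc k') j j≤k | ∸-cases (suc k') j' j'≤k
  ... | inj₁ (e0 , refl) | inj₁ (e0' , refl) rewrite e0 =
        refl , proj₁ (++-injective w' [ 0 ] w'' [ 0 ] (trans (proj₁ pw') (sym (proj₁ pw''))) e)
  ... | inj₁ (e0 , refl) | inj₂ (a' , e1' , ek') rewrite e0 | e1' = ⊥-elim (qExtend-zero≢suc a' 1≤j' pw' pw'' ek' e)
  ... | inj₂ (a , e1 , ek) | inj₁ (e0' , refl) rewrite e1 | e0' = ⊥-elim (qExtend-zero≢suc a 1≤j pw'' pw' ek (sym e))
  ... | inj₂ (a , e1 , ek) | inj₂ (a' , e1' , ek') rewrite e1 | e1' = qExtend-suc-injective a a' 1≤j 1≤j' pw' pw'' ek ek' e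

  qBase-unique : ∀ w → QIndec 1 w → w ≡ 0 ∷ []
  qBase-unique (x ∷ []) (_ , r , _) = cong (_∷ []) (rgs-head r)

  qBase : QIndec 1 (0 ∷ [])
  qBase = refl , new [] , short⇒QArcs singleton-short , λ { (suc c) _ (s≤s ()) }

  module QEnumeration = IndecomposableEnumeration.GrowthEnumeration QIndec qGrow qBase-unique qBase qShrink qGrow-closed qGrow-injective

module PncnIndecomposables where

  open import Data.Nat
  open import Data.Nat.Properties
  open import Data.List using (List; []; _∷_; length; _++_; [_]; take; drop)
  open import Data.List.Properties using (length-++; length-drop)
  open import Data.Product using (Σ; _×_; _,_; proj₁; proj₂)
  open import Data.Empty using (⊥; ⊥-elim)
  open import Relation.Nullary using (yes; no)
  open import Relation.Binary.PropositionalEquality hiding ([_])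
  open import Relation.Binary using (tri<; tri≈; tri>)
  open import Defs using (RGSFrom; new; old; [])
  open ListArcs
  open ArcConditions
  open Concatenation
  open RestrictedGrowth
  open LastElement

  consecutive : ℕ → ℕ → List ℕ
  consecutive B zero = []
  consecutive B (suc m) = B ∷ consecutive (suc B) m

  length-consecutive : ∀ B m → length (consecutive B m) ≡ m
  length-consecutive B zero = refl
  length-consecutive B (suc m) = cong suc (length-consecutive (suc B) m)

  at-consecutive : ∀ B m t → t < m → at (consecutive B m) t ≡ B + t
  at-consecutive B (suc m) zero _ = sym (+-identityʳ B)
  at-consecutive B (suc m) (suc t) (s≤s p) = trans (at-consecutive (suc B) m t p) (sym (+-suc B t))

  rgs-consecutive : ∀ B m → RGSFrom B (consecutive B m)
  rgs-consecutive B zero = []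
  rgs-consecutive B (suc m) = new (rgs-consecutive (suc B) m)

  labelBound-consecutive : ∀ B m → labelBound B (consecutive B m) ≡ B + m
  labelBound-consecutive B zero = sym (+-identityʳ B)
  labelBound-consecutive B (suc m) = trans (cong (λ z → labelBound z (consecutive (suc B) m)) (⊔-new B)) (trans (labelBound-consecutive (suc B) m) (sym (+-suc B m)))

  consecutive-no-arc : ∀ B m i j → Arc (consecutive B m) i j → ⊥
  consecutive-no-arc B m i j (arc l b e w) = <-irrefl refl (subst (i <_) (sym (+-cancelˡ-≡ B _ _ (trans (sym (at-consecutive B m i i<m)) (trans e (at-consecutive B m j j<m))))) l)
    where
    j<m : j < m
    j<m = subst (j <_) (length-consecutive B m) b
    i<m : i < m
    i<m = <-trans l j<m

  -- An indecomposable noncrossing nonnesting partition of size k + 1 ≥ 2 ends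
  -- with an arc (l , k) containing only singletons, and its first l + 1 elements
  -- form such a partition of size j = l + 1; pncnGrow k j appends the k − j
  -- singletons and the closing element.
  PncnIndec : ℕ → List ℕ → Set
  PncnIndec k w = length w ≡ k × RGSFrom 0 w × PncnArcs w × Indecomposable w

  pncnGrow : ℕ → ℕ → List ℕ → List ℕ
  pncnGrow k j w = (w ++ consecutive (labelBound 0 w) (k ∸ j)) ++ [ at w (pred j) ]

  PncnPreimage : ℕ → List ℕ → Set
  PncnPreimage k' w = Σ ℕ λ j → 1 ≤ j × j ≤ suc k' × Σ (List ℕ) λ w' → PncnIndec j w' × w ≡ pncnGrow (suc k') j w'

  pncnBase-unique : ∀ w → PncnIndec 1 w → w ≡ 0 ∷ []
  pncnBase-unique (x ∷ []) (_ , r , _) = cong (_∷ []) (rgs-head r)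

  pncnBase : PncnIndec 1 (0 ∷ [])
  pncnBase = refl , new [] , short⇒PncnArcs singleton-short , λ { (suc c) _ (s≤s ()) }

  module PncnGrow (k' j : ℕ) (w' : List ℕ) (1≤j : 1 ≤ j) (j≤k : j ≤ suc k') (pw : PncnIndec j w') where
    k : ℕ
    k = suc k'
    lw : length w' ≡ j
    lw = proj₁ pw
    rw : RGSFrom 0 w'
    rw = proj₁ (proj₂ pw)
    nw : PncnArcs w'
    nw = proj₁ (proj₂ (proj₂ pw))
    iw : Indecomposable w'
    iw = proj₂ (proj₂ (proj₂ pw))
    B m x : ℕ
    B = labelBound 0 w'
    m = k ∸ j
    x = at w' (pred j)
    S v : List ℕ
    S = consecutive B m
    v = w' ++ S
    sucpred : ∀ {j} → 1 ≤ j → j ≡ suc (pred j)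
    sucpred {suc j} _ = refl
    pj< : pred j < j
    pj< = pred< 1≤j
      where
      pred< : ∀ {j} → 1 ≤ j → pred j < j
      pred< {suc j} _ = ≤-refl
    lv : length v ≡ k
    lv = trans (length-++ w') (trans (cong₂ _+_ lw (length-consecutive B m)) (m+[n∸m]≡n j≤k))
    x<B : x < B
    x<B = at<labelBound {0} w' (pred j) (subst (pred j <_) (sym lw) pj<)
    dj : Disjoint w' S
    dj i t i< t< e = <-irrefl refl (<-≤-trans (at<labelBound {0} w' i i<) (subst (B ≤_) (sym (trans e (at-consecutive B m t (subst (t <_) (length-consecutive B m) t<)))) (m≤m+n B t)))
    atS : ∀ p → j ≤ p → p < length v → B ≤ at v p
    atS p j≤p p< with m+[n∸m]≡n j≤p
    ... | pp = subst (B ≤_) (sym (trans (cong (at v) (sym (trans (cong (_+ (p ∸ j)) lw) pp)))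
                 (trans (at-++ʳ w' S (p ∸ j)) (at-consecutive B m (p ∸ j) t<)))) (m≤m+n B _)
      where
      t< : p ∸ j < m
      t< = +-cancelˡ-< j _ _ (subst (_< j + m) (sym pp) (subst (p <_) (trans (length-++ w') (cong₂ _+_ lw (length-consecutive B m))) p<))
    rv : RGSFrom 0 v
    rv = rgs-++⁺ rw (rgs-consecutive B m)
    cntv : labelBound 0 v ≡ B + m
    cntv = trans (labelBound-++ 0 w' S) (labelBound-consecutive B m)
    lo : LastOccurrence v x (pred j)
    lo = <-≤-trans pj< (subst (j ≤_) (sym lv) j≤k) , at-++ˡ w' S (pred j) (subst (pred j <_) (sym lw) pj<) ,
         λ p pj<p p< e → <-irrefl refl (<-≤-trans x<B (subst (B ≤_) e (atS p (subst (_≤ p) (sym (sucpred 1≤j)) pj<p) p<)))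
    result : PncnIndec (suc k) (pncnGrow k j w')
    result = trans (length-snoc v x) (cong suc lv) ,
             rgs-++⁺ rv (old (subst (x <_) (sym cntv) (<-≤-trans x<B (m≤m+n B m))) []) ,
             Snoc.PncnArcs-snoc lo (PncnArcs-++⁺ {w'} {S} dj nw (short⇒PncnArcs λ i j a → ⊥-elim (consecutive-no-arc B m i j a))) cond ,
             arcs-over⇒indecomposable cover
      where
      cond : ∀ i jj → Arc v i jj → jj ≤ pred j
      cond i jj a with arc-split {w'} {S} dj a
      ... | inl b _ = ≤-pred (subst (suc jj ≤_) (sucpred 1≤j) (subst (jj <_) lw b))
      ... | inr _ _ _ _ y = ⊥-elim (consecutive-no-arc B m _ _ y)
      cover : ∀ c → 0 < c → c < length (v ++ [ x ]) → Σ ℕ λ i → Σ ℕ λ jj → Arc (v ++ [ x ]) i jj × i < c × c ≤ jj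
      cover c 0<c c< with c <? j
      ... | yes c<j with nonCut⇒arc (iw c 0<c (subst (c <_) (sym lw) c<j))
      ...   | i , jj , a , p , q = i , jj , arc-++ˡ {v} {[ x ]} (arc-++ˡ {w'} {S} a) , p , q
      cover c 0<c c< | no c≮j = pred j , length v , snoc-last-arc lo , <-≤-trans pj< (≮⇒≥ c≮j) , ≤-pred (subst (c <_) (length-snoc v x) c<)

  pncnGrow-closed : ∀ k' j w' → 1 ≤ j → j ≤ suc k' → PncnIndec j w' → PncnIndec (suc (suc k')) (pncnGrow (suc k') j w')
  pncnGrow-closed k' j w' 1≤j j≤k pw = PncnGrow.result k' j w' 1≤j j≤k pw

  rgs-fresh-run : ∀ {B} ys m → RGSFrom B ys → m ≤ length ys → (∀ t → t < m → B ≤ at ys t) →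
              (∀ u t → u < t → t < m → at ys u ≢ at ys t) → ∀ t → t < m → at ys t ≡ B + t
  rgs-fresh-run [] zero _ _ _ _ t ()
  rgs-fresh-run [] (suc m) _ () _ _ _ _
  rgs-fresh-run (y ∷ ys) zero _ _ _ _ t ()
  rgs-fresh-run {B} (y ∷ ys) (suc m) (new r) (s≤s le) ge ds zero _ = sym (+-identityʳ B)
  rgs-fresh-run {B} (y ∷ ys) (suc m) (new r) (s≤s le) ge ds (suc t) (s≤s t<m) =
    trans (rgs-fresh-run ys m r le ge' ds' t t<m) (sym (+-suc B t))
    where
    ge' : ∀ t → t < m → suc B ≤ at ys t
    ge' t t<m = ≤∧≢⇒< (ge (suc t) (s≤s t<m)) (λ e → ds 0 (suc t) (s≤s z≤n) (s≤s t<m) e)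
    ds' : ∀ u t → u < t → t < m → at ys u ≢ at ys t
    ds' u t u<t t<m = ds (suc u) (suc t) (s≤s u<t) (s≤s t<m)
  rgs-fresh-run {B} (y ∷ ys) (suc m) (old y<B r) _ ge _ zero _ = ⊥-elim (<-irrefl refl (<-≤-trans y<B (ge 0 (s≤s z≤n))))
  rgs-fresh-run {B} (y ∷ ys) (suc m) (old y<B r) _ ge _ (suc t) _ = ⊥-elim (<-irrefl refl (<-≤-trans y<B (ge 0 (s≤s z≤n))))

  module PncnShrink (k' : ℕ) (w : List ℕ) (pw : PncnIndec (suc (suc k')) w) (l : ℕ) (alk : Arc w l (suc k')) where
    k : ℕ
    k = suc k'
    lw : length w ≡ suc k
    lw = proj₁ pw
    rw : RGSFrom 0 w
    rw = proj₁ (proj₂ pw)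
    n1 : Crossfree w
    n1 = proj₁ (proj₁ (proj₂ (proj₂ pw)))
    nn : Nestfree w
    nn = proj₂ (proj₁ (proj₂ (proj₂ pw)))
    iw : Indecomposable w
    iw = proj₂ (proj₂ (proj₂ pw))
    k<n : k < length w
    k<n = subst (k <_) (sym lw) ≤-refl
    singleton-inside : ∀ p → l < p → p < k → ∀ q → q < length w → q ≢ p → at w q ≢ at w p
    singleton-inside p l<p p<k q q<n q≢p e with <-cmp q p
    ... | tri≈ _ qp _ = q≢p qp
    ... | tri< q<p _ _ with arc-to {xs = w} e q<p (<-trans p<k k<n)
    ...   | i , aip , _ with <-cmp i l
    ...     | tri< i<l _ _ = n1 i p l k aip alk i<l l<p p<k
    ...     | tri> _ _ l<i = nn l k i p alk aip l<i (Arc.lt aip) p<k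
    ...     | tri≈ _ refl _ = Arc.btw alk p l<p p<k (Arc.eq aip)
    singleton-inside p l<p p<k q q<n q≢p e | tri> _ _ p<q with arc-from {xs = w} (sym e) p<q q<n
    ...   | jj , apj , _ with <-cmp jj k
    ...     | tri< jj<k _ _ = nn l k p jj alk apj l<p (Arc.lt apj) jj<k
    ...     | tri> _ _ k<jj = n1 l k p jj alk apj l<p p<k k<jj
    ...     | tri≈ _ refl _ = Arc.btw alk p l<p p<k (trans (Arc.eq alk) (sym (Arc.eq apj)))
    j : ℕ
    j = suc l
    j≤k : j ≤ k
    j≤k = Arc.lt alk
    w' rest : List ℕ
    w' = take j w
    rest = drop j w
    lw' : length w' ≡ j
    lw' = length-take≤ j w (<⇒≤ (<-≤-trans (s≤s j≤k) (≤-reflexive (sym lw))))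
    ew : w' ++ rest ≡ w
    ew = Data.List.Properties.take++drop≡id j w
    rr : RGSFrom 0 w' × RGSFrom (labelBound 0 w') rest
    rr = rgs-++⁻ w' {rest} (subst (RGSFrom 0) (sym ew) rw)
    B m : ℕ
    B = labelBound 0 w'
    m = k ∸ j
    atr : ∀ t → at rest t ≡ at w (j + t)
    atr t = at-drop j w t
    jm : j + m ≡ k
    jm = m+[n∸m]≡n j≤k
    fresh : ∀ t → t < m → at rest t ≡ B + t
    fresh = rgs-fresh-run rest m (proj₂ rr) mle ge ds
      where
      mle : m ≤ length rest
      mle = subst (m ≤_) (sym (trans (length-drop j w) (cong (_∸ j) lw))) (∸-monoˡ-≤ j (n≤1+n k))
      pos : ∀ t → t < m → l < j + t × j + t < k
      pos t t<m = s≤s (m≤m+n l t) , subst (j + t <_) jm (+-monoʳ-< j t<m)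
      ge : ∀ t → t < m → B ≤ at rest t
      ge t t<m with B ≤? at rest t
      ... | yes p = p
      ... | no np with rgs-labels-occur (proj₁ rr) (at rest t) z≤n (≰⇒> np)
      ...   | q , q<j , eq = ⊥-elim (singleton-inside (j + t) (proj₁ (pos t t<m)) (proj₂ (pos t t<m)) q (<-trans (subst (q <_) lw' q<j) (<-≤-trans (s≤s j≤k) (≤-reflexive (sym lw))))
                   (λ e → <-irrefl refl (<-≤-trans (subst (q <_) lw' q<j) (subst (j ≤_) (sym e) (m≤m+n j t))))
                   (trans (sym (at-take j w q (subst (q <_) lw' q<j))) (trans eq (atr t))))
      ds : ∀ u t → u < t → t < m → at rest u ≢ at rest t
      ds u t u<t t<m e = singleton-inside (j + t) (proj₁ (pos t t<m)) (proj₂ (pos t t<m)) (j + u)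
          (<-trans (+-monoʳ-< j (<-trans u<t t<m)) (subst (_< length w) (sym jm) k<n))
          (λ e' → <-irrefl refl (subst (_< t) (+-cancelˡ-≡ j _ _ e') u<t))
          (trans (sym (atr u)) (trans e (atr t)))
    x : ℕ
    x = at w' l
    S full : List ℕ
    S = consecutive B m
    full = (w' ++ S) ++ [ x ]
    lws : length (w' ++ S) ≡ k
    lws = trans (length-++ w') (trans (cong₂ _+_ lw' (length-consecutive B m)) jm)
    eqw : w ≡ full
    eqw = at-ext w full (trans lw (sym (trans (length-snoc (w' ++ S) x) (cong suc lws)))) pt
      where
      pt : ∀ p → p < length w → at w p ≡ at full p
      pt p p< with p <? k
      ... | no p≮k with ≤-antisym (≤-pred (subst (p <_) lw p<)) (≮⇒≥ p≮k)
      ...   | refl = trans (sym (Arc.eq alk)) (trans (sym (at-take j w l ≤-refl)) (sym (subst (λ z → at full z ≡ x) lws (at-last (w' ++ S) x))))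
      pt p p< | yes p<k with p <? j
      ...   | yes p<j = trans (sym (at-take j w p p<j)) (sym (trans (at-++ˡ (w' ++ S) [ x ] p (subst (p <_) (sym lws) p<k))
                          (at-++ˡ w' S p (subst (p <_) (sym lw') p<j))))
      ...   | no p≮j with m+[n∸m]≡n (≮⇒≥ p≮j)
      ...     | pp = trans (cong (at w) (sym pp)) (trans (sym (atr (p ∸ j))) (trans (fresh (p ∸ j) t<m)
                   (sym (trans (at-++ˡ (w' ++ S) [ x ] p (subst (p <_) (sym lws) p<k))
                     (trans (cong (at (w' ++ S)) (sym (trans (cong (_+ (p ∸ j)) lw') pp))) (trans (at-++ʳ w' S (p ∸ j)) (at-consecutive B m (p ∸ j) t<m)))))))
        where
        t<m : p ∸ j < m
        t<m = +-cancelˡ-< j _ _ (subst (_< j + m) (sym pp) (subst (p <_) (sym jm) p<k))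
    nw' : PncnArcs w'
    nw' = proj₁ (PncnArcs-++⁻ {w'} {rest} (subst PncnArcs (sym ew) (proj₁ (proj₂ (proj₂ pw)))))
    iw' : Indecomposable w'
    iw' c 0<c c<n ct = iw c 0<c (<-trans c<j (<-≤-trans (s≤s j≤k) (≤-reflexive (sym lw)))) ctw
      where
      c<j : c < j
      c<j = subst (c <_) lw' c<n
      ctw : Cut w c
      ctw i q i<n q<n e i<c with q <? j
      ... | yes q<j = ct i q (subst (i <_) (sym lw') (<-trans i<c c<j)) (subst (q <_) (sym lw') q<j)
                        (trans (at-take j w i (<-trans i<c c<j)) (trans e (sym (at-take j w q q<j)))) i<c
      ... | no q≮j with q <? k
      ...   | yes q<k = ⊥-elim (singleton-inside q (≮⇒≥ q≮j) q<k i i<n (λ e' → <-irrefl refl (<-trans (subst (_< c) e' i<c) (<-≤-trans c<j (≮⇒≥ q≮j)))) e)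
      ...   | no q≮k with ≤-antisym (≤-pred (subst (q <_) lw q<n)) (≮⇒≥ q≮k)
      ...     | refl = ⊥-elim (<-irrefl refl (<-≤-trans (ct i l (subst (i <_) (sym lw') (<-trans i<c c<j)) (subst (l <_) (sym lw') ≤-refl)
                         (trans (at-take j w i (<-trans i<c c<j)) (trans e (trans (sym (Arc.eq alk)) (sym (at-take j w l ≤-refl))))) i<c) (≤-pred c<j)))
    res : PncnPreimage k' w
    res = j , s≤s z≤n , j≤k , w' , (lw' , proj₁ rr , nw' , iw') , eqw

  pncnShrink : ∀ k' w → PncnIndec (suc (suc k')) w → PncnPreimage k' w
  pncnShrink k' w pw with anyUpTo? (λ i → at w i ≟ at w (suc k')) (suc k')
  ... | no none = ⊥-elim (proj₂ (proj₂ (proj₂ pw)) (suc k') (s≤s z≤n) k<n ct)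
    where
    k<n : suc k' < length w
    k<n = subst (suc k' <_) (sym (proj₁ pw)) ≤-refl
    ct : Cut w (suc k')
    ct i q i<n q<n e i<k with q <? suc k'
    ... | yes q<k = q<k
    ... | no q≮k with ≤-antisym (≤-pred (subst (q <_) (proj₁ pw) q<n)) (≮⇒≥ q≮k)
    ...   | refl = ⊥-elim (none (i , i<k , e))
  ... | yes (i0 , i0<k , e) with arc-to {xs = w} e i0<k (subst (suc k' <_) (sym (proj₁ pw)) ≤-refl)
  ...   | l , alk , _ = PncnShrink.res k' w pw l alk

  pncnGrow-sizes-differ : ∀ k' j j' w' w'' → 1 ≤ j → j ≤ suc k' → 1 ≤ j' → j' ≤ suc k' → PncnIndec j w' → PncnIndec j' w'' →
    j < j' → pncnGrow (suc k') j w' ≢ pncnGrow (suc k') j' w''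
  pncnGrow-sizes-differ k' j j' w' w'' 1≤j j≤k 1≤j' j'≤k pw' pw'' j<j' e =
    <-irrefl refl (<-≤-trans S1.x<B (subst (S1.B ≤_) closing-label (S1.atS p (≤-pred (subst (j <_) (S2.sucpred 1≤j') j<j')) p<v1)))
    where
    module S1 = PncnGrow k' j w' 1≤j j≤k pw'
    module S2 = PncnGrow k' j' w'' 1≤j' j'≤k pw''
    p : ℕ
    p = pred j'
    p<k : p < suc k'
    p<k = <-≤-trans S2.pj< j'≤k
    p<v1 : p < length S1.v
    p<v1 = subst (p <_) (sym S1.lv) p<k
    p<v2 : p < length S2.v
    p<v2 = subst (p <_) (sym S2.lv) p<k
    closing-label : at S1.v p ≡ S1.x
    closing-label = trans (sym (at-++ˡ S1.v [ S1.x ] p p<v1)) (trans (cong (λ z → at z p) e) (trans (at-++ˡ S2.v [ S2.x ] p p<v2)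
              (trans (proj₁ (proj₂ S2.lo)) (trans (sym (subst (λ z → at (S2.v ++ [ S2.x ]) z ≡ S2.x) S2.lv (at-last S2.v S2.x)))
                (trans (cong (λ z → at z (suc k')) (sym e)) (subst (λ z → at (S1.v ++ [ S1.x ]) z ≡ S1.x) S1.lv (at-last S1.v S1.x)))))))

  pncnGrow-injective : ∀ k' j j' w' w'' → 1 ≤ j → j ≤ suc k' → 1 ≤ j' → j' ≤ suc k' → PncnIndec j w' → PncnIndec j' w'' →
         pncnGrow (suc k') j w' ≡ pncnGrow (suc k') j' w'' → j ≡ j' × w' ≡ w''
  pncnGrow-injective k' j j' w' w'' 1≤j j≤k 1≤j' j'≤k pw' pw'' e with <-cmp j j'
  ... | tri< j<j' _ _ = ⊥-elim (pncnGrow-sizes-differ k' j j' w' w'' 1≤j j≤k 1≤j' j'≤k pw' pw'' j<j' e)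
  ... | tri> _ _ j'<j = ⊥-elim (pncnGrow-sizes-differ k' j' j w'' w' 1≤j' j'≤k 1≤j j≤k pw'' pw' j'<j (sym e))
  ... | tri≈ _ refl _ = refl , proj₁ (++-injective w' _ w'' _ (trans (proj₁ pw') (sym (proj₁ pw'')))
          (proj₁ (++-injective _ _ _ _ (trans (PncnGrow.lv k' j w' 1≤j j≤k pw') (sym (PncnGrow.lv k' j w'' 1≤j j≤k pw''))) e)))

  module PncnEnumeration = IndecomposableEnumeration.GrowthEnumeration PncnIndec pncnGrow pncnBase-unique pncnBase pncnShrink pncnGrow-closed pncnGrow-injective

open import Defs
open import Data.Nat using (ℕ; suc; _*_; _<_)
open import Data.Vec using (Vec; toList)
open import Data.Vec.Properties using (length-toList)
open import Data.List using (length)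
open import Data.Product using (_×_; _,_)
open import Relation.Binary.PropositionalEquality using (refl; subst; sym)
open ArcConditions
open ListEncoding
open TotallyNestedArcs using (componentsTN⇒QArcs)
open ArcsTotallyNested using (QArcs⇒componentsTN)
open Concatenation
open IndecomposableTotallyNested
open FibonacciConvolution using (fibOdd)
open Cardinality
open QIndecomposables using (module QEnumeration)
open PncnIndecomposables using (module PncnEnumeration)

module QCounting = ComponentCounting QArcs (short⇒QArcs []-short) QArcs-++⁻ QArcs-++⁺
  Shift.QArcs-unshift Shift.QArcs-shift
  QEnumeration.enumeration QEnumeration.enumeration-sound QEnumeration.enumeration-complete
  QEnumeration.enumeration-unique QEnumeration.enumeration-length refl

module PncnCounting = ComponentCounting PncnArcs (short⇒PncnArcs []-short) PncnArcs-++⁻ PncnArcs-++⁺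
  Shift.PncnArcs-unshift Shift.PncnArcs-shift
  PncnEnumeration.enumeration PncnEnumeration.enumeration-sound PncnEnumeration.enumeration-complete
  PncnEnumeration.enumeration-unique PncnEnumeration.enumeration-length refl

inQ⇒QArcs : ∀ {n} (v : Vec ℕ n) → InQ v → RGSFrom 0 (toList v) × QArcs (toList v)
inQ⇒QArcs v (r , c) = r , componentsTN⇒QArcs (FromVec.ctnTo v c)

QArcs⇒inQ : ∀ {n} (v : Vec ℕ n) → RGSFrom 0 (toList v) → QArcs (toList v) → InQ v
QArcs⇒inQ v r nl = r , FromVec.ctnFrom v (QArcs⇒componentsTN nl)

inPncn⇒PncnArcs : ∀ {n} (v : Vec ℕ n) → InPncn v → RGSFrom 0 (toList v) × PncnArcs (toList v)
inPncn⇒PncnArcs v (r , nc , nn) = r , FromVec.ncnTo v nc , FromVec.nnTo v nn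

PncnArcs⇒inPncn : ∀ {n} (v : Vec ℕ n) → RGSFrom 0 (toList v) → PncnArcs (toList v) → InPncn v
PncnArcs⇒inPncn v r (nc , nn) = r , FromVec.ncnFrom v nc , FromVec.nnFrom v nn

TotallyNestedPart : DecoratedPart → Set
TotallyNestedPart (k , w) = 0 < k × IsPartition w × TotallyNested w

totallyNested⇒goodPart : ∀ p → TotallyNestedPart p → QCounting.GoodPart p
totallyNested⇒goodPart (k , w) (0<k , r , tn) = 0<k , r , tn⇒QArcs tn′ , tn⇒indecomposable tn′
  where
  tn′ : TotallyNestedL (toList w) 0 (length (toList w))
  tn′ = subst (TotallyNestedL (toList w) 0) (sym (length-toList w)) (FromVec.tnTo w tn)

goodPart⇒totallyNested : ∀ p → QCounting.GoodPart p → TotallyNestedPart p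
goodPart⇒totallyNested (k , w) (0<k , r , nl , ind) =
  0<k , r , FromVec.tnFrom w (subst (TotallyNestedL (toList w) 0) (length-toList w) (QArcs⇒tn nl ind))

Q-card : ∀ n → HasCard {Vec ℕ n} InQ (fibOdd n)
Q-card n = QCounting.Count.card InQ inQ⇒QArcs QArcs⇒inQ

Pncn-card : ∀ n → HasCard {Vec ℕ n} InPncn (fibOdd n)
Pncn-card n = PncnCounting.Count.card InPncn inPncn⇒PncnArcs PncnArcs⇒inPncn

Q↔decoratedCompositions : ∀ n → Bijection {Vec ℕ n} InQ (IsDecoratedComposition n)
Q↔decoratedCompositions n =
  QCounting.Count.Decorations.bijection InQ inQ⇒QArcs QArcs⇒inQ TotallyNestedPart totallyNested⇒goodPart goodPart⇒totallyNested

corollary5p4 : (m : ℕ) →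
    HasCard {Vec ℕ (suc m)} InQ (fib (suc (2 * m)))
    × HasCard {Vec ℕ (suc m)} InPncn (fib (suc (2 * m)))
    × Bijection {Vec ℕ (suc m)} InQ (IsDecoratedComposition (suc m))
corollary5p4 m = Q-card (suc m) , Pncn-card (suc m) , Q↔decoratedCompositions (suc m)
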